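{- Let $G$ be a \textsf{MELL} proof-net, let $n\in\mathbb{N}$ and let $e\in B_G$ with $\partial(e)\leq n$. Suppose every cut of $G$ at levels $0$ to $n-1$ is a $W$-cut and every cut of $G$ at level $n$ is either a $W$-cut or a $!$-cut. Then the only canonical sequence for $e$ is $U_e=\mathsf{e}\cdot\ldots\cdot\mathsf{e}$ ($\partial(e)$ times), and the only copy of $e$ on $U_e$ is $\mathsf{e}$.
   Context: Formulas: $A::=\alpha\mid A\multimap A\mid A\otimes A\mid\, !A\mid\forall\alpha.A$. \textsf{MELL}: intuitionistic sequent calculus with axiom, cut, weakening $W$, contraction $X$ (on $!A$), $R_\multimap,L_\multimap,R_\otimes,L_\otimes$, promotion (from $A_1,\dots,A_n\vdash B$ to $!A_1,\dots,!A_n\vdash !B$), dereliction $D$ (from $A,\Gamma\vdash B$ to $!A,\Gamma\vdash B$), digging $N$ (from $!!A,\Gamma\vdash B$ to $!A,\Gamma\vdash B$), $R_\forall,L_\forall$. Proof-nets: graph representation of derivations, vertices labelled in $\{R_\multimap,L_\multimap,R_\otimes,L_\otimes,R_\forall,L_\forall,R_!,L_!,W,X,D,N,P,C\}$, edges $E_G$ labelled by formulas; one $P$-vertex per hypothesis, one $C$-vertex for the conclusion (each with one edge); one vertex per logical/structural rule instance; axioms and cuts are edges. Promotion creates a box: $R_!$-vertex with internal edge $B$ and external edge $!B$ (box-edge), one $L_!$-vertex per premise with internal edge $A_i$ and external edge $!A_i$. $B_G$: box-edges; $\theta_G(x)$: $R_!$-vertex of innermost box containing $x$; $\rho_G(v)$: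 box-edge of the box with $R_!$-vertex $v$; $\partial(e)$: box-depth of $e$; the level of a cut is the box-depth of its cut edge. An $S$-cut ($S\in\{\multimap,\otimes,\forall,!,X,D,N,W\}$) is a cut reducible by the corresponding standard cut-elimination step: a $W$-cut is between a box-edge and a weakening vertex; a $!$-cut is between a box-edge and an $L_!$-vertex of another box. Context semantics: exponential signatures $t::=\mathsf{e}\mid\mathsf{r}(t)\mid\mathsf{l}(t)\mid\mathsf{p}(t)\mid\mathsf{n}(t,t)$; standard = no $\mathsf{p}$. $\sqsubseteq$: least relation with $\mathsf{e}\sqsubseteq\mathsf{e}$; $\mathsf{r}(t)\sqsubseteq\mathsf{r}(u)$, $\mathsf{l}(t)\sqsubseteq\mathsf{l}(u)$, $\mathsf{p}(t)\sqsubseteq\mathsf{p}(u)$ iff $t\sqsubseteq u$; $\mathsf{p}(t)\sqsubseteq\mathsf{n}(u,v)$ iff $t\sqsubseteq v$; $\mathsf{n}(t,u)\sqsubseteq\mathsf{n}(v,w)$ iff $t\sqsubseteq v$, $u=w$. Stack elements: exponential signatures and $\mathsf{a},\mathsf{o},\mathsf{s},\mathsf{f},\mathsf{x}$. Contexts $(e,U,V,b)$, $e\in E_G$, $U$ finite sequence of signatures, $V$ nonempty sequence of stack elements, $b\in\{+,-\}$. $\longmapsto_G$: least relation containing these and their duals (dual of $(e,U,V,b)\mapsto(g,W,Z,c)$ is $(g,W,Z,c\!\downarrow)\mapsto(e,U,V,b\!\downarrow)$, $\pm\!\downarrow=\mp$): $R_\multimap$ ($a:A,b':B,c:A\multimap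 B$): $(a,U,V,-)\mapsto(c,U,V\cdot\mathsf{a},+)$, $(b',U,V,+)\mapsto(c,U,V\cdot\mathsf{o},+)$; $L_\multimap$ ($c:A\multimap B,a:A,b':B$): $(c,U,V\cdot\mathsf{a},+)\mapsto(a,U,V,-)$, $(c,U,V\cdot\mathsf{o},+)\mapsto(b',U,V,+)$; $R_\otimes$ ($a:A,b':B,c:A\otimes B$): $(a,U,V,+)\mapsto(c,U,V\cdot\mathsf{f},+)$, $(b',U,V,+)\mapsto(c,U,V\cdot\mathsf{x},+)$; $L_\otimes$: $(c,U,V\cdot\mathsf{f},+)\mapsto(a,U,V,+)$, $(c,U,V\cdot\mathsf{x},+)\mapsto(b',U,V,+)$; $R_\forall$ ($a:A,c:\forall\alpha.A$): $(a,U,V,+)\mapsto(c,U,V\cdot\mathsf{s},+)$; $L_\forall$ ($c:\forall\alpha.A,a:A\{B/\alpha\}$): $(c,U,V\cdot\mathsf{s},+)\mapsto(a,U,V,+)$; $X$ (contracted $c:!A$, copies $a,b'$): $(c,U,V\cdot\mathsf{l}(t),+)\mapsto(a,U,V\cdot t,+)$, $(c,U,V\cdot\mathsf{r}(t),+)\mapsto(b',U,V\cdot t,+)$; $D$ ($c:!A,a:A$): $(c,U,V\cdot\mathsf{e},+)\mapsto(a,U,V,+)$; $N$ ($c:!A,a:!!A$): $(c,U,V\cdot\mathsf{n}(t,u),+)\mapsto(a,U,V\cdot t\cdot u,+)$, $(c,U,\mathsf{p}(t),+)\mapsto(a,U,t,+)$; box (box-edge $c$, internal conclusion edge $a$; per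 premise internal $a'$, external $c'$): $(c,U,V\cdot t,+)\mapsto(a,U\cdot t,V,+)$, $(a',U\cdot t,V,+)\mapsto(c',U,V\cdot t,+)$, $(c,U,t,+)\mapsto(c',U,t,+)$. Final stacks: positive final: $\mathsf{e}$; $V\cdot\mathsf{a}$ ($V$ negative final); $V\cdot s$, $s\in\{\mathsf{o},\mathsf{f},\mathsf{x},\mathsf{s}\}$ ($V$ positive final); $V\cdot\mathsf{e}$ ($V$ positive final). Negative final: $V\cdot\mathsf{a}$ ($V$ positive final); $V\cdot s$, $s\in\{\mathsf{o},\mathsf{f},\mathsf{x},\mathsf{s}\}$ ($V$ negative final); $V\cdot t$ ($V$ negative final). Final contexts: $(e,U,V,+)$, $e$ the edge of a $W$- or of the $C$-vertex, $V$ positive final; $(e,U,\mathsf{e},+)$, $e$ the $!A$-edge of a $D$-vertex; $(e,U,V,-)$, $e$ the edge of a $P$-vertex, $V$ negative final. A copy for $e\in B_G$ on $U$ is a standard $t$ with: for all $u\sqsubseteq t$, $(e,U,u,+)\longmapsto_G^*C$, $C$ final. Canonical sequences $L_G(x)$: $\{\varepsilon\}$ if $\theta_G(x)$ undefined, else $\{V\cdot t\mid V\in L_G(\rho_G(\theta_G(x))),\ t\text{ copy for }\rho_G(\theta_G(x))\text{ on }V\}$. -}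

module Defs where

open import Data.Nat using (ℕ; zero; suc)
open import Data.Bool using (Bool; true; false)
open import Data.Empty using (⊥)
open import Data.Unit using (⊤; tt)
open import Data.Sum using (_⊎_; inj₁; inj₂; [_,_]′)
open import Data.Product using (Σ; _×_; _,_)
open import Data.Maybe using (Maybe; just; nothing)
import Data.Maybe as Maybe
open import Data.List using (List; []; _∷_; _++_; map)
open import Relation.Binary.PropositionalEquality using (_≡_; _≢_)
open import Relation.Binary.Construct.Closure.ReflexiveTransitive using (Star)

-- Formulas  A ::= α | A ⊸ A | A ⊗ A | !A | ∀α.A   (de Bruijn variables)

infixr 6 _⊸_
infixr 7 _⊗_

data Form : Set where
  var  : ℕ → Form
  _⊸_  : Form → Form → Form
  _⊗_  : Form → Form → Form
  !_   : Form → Form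
  ∀'   : Form → Form

ext : (ℕ → ℕ) → ℕ → ℕ
ext ρ zero    = zero
ext ρ (suc k) = suc (ρ k)

ren : (ℕ → ℕ) → Form → Form
ren ρ (var k) = var (ρ k)
ren ρ (A ⊸ B) = ren ρ A ⊸ ren ρ B
ren ρ (A ⊗ B) = ren ρ A ⊗ ren ρ B
ren ρ (! A)   = ! ren ρ A
ren ρ (∀' A)  = ∀' (ren (ext ρ) A)

exts : (ℕ → Form) → ℕ → Form
exts σ zero    = var zero
exts σ (suc k) = ren suc (σ k)

sub : (ℕ → Form) → Form → Form
sub σ (var k) = σ k
sub σ (A ⊸ B) = sub σ A ⊸ sub σ B
sub σ (A ⊗ B) = sub σ A ⊗ sub σ B
sub σ (! A)   = ! sub σ A
sub σ (∀' A)  = ∀' (sub (exts σ) A)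

-- A{B/α} where α is the variable bound by the ∀
_⟦_⟧ : Form → Form → Form
A ⟦ B ⟧ = sub σ A
  where
  σ : ℕ → Form
  σ zero    = B
  σ (suc k) = var k

-- MELL intuitionistic sequent calculus (Γ a list; an explicit exchange
-- rule, which creates no vertex in the proof-net, handles permutations).

infix 4 _⊢_

data _⊢_ : List Form → Form → Set where
  ax   : ∀ {A} → A ∷ [] ⊢ A
  cut  : ∀ {Γ Δ A B} → Γ ⊢ A → A ∷ Δ ⊢ B → Γ ++ Δ ⊢ B
  exch : ∀ Γ {Δ A B C} → Γ ++ A ∷ B ∷ Δ ⊢ C → Γ ++ B ∷ A ∷ Δ ⊢ C
  W    : ∀ {Γ A B} → Γ ⊢ B → ! A ∷ Γ ⊢ B
  X    : ∀ {Γ A B} → ! A ∷ ! A ∷ Γ ⊢ B → ! A ∷ Γ ⊢ B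
  R⊸   : ∀ {Γ A B} → A ∷ Γ ⊢ B → Γ ⊢ A ⊸ B
  L⊸   : ∀ {Γ Δ A B C} → Γ ⊢ A → B ∷ Δ ⊢ C → A ⊸ B ∷ Γ ++ Δ ⊢ C
  R⊗   : ∀ {Γ Δ A B} → Γ ⊢ A → Δ ⊢ B → Γ ++ Δ ⊢ A ⊗ B
  L⊗   : ∀ {Γ A B C} → A ∷ B ∷ Γ ⊢ C → A ⊗ B ∷ Γ ⊢ C
  P    : ∀ {Γ B} → Γ ⊢ B → map !_ Γ ⊢ ! B
  D    : ∀ {Γ A B} → A ∷ Γ ⊢ B → ! A ∷ Γ ⊢ B
  N    : ∀ {Γ A B} → ! ! A ∷ Γ ⊢ B → ! A ∷ Γ ⊢ B
  R∀   : ∀ {Γ A} → map (ren suc) Γ ⊢ A → Γ ⊢ ∀' A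
  L∀   : ∀ {Γ A B C} → A ⟦ B ⟧ ∷ Γ ⊢ C → ∀' A ∷ Γ ⊢ C

data Pos : List Form → Set where
  here  : ∀ {A Γ} → Pos (A ∷ Γ)
  there : ∀ {A Γ} → Pos Γ → Pos (A ∷ Γ)

splitPos : ∀ Γ {Δ} → Pos (Γ ++ Δ) → Pos Γ ⊎ Pos Δ
splitPos []      p         = inj₂ p
splitPos (A ∷ Γ) here      = inj₁ here
splitPos (A ∷ Γ) (there p) with splitPos Γ p
... | inj₁ q = inj₁ (there q)
... | inj₂ q = inj₂ q

mapPos : ∀ {f : Form → Form} {Γ} → Pos Γ → Pos (map f Γ)
mapPos here      = here
mapPos (there p) = there (mapPos p)

unmapPos : ∀ {f : Form → Form} Γ → Pos (map f Γ) → Pos Γ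
unmapPos (A ∷ Γ) here      = here
unmapPos (A ∷ Γ) (there p) = there (unmapPos Γ p)

swapPos : ∀ Γ {Δ A B} → Pos (Γ ++ B ∷ A ∷ Δ) → Pos (Γ ++ A ∷ B ∷ Δ)
swapPos []      here              = there here
swapPos []      (there here)      = here
swapPos []      (there (there p)) = there (there p)
swapPos (C ∷ Γ) here              = here
swapPos (C ∷ Γ) (there p)         = there (swapPos Γ p)

-- Every edge is oriented (the orientation along which the polarity + is
-- read in the context semantics) and is identified with its tail port.
-- A vertex is described by its kind together with its incident edges:
-- ports of type T are tails (the edge itself), ports of type H are heads
-- (the edge is the unique g with nxt g ≡ h).

data Shape (T H : Set) : Set where
  R⊸ : (a : T) (b : H) (c : T) → Shape T H   -- a:A, b:B, c:A⊸B
  L⊸ : (c : H) (a : H) (b : T) → Shape T H   -- c:A⊸B, a:A, b:B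
  R⊗ : (a : H) (b : H) (c : T) → Shape T H   -- a:A, b:B, c:A⊗B
  L⊗ : (c : H) (a : T) (b : T) → Shape T H   -- c:A⊗B, a:A, b:B
  R∀ : (a : H) (c : T) → Shape T H           -- a:A, c:∀α.A
  L∀ : (c : H) (a : T) → Shape T H           -- c:∀α.A, a:A{B/α}
  X  : (c : H) (a : T) (b : T) → Shape T H   -- c:!A contracted, copies a, b
  D  : (c : H) (a : T) → Shape T H           -- c:!A, a:A
  N  : (c : H) (a : T) → Shape T H           -- c:!A, a:!!A
  W  : (c : H) → Shape T H                   -- c:!A weakened
  R! : (a : H) (c : T) → Shape T H           -- a:B internal, c:!B box-edge
  L! : (c : H) (a : T) (box : T) → Shape T H -- c:!A external, a:A internal,
                                             -- box = box-edge of its box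

mapSh : ∀ {T H T' H'} → (T → T') → (H → H') → Shape T H → Shape T' H'
mapSh f g (R⊸ a b c) = R⊸ (f a) (g b) (f c)
mapSh f g (L⊸ c a b) = L⊸ (g c) (g a) (f b)
mapSh f g (R⊗ a b c) = R⊗ (g a) (g b) (f c)
mapSh f g (L⊗ c a b) = L⊗ (g c) (f a) (f b)
mapSh f g (R∀ a c)   = R∀ (g a) (f c)
mapSh f g (L∀ c a)   = L∀ (g c) (f a)
mapSh f g (X c a b)  = X (g c) (f a) (f b)
mapSh f g (D c a)    = D (g c) (f a)
mapSh f g (N c a)    = N (g c) (f a)
mapSh f g (W c)      = W (g c)
mapSh f g (R! a c)   = R! (g a) (f c)
mapSh f g (L! c a b) = L! (g c) (f a) (f b)

-- Open nets: the net of a derivation of Γ ⊢ B before adding the P- and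
-- C-vertices.  Tails T / heads H are the internal ports; an element of
-- P (= Pos Γ) stands for the tail of a hypothesis edge (to be attached to
-- a P-vertex), inj₂ tt in the codomain of nxt for the head of the
-- conclusion edge (to be attached to the C-vertex).
-- outer t : box-edge of the innermost box containing t (ρ(θ(t))).
-- dep t   : box-depth of t.
record ONet (Pp : Set) : Set₁ where
  field
    T H V : Set
    nxt   : T ⊎ Pp → H ⊎ ⊤
    shp   : V → Shape T H
    outer : T → Maybe T
    dep   : T → ℕ

-- Closed proof-nets: one P-vertex per hypothesis, one C-vertex.

record Net : Set₁ where
  field
    E H V : Set          -- edges (= tail ports), head ports, vertices
    nxt   : E → H
    shp   : V → Shape E H
    Pv    : Set
    pe    : Pv → E
    cH    : H
    outer : E → Maybe E  -- ρ_G(θ_G(e)) (nothing if θ_G(e) undefined)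
    dep   : E → ℕ

module Construction where
  open ONet


  route : ∀ {H H' : Set} → (H → H') → H' ⊎ ⊤ → H ⊎ ⊤ → H' ⊎ ⊤
  route f k (inj₁ h) = inj₁ (f h)
  route f k (inj₂ _) = k

  liftO : ∀ {T T' : Set} → (T → T') → Maybe T → Maybe T'
  liftO = Maybe.map

  -- One premise; one new vertex whose new ports are a head c (the left
  -- formula it introduces, first hypothesis of the conclusion) and tails
  -- indexed by K (the premise hypotheses it consumes).
  oneUp : ∀ {Γ' Γ A} (K : Set) → ONet (Pos Γ') → (K → Pos Γ')
        → (Pos Γ → Pos Γ')
        → (∀ {T H : Set} → H → (K → T) → Shape T H) → ONet (Pos (A ∷ Γ))
  oneUp K n cons rest sh = record
    { T = T n ⊎ K ; H = H n ⊎ ⊤ ; V = V n ⊎ ⊤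
    ; nxt = λ { (inj₁ (inj₁ t)) → r (nxt n (inj₁ t))
              ; (inj₁ (inj₂ k)) → r (nxt n (inj₂ (cons k)))
              ; (inj₂ here) → inj₁ (inj₂ tt)
              ; (inj₂ (there p)) → r (nxt n (inj₂ (rest p))) }
    ; shp = λ { (inj₁ v) → mapSh inj₁ inj₁ (shp n v)
              ; (inj₂ _) → sh (inj₂ tt) inj₂ }
    ; outer = λ { (inj₁ t) → liftO inj₁ (outer n t) ; (inj₂ _) → nothing }
    ; dep = λ { (inj₁ t) → dep n t ; (inj₂ _) → 0 } }
    where
    r = route inj₁ (inj₂ tt)

  -- cut: the conclusion edge of the first net is glued with the first
  -- hypothesis edge of the second one
  netCut : ∀ Γ {Δ A} → ONet (Pos Γ) → ONet (Pos (A ∷ Δ)) → ONet (Pos (Γ ++ Δ))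
  netCut Γ n m = record
    { T = T n ⊎ T m ; H = H n ⊎ H m ; V = V n ⊎ V m
    ; nxt = λ { (inj₁ (inj₁ t)) → go1 (inj₁ t)
              ; (inj₁ (inj₂ t)) → go2 (inj₁ t)
              ; (inj₂ p) → [ (λ q → go1 (inj₂ q)) , (λ q → go2 (inj₂ (there q))) ]′ (splitPos Γ p) }
    ; shp = λ { (inj₁ v) → mapSh inj₁ inj₁ (shp n v)
              ; (inj₂ v) → mapSh inj₂ inj₂ (shp m v) }
    ; outer = λ { (inj₁ t) → liftO inj₁ (outer n t) ; (inj₂ t) → liftO inj₂ (outer m t) }
    ; dep = λ { (inj₁ t) → dep n t ; (inj₂ t) → dep m t } }
    where
    go2 : T m ⊎ Pos _ → (H n ⊎ H m) ⊎ ⊤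
    go2 x = route inj₂ (inj₂ tt) (nxt m x)
    go1 : T n ⊎ Pos Γ → (H n ⊎ H m) ⊎ ⊤
    go1 x = route inj₁ (go2 (inj₂ here)) (nxt n x)

  netExch : ∀ Γ {Δ A B} → ONet (Pos (Γ ++ A ∷ B ∷ Δ)) → ONet (Pos (Γ ++ B ∷ A ∷ Δ))
  netExch Γ n = record
    { T = T n ; H = H n ; V = V n
    ; nxt = λ { (inj₁ t) → nxt n (inj₁ t) ; (inj₂ p) → nxt n (inj₂ (swapPos Γ p)) }
    ; shp = shp n ; outer = outer n ; dep = dep n }

  -- R⊸ vertex: tail a (consumes the first premise hypothesis), head b
  -- (premise conclusion), tail c (new conclusion)
  netR⊸ : ∀ {Γ A} → ONet (Pos (A ∷ Γ)) → ONet (Pos Γ)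
  netR⊸ n = record
    { T = T n ⊎ Bool ; H = H n ⊎ ⊤ ; V = V n ⊎ ⊤
    ; nxt = λ { (inj₁ (inj₁ t)) → r (nxt n (inj₁ t))
              ; (inj₁ (inj₂ true)) → r (nxt n (inj₂ here))
              ; (inj₁ (inj₂ false)) → inj₂ tt
              ; (inj₂ p) → r (nxt n (inj₂ (there p))) }
    ; shp = λ { (inj₁ v) → mapSh inj₁ inj₁ (shp n v)
              ; (inj₂ _) → R⊸ (inj₂ true) (inj₂ tt) (inj₂ false) }
    ; outer = λ { (inj₁ t) → liftO inj₁ (outer n t) ; (inj₂ _) → nothing }
    ; dep = λ { (inj₁ t) → dep n t ; (inj₂ _) → 0 } }
    where
    r = route inj₁ (inj₁ (inj₂ tt))

  -- R∀ vertex: head a (premise conclusion), tail c (new conclusion)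
  netR∀ : ∀ {Γ} → ONet (Pos (map (ren suc) Γ)) → ONet (Pos Γ)
  netR∀ n = record
    { T = T n ⊎ ⊤ ; H = H n ⊎ ⊤ ; V = V n ⊎ ⊤
    ; nxt = λ { (inj₁ (inj₁ t)) → r (nxt n (inj₁ t))
              ; (inj₁ (inj₂ _)) → inj₂ tt
              ; (inj₂ p) → r (nxt n (inj₂ (mapPos p))) }
    ; shp = λ { (inj₁ v) → mapSh inj₁ inj₁ (shp n v)
              ; (inj₂ _) → R∀ (inj₂ tt) (inj₂ tt) }
    ; outer = λ { (inj₁ t) → liftO inj₁ (outer n t) ; (inj₂ _) → nothing }
    ; dep = λ { (inj₁ t) → dep n t ; (inj₂ _) → 0 } }
    where
    r = route inj₁ (inj₁ (inj₂ tt))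

  -- L⊸ vertex: head c (A⊸B, new first hypothesis), head a (conclusion of
  -- the first premise), tail b (first hypothesis of the second premise)
  netL⊸ : ∀ Γ {Δ A B} → ONet (Pos Γ) → ONet (Pos (B ∷ Δ)) → ONet (Pos (A ⊸ B ∷ Γ ++ Δ))
  netL⊸ Γ n m = record
    { T = T n ⊎ (T m ⊎ ⊤) ; H = H n ⊎ (H m ⊎ Bool) ; V = V n ⊎ (V m ⊎ ⊤)
    ; nxt = λ { (inj₁ (inj₁ t)) → r1 (nxt n (inj₁ t))
              ; (inj₁ (inj₂ (inj₁ t))) → r2 (nxt m (inj₁ t))
              ; (inj₁ (inj₂ (inj₂ _))) → r2 (nxt m (inj₂ here))
              ; (inj₂ here) → inj₁ (inj₂ (inj₂ true))
              ; (inj₂ (there p)) → [ (λ q → r1 (nxt n (inj₂ q))) , (λ q → r2 (nxt m (inj₂ (there q)))) ]′ (splitPos Γ p) }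
    ; shp = λ { (inj₁ v) → mapSh inj₁ inj₁ (shp n v)
              ; (inj₂ (inj₁ v)) → mapSh (λ t → inj₂ (inj₁ t)) (λ h → inj₂ (inj₁ h)) (shp m v)
              ; (inj₂ (inj₂ _)) → L⊸ (inj₂ (inj₂ true)) (inj₂ (inj₂ false)) (inj₂ (inj₂ tt)) }
    ; outer = λ { (inj₁ t) → liftO inj₁ (outer n t)
                ; (inj₂ (inj₁ t)) → liftO (λ u → inj₂ (inj₁ u)) (outer m t)
                ; (inj₂ (inj₂ _)) → nothing }
    ; dep = λ { (inj₁ t) → dep n t ; (inj₂ (inj₁ t)) → dep m t ; (inj₂ (inj₂ _)) → 0 } }
    where
    r1 = route inj₁ (inj₁ (inj₂ (inj₂ false)))
    r2 = route (λ h → inj₂ (inj₁ h)) (inj₂ tt)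

  -- R⊗ vertex: heads a, b (premise conclusions), tail c (new conclusion)
  netR⊗ : ∀ Γ {Δ} → ONet (Pos Γ) → ONet (Pos Δ) → ONet (Pos (Γ ++ Δ))
  netR⊗ Γ n m = record
    { T = T n ⊎ (T m ⊎ ⊤) ; H = H n ⊎ (H m ⊎ Bool) ; V = V n ⊎ (V m ⊎ ⊤)
    ; nxt = λ { (inj₁ (inj₁ t)) → r1 (nxt n (inj₁ t))
              ; (inj₁ (inj₂ (inj₁ t))) → r2 (nxt m (inj₁ t))
              ; (inj₁ (inj₂ (inj₂ _))) → inj₂ tt
              ; (inj₂ p) → [ (λ q → r1 (nxt n (inj₂ q))) , (λ q → r2 (nxt m (inj₂ q))) ]′ (splitPos Γ p) }
    ; shp = λ { (inj₁ v) → mapSh inj₁ inj₁ (shp n v)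
              ; (inj₂ (inj₁ v)) → mapSh (λ t → inj₂ (inj₁ t)) (λ h → inj₂ (inj₁ h)) (shp m v)
              ; (inj₂ (inj₂ _)) → R⊗ (inj₂ (inj₂ true)) (inj₂ (inj₂ false)) (inj₂ (inj₂ tt)) }
    ; outer = λ { (inj₁ t) → liftO inj₁ (outer n t)
                ; (inj₂ (inj₁ t)) → liftO (λ u → inj₂ (inj₁ u)) (outer m t)
                ; (inj₂ (inj₂ _)) → nothing }
    ; dep = λ { (inj₁ t) → dep n t ; (inj₂ (inj₁ t)) → dep m t ; (inj₂ (inj₂ _)) → 0 } }
    where
    r1 = route inj₁ (inj₁ (inj₂ (inj₂ true)))
    r2 = route (λ h → inj₂ (inj₁ h)) (inj₁ (inj₂ (inj₂ false)))

  -- promotion: a box.  R!-vertex: head a (internal conclusion), tail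
  -- inj₁ tt (box-edge).  One L!-vertex per premise i : Pos Γ with head i
  -- (external edge !A_i) and tail i (internal edge A_i).
  netP : ∀ Γ → ONet (Pos Γ) → ONet (Pos (map !_ Γ))
  netP Γ n = record
    { T = T n ⊎ (⊤ ⊎ Pos Γ) ; H = H n ⊎ (⊤ ⊎ Pos Γ) ; V = V n ⊎ (⊤ ⊎ Pos Γ)
    ; nxt = λ { (inj₁ (inj₁ t)) → r (nxt n (inj₁ t))
              ; (inj₁ (inj₂ (inj₁ _))) → inj₂ tt
              ; (inj₁ (inj₂ (inj₂ i))) → r (nxt n (inj₂ i))
              ; (inj₂ p) → inj₁ (inj₂ (inj₂ (unmapPos Γ p))) }
    ; shp = λ { (inj₁ v) → mapSh inj₁ inj₁ (shp n v)
              ; (inj₂ (inj₁ _)) → R! (inj₂ (inj₁ tt)) (inj₂ (inj₁ tt))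
              ; (inj₂ (inj₂ i)) → L! (inj₂ (inj₂ i)) (inj₂ (inj₂ i)) (inj₂ (inj₁ tt)) }
    ; outer = λ { (inj₁ t) → just (Maybe.maybe inj₁ (inj₂ (inj₁ tt)) (outer n t))
                ; (inj₂ (inj₁ _)) → nothing
                ; (inj₂ (inj₂ _)) → just (inj₂ (inj₁ tt)) }
    ; dep = λ { (inj₁ t) → suc (dep n t) ; (inj₂ (inj₁ _)) → 0 ; (inj₂ (inj₂ _)) → 1 } }
    where
    r = route inj₁ (inj₁ (inj₂ (inj₁ tt)))

  onet : ∀ {Γ B} → Γ ⊢ B → ONet (Pos Γ)
  onet ax = record
    { T = ⊥ ; H = ⊥ ; V = ⊥
    ; nxt = λ { (inj₁ ()) ; (inj₂ _) → inj₂ tt }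
    ; shp = λ () ; outer = λ () ; dep = λ () }
  onet (cut {Γ} d₁ d₂) = netCut Γ (onet d₁) (onet d₂)
  onet (exch Γ d) = netExch Γ (onet d)
  onet (W d) = oneUp ⊥ (onet d) (λ ()) (λ p → p) (λ c _ → W c)
  onet (X d) = oneUp Bool (onet d) (λ { true → here ; false → there here })
                 (λ p → there (there p)) (λ c k → X c (k true) (k false))
  onet (R⊸ d) = netR⊸ (onet d)
  onet (L⊸ {Γ} d₁ d₂) = netL⊸ Γ (onet d₁) (onet d₂)
  onet (R⊗ {Γ} d₁ d₂) = netR⊗ Γ (onet d₁) (onet d₂)
  onet (L⊗ d) = oneUp Bool (onet d) (λ { true → here ; false → there here })
                  (λ p → there (there p)) (λ c k → L⊗ c (k true) (k false))
  onet (P {Γ} d) = netP Γ (onet d)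
  onet (D d) = oneUp ⊤ (onet d) (λ _ → here) there (λ c k → D c (k tt))
  onet (N d) = oneUp ⊤ (onet d) (λ _ → here) there (λ c k → N c (k tt))
  onet (R∀ d) = netR∀ (onet d)
  onet (L∀ d) = oneUp ⊤ (onet d) (λ _ → here) there (λ c k → L∀ c (k tt))

  PN : ∀ {Γ B} → Γ ⊢ B → Net
  PN {Γ} d = record
    { E = T n ⊎ Pos Γ ; H = H n ⊎ ⊤ ; V = V n
    ; nxt = nxt n
    ; shp = λ v → mapSh inj₁ inj₁ (shp n v)
    ; Pv = Pos Γ ; pe = inj₂ ; cH = inj₂ tt
    ; outer = λ { (inj₁ t) → liftO inj₁ (outer n t) ; (inj₂ _) → nothing }
    ; dep = λ { (inj₁ t) → dep n t ; (inj₂ _) → 0 } }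
    where
    n = onet d


open Construction public using (onet; PN)

-- Context semantics

-- exponential signatures  t ::= e | r(t) | l(t) | p(t) | n(t,t)
data Sig : Set where
  sE : Sig
  sR sL sP : Sig → Sig
  sN : Sig → Sig → Sig

-- standard = no p
data Std : Sig → Set where
  stdE : Std sE
  stdR : ∀ {t} → Std t → Std (sR t)
  stdL : ∀ {t} → Std t → Std (sL t)
  stdN : ∀ {t u} → Std t → Std u → Std (sN t u)

infix 4 _⊑_
data _⊑_ : Sig → Sig → Set where
  ⊑E  : sE ⊑ sE
  ⊑R  : ∀ {t u} → t ⊑ u → sR t ⊑ sR u
  ⊑L  : ∀ {t u} → t ⊑ u → sL t ⊑ sL u
  ⊑P  : ∀ {t u} → t ⊑ u → sP t ⊑ sP u
  ⊑PN : ∀ {t u v} → t ⊑ v → sP t ⊑ sN u v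
  ⊑NN : ∀ {t u v} → t ⊑ v → sN t u ⊑ sN v u

data SE : Set where
  sig : Sig → SE
  ‵a ‵o ‵s ‵f ‵x : SE

-- finite sequences, extended on the right (U · t)
infixl 5 _▷_
data Snoc (A : Set) : Set where
  ∅   : Snoc A
  _▷_ : Snoc A → A → Snoc A

-- nonempty sequences of stack elements (V · t)
infixl 5 _▶_
data Stk : Set where
  [_] : SE → Stk
  _▶_ : Stk → SE → Stk

data Pol : Set where
  pos neg : Pol

flip : Pol → Pol
flip pos = neg
flip neg = pos

record Ctx (G : Net) : Set where
  constructor ⟨_,_,_,_⟩
  field
    edge : Net.E G
    U    : Snoc Sig
    stk  : Stk
    pol  : Pol

dual : ∀ {G} → Ctx G → Ctx G
dual ⟨ e , U , V , b ⟩ = ⟨ e , U , V , flip b ⟩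

module _ (G : Net) where
  open Net G

  -- the basic transitions of ↦_G (duals are added below)
  data Step₀ : Ctx G → Ctx G → Set where
    r⊸a : ∀ {v a b c U V} → shp v ≡ R⊸ a b c →
          Step₀ ⟨ a , U , V , neg ⟩ ⟨ c , U , V ▶ ‵a , pos ⟩
    r⊸b : ∀ {v a b c g U V} → shp v ≡ R⊸ a b c → nxt g ≡ b →
          Step₀ ⟨ g , U , V , pos ⟩ ⟨ c , U , V ▶ ‵o , pos ⟩
    l⊸a : ∀ {v c a b g g' U V} → shp v ≡ L⊸ c a b → nxt g ≡ c → nxt g' ≡ a →
          Step₀ ⟨ g , U , V ▶ ‵a , pos ⟩ ⟨ g' , U , V , neg ⟩
    l⊸b : ∀ {v c a b g U V} → shp v ≡ L⊸ c a b → nxt g ≡ c →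
          Step₀ ⟨ g , U , V ▶ ‵o , pos ⟩ ⟨ b , U , V , pos ⟩
    r⊗a : ∀ {v a b c g U V} → shp v ≡ R⊗ a b c → nxt g ≡ a →
          Step₀ ⟨ g , U , V , pos ⟩ ⟨ c , U , V ▶ ‵f , pos ⟩
    r⊗b : ∀ {v a b c g U V} → shp v ≡ R⊗ a b c → nxt g ≡ b →
          Step₀ ⟨ g , U , V , pos ⟩ ⟨ c , U , V ▶ ‵x , pos ⟩
    l⊗a : ∀ {v c a b g U V} → shp v ≡ L⊗ c a b → nxt g ≡ c →
          Step₀ ⟨ g , U , V ▶ ‵f , pos ⟩ ⟨ a , U , V , pos ⟩
    l⊗b : ∀ {v c a b g U V} → shp v ≡ L⊗ c a b → nxt g ≡ c →
          Step₀ ⟨ g , U , V ▶ ‵x , pos ⟩ ⟨ b , U , V , pos ⟩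
    r∀  : ∀ {v a c g U V} → shp v ≡ R∀ a c → nxt g ≡ a →
          Step₀ ⟨ g , U , V , pos ⟩ ⟨ c , U , V ▶ ‵s , pos ⟩
    l∀  : ∀ {v c a g U V} → shp v ≡ L∀ c a → nxt g ≡ c →
          Step₀ ⟨ g , U , V ▶ ‵s , pos ⟩ ⟨ a , U , V , pos ⟩
    -- contraction; the prefix V of V·l(t) may be empty
    xl  : ∀ {v c a b g U V t} → shp v ≡ X c a b → nxt g ≡ c →
          Step₀ ⟨ g , U , V ▶ sig (sL t) , pos ⟩ ⟨ a , U , V ▶ sig t , pos ⟩
    xl₀ : ∀ {v c a b g U t} → shp v ≡ X c a b → nxt g ≡ c →
          Step₀ ⟨ g , U , [ sig (sL t) ] , pos ⟩ ⟨ a , U , [ sig t ] , pos ⟩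
    xr  : ∀ {v c a b g U V t} → shp v ≡ X c a b → nxt g ≡ c →
          Step₀ ⟨ g , U , V ▶ sig (sR t) , pos ⟩ ⟨ b , U , V ▶ sig t , pos ⟩
    xr₀ : ∀ {v c a b g U t} → shp v ≡ X c a b → nxt g ≡ c →
          Step₀ ⟨ g , U , [ sig (sR t) ] , pos ⟩ ⟨ b , U , [ sig t ] , pos ⟩
    der : ∀ {v c a g U V} → shp v ≡ D c a → nxt g ≡ c →
          Step₀ ⟨ g , U , V ▶ sig sE , pos ⟩ ⟨ a , U , V , pos ⟩
    -- digging; the prefix V of V·n(t,u) may be empty
    dn  : ∀ {v c a g U V t u} → shp v ≡ N c a → nxt g ≡ c →
          Step₀ ⟨ g , U , V ▶ sig (sN t u) , pos ⟩ ⟨ a , U , V ▶ sig t ▶ sig u , pos ⟩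
    dn₀ : ∀ {v c a g U t u} → shp v ≡ N c a → nxt g ≡ c →
          Step₀ ⟨ g , U , [ sig (sN t u) ] , pos ⟩ ⟨ a , U , [ sig t ] ▶ sig u , pos ⟩
    dp  : ∀ {v c a g U t} → shp v ≡ N c a → nxt g ≡ c →
          Step₀ ⟨ g , U , [ sig (sP t) ] , pos ⟩ ⟨ a , U , [ sig t ] , pos ⟩
    -- boxes: entering through a premise (external → internal edge)
    bin : ∀ {v c a bx g U V t} → shp v ≡ L! c a bx → nxt g ≡ c →
          Step₀ ⟨ g , U , V ▶ sig t , pos ⟩ ⟨ a , U ▷ t , V , pos ⟩
    -- exiting through the conclusion (internal conclusion → box-edge)
    bout : ∀ {v a c g U V t} → shp v ≡ R! a c → nxt g ≡ a →
          Step₀ ⟨ g , U ▷ t , V , pos ⟩ ⟨ c , U , V ▶ sig t , pos ⟩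
    -- from a premise to the box-edge when the stack is a single signature
    bjump : ∀ {v c a bx g U t} → shp v ≡ L! c a bx → nxt g ≡ c →
          Step₀ ⟨ g , U , [ sig t ] , pos ⟩ ⟨ bx , U , [ sig t ] , pos ⟩

  _↦_ : Ctx G → Ctx G → Set
  C ↦ C' = Step₀ C C' ⊎ Step₀ (dual C') (dual C)

  _↦*_ : Ctx G → Ctx G → Set
  _↦*_ = Star _↦_

data Mul : SE → Set where
  m‵o : Mul ‵o
  m‵f : Mul ‵f
  m‵x : Mul ‵x
  m‵s : Mul ‵s

data PosFinal : Stk → Set
data NegFinal : Stk → Set

data PosFinal where
  pfE   : PosFinal [ sig sE ]
  pfA   : ∀ {V} → NegFinal V → PosFinal (V ▶ ‵a)
  pfMul : ∀ {V s} → Mul s → PosFinal V → PosFinal (V ▶ s)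
  pfSE  : ∀ {V} → PosFinal V → PosFinal (V ▶ sig sE)

data NegFinal where
  nfA   : ∀ {V} → PosFinal V → NegFinal (V ▶ ‵a)
  nfMul : ∀ {V s} → Mul s → NegFinal V → NegFinal (V ▶ s)
  nfSig : ∀ {V t} → NegFinal V → NegFinal (V ▶ sig t)

module _ (G : Net) where
  open Net G

  data Final : Ctx G → Set where
    finW : ∀ {v c g U V} → shp v ≡ W c → nxt g ≡ c → PosFinal V →
           Final ⟨ g , U , V , pos ⟩
    finC : ∀ {g U V} → nxt g ≡ cH → PosFinal V → Final ⟨ g , U , V , pos ⟩
    finD : ∀ {v c a g U} → shp v ≡ D c a → nxt g ≡ c →
           Final ⟨ g , U , [ sig sE ] , pos ⟩
    finP : ∀ {i U V} → NegFinal V → Final ⟨ pe i , U , V , neg ⟩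

  BoxEdge : E → Set
  BoxEdge e = Σ V λ v → Σ H λ a → shp v ≡ R! a e

  Copy : E → Snoc Sig → Sig → Set
  Copy e U t = Std t × (∀ u → u ⊑ t →
                 Σ (Ctx G) λ C → (_↦*_ G ⟨ e , U , [ sig u ] , pos ⟩ C) × Final C)

  data Canonical : E → Snoc Sig → Set where
    can∅ : ∀ {x} → outer x ≡ nothing → Canonical x ∅
    can▷ : ∀ {x c U t} → outer x ≡ just c → Canonical c U → Copy c U t →
           Canonical x (U ▷ t)

  -- cuts: edges from a vertex introducing a right formula to a vertex
  -- introducing a left formula
  data RIntro : E → Set where
    ri⊸ : ∀ {v a b c} → shp v ≡ R⊸ a b c → RIntro c
    ri⊗ : ∀ {v a b c} → shp v ≡ R⊗ a b c → RIntro c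
    ri∀ : ∀ {v a c} → shp v ≡ R∀ a c → RIntro c
    ri! : ∀ {v a c} → shp v ≡ R! a c → RIntro c

  data LIntro : H → Set where
    li⊸ : ∀ {v c a b} → shp v ≡ L⊸ c a b → LIntro c
    li⊗ : ∀ {v c a b} → shp v ≡ L⊗ c a b → LIntro c
    li∀ : ∀ {v c a} → shp v ≡ L∀ c a → LIntro c
    liX : ∀ {v c a b} → shp v ≡ X c a b → LIntro c
    liD : ∀ {v c a} → shp v ≡ D c a → LIntro c
    liN : ∀ {v c a} → shp v ≡ N c a → LIntro c
    liW : ∀ {v c} → shp v ≡ W c → LIntro c
    li! : ∀ {v c a bx} → shp v ≡ L! c a bx → LIntro c

  IsCut : E → Set
  IsCut e = RIntro e × LIntro (nxt e)

  WCut : E → Set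
  WCut e = BoxEdge e × Σ V λ v → shp v ≡ W (nxt e)

  BangCut : E → Set
  BangCut e = BoxEdge e × Σ V λ v → Σ E λ a → Σ E λ bx →
                (shp v ≡ L! (nxt e) a bx) × (bx ≢ e)

eSeq : ℕ → Snoc Sig
eSeq zero    = ∅
eSeq (suc k) = eSeq k ▷ sE

{-# OPTIONS --safe #-}
-- Every net of a derivation carries a labelling of its ports by kind,
-- box-depth, type skeleton and rank, coherent at each vertex and built by
-- induction on the derivation; the rank is a potential expressing the
-- acyclicity of the net.  Under the cut hypotheses a context on a right
-- conclusion can only flow into a W-vertex (final) or, at level n, into an
-- L!-vertex of another box, and then only with a one-element stack, so it
-- jumps to that box-edge.  Hence (uniqueness) a path started at ⟨e, U, t, +⟩
-- never touches the bottom t of its stack, while every final context has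
-- bottom e, so t = e; and (existence) the path started at ⟨e, U_e, e, +⟩ keeps
-- a final stack whose top, on negative contexts, is an address into the type
-- of the current edge (so every X, N, D, L! vertex finds the signatures it
-- needs), while the rank strictly decreases, so the path reaches a final
-- context.  The canonical sequences follow by induction on the depth.

module Submission where

open import Defs
open import Data.Nat using (ℕ; zero; suc; _+_; _≤_; _<_; z≤n; s≤s)
open import Data.Nat.Properties using (n≤1+n; m≤n⇒m<n∨m≡n; ≤-pred; suc-injective; ≤-refl; ≤-trans; <-irrefl; ≤-reflexive; <⇒≤; <-≤-trans; +-suc; m≤m+n; m≤n+m; +-monoʳ-<; +-mono-≤-<)
open import Data.Empty using (⊥; ⊥-elim)
open import Data.Unit using (⊤; tt)
open import Data.Bool using (Bool; true; false)
open import Data.Sum using (_⊎_; inj₁; inj₂; [_,_]′)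
open import Data.Sum.Properties using (inj₁-injective; inj₂-injective)
open import Data.Product using (Σ; _×_; _,_; proj₁; proj₂)
open import Data.Maybe using (Maybe; just; nothing)
open import Data.Maybe.Properties using (just-injective)
import Data.Maybe as Maybe
open import Data.List using (List; []; _∷_; _++_; map)
open import Function using (_∘_; id)
open import Relation.Nullary using (¬_)
open import Relation.Binary.PropositionalEquality using (_≡_; refl; sym; trans; cong; cong₂; subst; _≢_)
open import Relation.Binary.Construct.Closure.ReflexiveTransitive using (Star; ε; _◅_)

open Construction using (route; liftO)

≡-≢-trans : ∀ {A : Set} {x y z : A} → x ≡ y → y ≢ z → x ≢ z
≡-≢-trans x≡y y≢z x≡z = y≢z (trans (sym x≡y) x≡z)

-- Labelled nets

-- kS x / hS x: the port x of a vertex of shape S (named as in Shape), as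
-- the tail / head of an edge; kP: the edge of a P-vertex, hC: of the C-vertex.
data TailKind : Set where
  kR⊸a kR⊸c kL⊸b kR⊗c kL⊗a kL⊗b kR∀c kL∀a kXa kXb kDa kNa kR!c kL!a kP : TailKind

data HeadKind : Set where
  hR⊸b hL⊸c hL⊸a hR⊗a hR⊗b hL⊗c hR∀a hL∀c hXc hDc hNc hWc hR!a hL!c hC : HeadKind

data RightTail : TailKind → Set where
  rR⊸ : RightTail kR⊸c
  rR⊗ : RightTail kR⊗c
  rR∀ : RightTail kR∀c
  rR! : RightTail kR!c

data LeftTail : TailKind → Set where
  lR⊸a : LeftTail kR⊸a
  lL⊸b : LeftTail kL⊸b
  lL⊗a : LeftTail kL⊗a
  lL⊗b : LeftTail kL⊗b
  lL∀a : LeftTail kL∀a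
  lXa : LeftTail kXa
  lXb : LeftTail kXb
  lDa : LeftTail kDa
  lNa : LeftTail kNa
  lL!a : LeftTail kL!a

data LeftHead : HeadKind → Set where
  hhL⊸c : LeftHead hL⊸c
  hhL⊗c : LeftHead hL⊗c
  hhL∀c : LeftHead hL∀c
  hhXc : LeftHead hXc
  hhDc : LeftHead hDc
  hhNc : LeftHead hNc
  hhWc : LeftHead hWc
  hhL!c : LeftHead hL!c

data WeakOrBox : HeadKind → Set where
  weak : WeakOrBox hWc
  box  : WeakOrBox hL!c

data Skel : Set where
  sv : Skel
  _s⊸_ : Skel → Skel → Skel
  _s⊗_ : Skel → Skel → Skel
  s! : Skel → Skel
  s∀ : Skel → Skel

skeleton : Form → Skel
skeleton (var _) = sv
skeleton (A ⊸ B) = skeleton A s⊸ skeleton B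
skeleton (A ⊗ B) = skeleton A s⊗ skeleton B
skeleton (! A) = s! (skeleton A)
skeleton (∀' A) = s∀ (skeleton A)

-- k ≼ k′: k′ is a substitution instance of k.
data _≼_ : Skel → Skel → Set where
  ≼v : ∀ {k} → sv ≼ k
  ≼⊸ : ∀ {a b c d} → a ≼ c → b ≼ d → (a s⊸ b) ≼ (c s⊸ d)
  ≼⊗ : ∀ {a b c d} → a ≼ c → b ≼ d → (a s⊗ b) ≼ (c s⊗ d)
  ≼! : ∀ {a c} → a ≼ c → s! a ≼ s! c
  ≼∀ : ∀ {a c} → a ≼ c → s∀ a ≼ s∀ c

-- Address k Q: the stack elements Q, top first, trace a path in a formula of
-- skeleton k down to a variable, or stop right after an ‵a.
Address : Skel → List SE → Set
Address sv _ = ⊤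
Address (k s⊸ k') (‵a ∷ []) = ⊤
Address (k s⊸ k') (‵a ∷ y ∷ Q) = Address k (y ∷ Q)
Address (k s⊸ k') (‵o ∷ Q) = Address k' Q
Address (k s⊗ k') (‵f ∷ Q) = Address k Q
Address (k s⊗ k') (‵x ∷ Q) = Address k' Q
Address (s! k) (sig t ∷ Q) = Address k Q
Address (s∀ k) (‵s ∷ Q) = Address k Q
Address _ _ = ⊥

Address-≼ : ∀ {k k'} Q → k ≼ k' → Address k' Q → Address k Q
Address-≼ Q ≼v _ = tt
Address-≼ (‵a ∷ []) (≼⊸ p q) _ = tt
Address-≼ (‵a ∷ y ∷ Q) (≼⊸ p q) v = Address-≼ (y ∷ Q) p v
Address-≼ (‵o ∷ Q) (≼⊸ p q) v = Address-≼ Q q v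
Address-≼ (‵f ∷ Q) (≼⊗ p q) v = Address-≼ Q p v
Address-≼ (‵x ∷ Q) (≼⊗ p q) v = Address-≼ Q q v
Address-≼ (sig t ∷ Q) (≼! p) v = Address-≼ Q p v
Address-≼ (‵s ∷ Q) (≼∀ p) v = Address-≼ Q p v

Address-! : ∀ k Q → Address (s! k) Q → Σ Sig λ t → Σ (List SE) λ Q' → (Q ≡ sig t ∷ Q') × Address k Q'
Address-! k (sig t ∷ Q) v = t , Q , refl , v

record Labelling (E H : Set) : Set where
  field
    tkind : E → TailKind
    hkind : H → HeadKind
    trank : E → ℕ
    hrank : H → ℕ
    tdepth : E → ℕ
    hdepth : H → ℕ
    ttype : E → Skel
    htype : H → Skel

module _ {E H : Set} (labels : Labelling E H) where
  open Labelling labels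

  Coherent : Shape E H → Set
  Coherent (R⊸ a b c) =
    tkind a ≡ kR⊸a × tkind c ≡ kR⊸c × hkind b ≡ hR⊸b ×
    trank a ≡ trank c × hrank b ≡ trank c ×
    tdepth a ≡ tdepth c × hdepth b ≡ tdepth c
  Coherent (L⊸ c a b) =
    hkind c ≡ hL⊸c × hkind a ≡ hL⊸a × tkind b ≡ kL⊸b ×
    hrank c ≡ trank b × hrank a ≡ trank b ×
    hdepth c ≡ tdepth b × hdepth a ≡ tdepth b ×
    Σ Skel (λ k → htype c ≡ k s⊸ ttype b)
  Coherent (R⊗ a b c) =
    hkind a ≡ hR⊗a × hkind b ≡ hR⊗b × tkind c ≡ kR⊗c ×
    hrank a ≡ trank c × hrank b ≡ trank c ×
    hdepth a ≡ tdepth c × hdepth b ≡ tdepth c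
  Coherent (L⊗ c a b) =
    hkind c ≡ hL⊗c × tkind a ≡ kL⊗a × tkind b ≡ kL⊗b ×
    hrank c ≡ trank a × trank b ≡ trank a ×
    hdepth c ≡ tdepth a × tdepth b ≡ tdepth a ×
    htype c ≡ (ttype a s⊗ ttype b)
  Coherent (R∀ a c) =
    hkind a ≡ hR∀a × tkind c ≡ kR∀c ×
    hrank a ≡ trank c ×
    hdepth a ≡ tdepth c
  Coherent (L∀ c a) =
    hkind c ≡ hL∀c × tkind a ≡ kL∀a ×
    hrank c ≡ trank a ×
    hdepth c ≡ tdepth a ×
    Σ Skel (λ k → htype c ≡ s∀ k × k ≼ ttype a)
  Coherent (X c a b) =
    hkind c ≡ hXc × tkind a ≡ kXa × tkind b ≡ kXb ×
    hrank c ≡ trank a × trank b ≡ trank a ×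
    hdepth c ≡ tdepth a × tdepth b ≡ tdepth a ×
    Σ Skel (λ k → htype c ≡ s! k × ttype a ≡ s! k × ttype b ≡ s! k)
  Coherent (D c a) =
    hkind c ≡ hDc × tkind a ≡ kDa ×
    hrank c ≡ trank a ×
    hdepth c ≡ tdepth a ×
    htype c ≡ s! (ttype a)
  Coherent (N c a) =
    hkind c ≡ hNc × tkind a ≡ kNa ×
    hrank c ≡ trank a ×
    hdepth c ≡ tdepth a ×
    Σ Skel (λ k → htype c ≡ s! k × ttype a ≡ s! (s! k))
  Coherent (W c) = hkind c ≡ hWc
  Coherent (R! a c) =
    hkind a ≡ hR!a × tkind c ≡ kR!c ×
    hrank a ≡ trank c ×
    hdepth a ≡ suc (tdepth c)
  Coherent (L! c a bx) =
    hkind c ≡ hL!c × tkind a ≡ kL!a × tkind bx ≡ kR!c ×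
    hrank c ≡ trank a × trank bx ≡ trank a ×
    tdepth a ≡ suc (hdepth c) × tdepth bx ≡ hdepth c ×
    htype c ≡ s! (ttype a)

data HeadIn {T H : Set} (h : H) : Shape T H → Set where
  iR⊸b : ∀ {a c} → HeadIn h (R⊸ a h c)
  iL⊸c : ∀ {a b} → HeadIn h (L⊸ h a b)
  iL⊸a : ∀ {c b} → HeadIn h (L⊸ c h b)
  iR⊗a : ∀ {b c} → HeadIn h (R⊗ h b c)
  iR⊗b : ∀ {a c} → HeadIn h (R⊗ a h c)
  iL⊗c : ∀ {a b} → HeadIn h (L⊗ h a b)
  iR∀a : ∀ {c} → HeadIn h (R∀ h c)
  iL∀c : ∀ {a} → HeadIn h (L∀ h a)
  iXc : ∀ {a b} → HeadIn h (X h a b)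
  iDc : ∀ {a} → HeadIn h (D h a)
  iNc : ∀ {a} → HeadIn h (N h a)
  iWc : HeadIn h (W h)
  iR!a : ∀ {c} → HeadIn h (R! h c)
  iL!c : ∀ {a bx} → HeadIn h (L! h a bx)

data TailIn {T H : Set} (t : T) : Shape T H → Set where
  jR⊸a : ∀ {b c} → TailIn t (R⊸ t b c)
  jR⊸c : ∀ {a b} → TailIn t (R⊸ a b t)
  jL⊸b : ∀ {c a} → TailIn t (L⊸ c a t)
  jR⊗c : ∀ {a b} → TailIn t (R⊗ a b t)
  jL⊗a : ∀ {c b} → TailIn t (L⊗ c t b)
  jL⊗b : ∀ {c a} → TailIn t (L⊗ c a t)
  jR∀c : ∀ {a} → TailIn t (R∀ a t)
  jL∀a : ∀ {c} → TailIn t (L∀ c t)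
  jXa : ∀ {c b} → TailIn t (X c t b)
  jXb : ∀ {c a} → TailIn t (X c a t)
  jDa : ∀ {c} → TailIn t (D c t)
  jNa : ∀ {c} → TailIn t (N c t)
  jR!c : ∀ {a} → TailIn t (R! a t)
  jL!a : ∀ {c bx} → TailIn t (L! c t bx)

module _ {T H V : Set} (shp : V → Shape T H) where
  HeadAttached : H → Set
  HeadAttached h = Σ V λ v → Σ (Shape T H) λ s → (shp v ≡ s) × HeadIn h s

  TailAttached : T → Set
  TailAttached t = Σ V λ v → Σ (Shape T H) λ s → (shp v ≡ s) × TailIn t s

  IsBoxEdge : T → Set
  IsBoxEdge c = Σ V λ w → Σ H λ a → shp w ≡ R! a c

  OuterBox : (T → Maybe T) → (T → ℕ) → T → Set
  OuterBox outer dep t = (outer t ≡ nothing × dep t ≡ 0) ⊎ Σ T (λ c → (outer t ≡ just c) × (dep t ≡ suc (dep c)) × IsBoxEdge c)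

record WellLabelled (G : Net) : Set where
  open Net G
  field
    labels : Labelling E H
  open Labelling labels public
  field
    coherent : ∀ v → Coherent labels (shp v)
    tdepth-dep : ∀ g → tdepth g ≡ dep g
    depth-nxt : ∀ g → tdepth g ≡ hdepth (nxt g)
    type-nxt : ∀ g → ttype g ≡ htype (nxt g)
    rank-right : ∀ g → RightTail (tkind g) → hkind (nxt g) ≢ hC → hrank (nxt g) < trank g
    rank-left : ∀ g → LeftTail (tkind g) → LeftHead (hkind (nxt g)) → trank g < hrank (nxt g)
    head-attached : ∀ h → (h ≡ cH) ⊎ HeadAttached shp h
    tail-attached : ∀ g → (Σ Pv λ i → pe i ≡ g) ⊎ TailAttached shp g
    head-fed : ∀ v s h → shp v ≡ s → HeadIn h s → Σ E λ g → nxt g ≡ h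
    L!-boxEdge : ∀ v c a bx → shp v ≡ L! c a bx → BoxEdge G bx
    outer-box : ∀ g → OuterBox shp outer dep g

data BottomIs (x : SE) : Stk → Set where
  b0 : BottomIs x [ x ]
  bS : ∀ {S y} → BottomIs x S → BottomIs x (S ▶ y)

data IsSig : SE → Set where
  isg : ∀ {t} → IsSig (sig t)

data HasNonSig : Stk → Set where
  nsH : ∀ {S y} → ¬ IsSig y → HasNonSig (S ▶ y)
  nsT : ∀ {S y} → HasNonSig S → HasNonSig (S ▶ y)

posFinal-bottom : ∀ {S} → PosFinal S → BottomIs (sig sE) S
negFinal-bottom : ∀ {S} → NegFinal S → BottomIs (sig sE) S
posFinal-bottom pfE = b0
posFinal-bottom (pfA x) = bS (negFinal-bottom x)
posFinal-bottom (pfMul m x) = bS (posFinal-bottom x)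
posFinal-bottom (pfSE x) = bS (posFinal-bottom x)
negFinal-bottom (nfA x) = bS (posFinal-bottom x)
negFinal-bottom (nfMul m x) = bS (negFinal-bottom x)
negFinal-bottom (nfSig x) = bS (negFinal-bottom x)

bottom-unique : ∀ {x y S} → BottomIs x S → BottomIs y S → x ≡ y
bottom-unique b0 b0 = refl
bottom-unique (bS p) (bS q) = bottom-unique p q

bottom-pop : ∀ {x S y} → BottomIs x (S ▶ y) → BottomIs x S
bottom-pop (bS b) = b

hasNonSig-pop : ∀ {S t} → HasNonSig (S ▶ sig t) → HasNonSig S
hasNonSig-pop (nsH p) = ⊥-elim (p isg)
hasNonSig-pop (nsT p) = p

negFinal-pop : ∀ {S t} → NegFinal (S ▶ sig t) → NegFinal S
negFinal-pop (nfMul () x)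
negFinal-pop (nfSig x) = x

sig-injective : ∀ {t u} → sig t ≡ sig u → t ≡ u
sig-injective refl = refl

infixl 5 _⊕_
_⊕_ : Stk → List SE → Stk
S ⊕ [] = S
S ⊕ (x ∷ Q) = (S ⊕ Q) ▶ x

⊑-refl : ∀ t → t ⊑ t
⊑-refl sE = ⊑E
⊑-refl (sR t) = ⊑R (⊑-refl t)
⊑-refl (sL t) = ⊑L (⊑-refl t)
⊑-refl (sP t) = ⊑P (⊑-refl t)
⊑-refl (sN t u) = ⊑NN (⊑-refl t)

-- Context paths under the cut hypotheses

module Paths (G : Net) (wl : WellLabelled G) (n : ℕ)
  (cuts-below : ∀ c → IsCut G c → Net.dep G c < n → WCut G c)
  (cuts-at : ∀ c → IsCut G c → Net.dep G c ≡ n → WCut G c ⊎ BangCut G c) where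
  open Net G
  open WellLabelled wl

  _⟶_ : Ctx G → Ctx G → Set
  _⟶_ = _↦_ G

  coherentAt : ∀ {v s} → shp v ≡ s → Coherent labels s
  coherentAt {v} refl = coherent v

  dep-head : ∀ {g h} → nxt g ≡ h → dep g ≡ hdepth h
  dep-head {g} refl = trans (sym (tdepth-dep g)) (depth-nxt g)

  dep-across : ∀ {g h x} → nxt g ≡ h → hdepth h ≡ tdepth x → dep x ≡ dep g
  dep-across {x = x} nx q = trans (sym (tdepth-dep x)) (sym (trans (dep-head nx) q))

  type-head : ∀ {g h} → nxt g ≡ h → ttype g ≡ htype h
  type-head {g} refl = type-nxt g

  Address-cast : ∀ {g k Q} → ttype g ≡ k → Address k Q → Address (ttype g) Q
  Address-cast {Q = Q} e = subst (λ k → Address k Q) (sym e)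

  rightIntro-rightTail : ∀ {g} → RIntro G g → RightTail (tkind g)
  rightIntro-rightTail (ri⊸ eq) = let (_ , kc , _) = coherentAt eq in subst RightTail (sym kc) rR⊸
  rightIntro-rightTail (ri⊗ eq) = let (_ , _ , kc , _) = coherentAt eq in subst RightTail (sym kc) rR⊗
  rightIntro-rightTail (ri∀ eq) = let (_ , kc , _) = coherentAt eq in subst RightTail (sym kc) rR∀
  rightIntro-rightTail (ri! eq) = let (_ , kc , _) = coherentAt eq in subst RightTail (sym kc) rR!

  not-boxEdge : ∀ {c k} → tkind c ≡ k → k ≢ kR!c → ¬ BoxEdge G c
  not-boxEdge kc k≢ (_ , _ , eq) = let (_ , kc' , _) = coherentAt eq in k≢ (trans (sym kc) kc')

  L!-box-rightIntro : ∀ {v c a bx} → shp v ≡ L! c a bx → RIntro G bx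
  L!-box-rightIntro eq = let (_ , _ , eq′) = L!-boxEdge _ _ _ _ eq in ri! eq′

  cut-W-or-! : ∀ g → RIntro G g → dep g ≤ n → LIntro G (nxt g) →
               (hkind (nxt g) ≡ hWc) ⊎ ((hkind (nxt g) ≡ hL!c) × (dep g ≡ n) × BoxEdge G g)
  cut-W-or-! g ri dl li with m≤n⇒m<n∨m≡n dl
  ... | inj₁ lt = let (_ , _ , eq) = cuts-below g (ri , li) lt in inj₁ (coherentAt eq)
  ... | inj₂ e with cuts-at g (ri , li) e
  ...   | inj₁ (_ , _ , eq) = inj₁ (coherentAt eq)
  ...   | inj₂ (be , _ , _ , _ , eq , _) = inj₂ (proj₁ (coherentAt eq) , e , be)

  no-cut-into : ∀ {g c k} → RIntro G g → dep g ≤ n → nxt g ≡ c → LIntro G c → hkind c ≡ k → ¬ WeakOrBox k → ⊥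
  no-cut-into {g} ri dl refl li hk nwb with cut-W-or-! g ri dl li
  ... | inj₁ w = nwb (subst WeakOrBox (trans (sym w) hk) weak)
  ... | inj₂ (b , _) = nwb (subst WeakOrBox (trans (sym b) hk) box)

  -- !-cuts only occur at level n, so a box-edge below level n cannot enter an L!-vertex.
  no-!-cut : ∀ {g v c a bx} → RIntro G g → dep g ≤ n → nxt g ≡ c → shp v ≡ L! c a bx → (BoxEdge G g → dep g < n) → ⊥
  no-!-cut {g} ri dl refl eq below with cut-W-or-! g ri dl (li! eq)
  ... | inj₁ w with trans (sym w) (proj₁ (coherentAt eq))
  ...   | ()
  no-!-cut ri dl refl eq below | inj₂ (_ , e , be) = <-irrefl e (below be)

  PosKeeps : Sig → E → Stk → Set
  PosKeeps t g S = RIntro G g × dep g ≤ n × BottomIs (sig t) S × ((S ≡ [ sig t ]) ⊎ (BoxEdge G g → dep g < n))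

  NegKeeps : Sig → E → Stk → Set
  NegKeeps t g S = ¬ RIntro G g × dep g ≤ n × BottomIs (sig t) S × HasNonSig S

  KeepsBottom : Sig → Ctx G → Set
  KeepsBottom t ⟨ g , _ , S , pos ⟩ = PosKeeps t g S
  KeepsBottom t ⟨ g , _ , S , neg ⟩ = NegKeeps t g S

  keeps-down : ∀ {t g S c y h} → RIntro G c → ¬ BoxEdge G c → nxt g ≡ h → hdepth h ≡ tdepth c →
               PosKeeps t g S → PosKeeps t c (S ▶ y)
  keeps-down ric nb nx q (_ , dl , bt , _) = ric , ≤-trans (≤-reflexive (dep-across nx q)) dl , bS bt , inj₂ (⊥-elim ∘ nb)

  keeps-up : ∀ {t g g' c k S'} → nxt g' ≡ c → LIntro G c → hkind c ≡ k → ¬ WeakOrBox k →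
             hdepth c ≡ tdepth g → dep g ≤ n → BottomIs (sig t) S' → HasNonSig S' → NegKeeps t g' S'
  keeps-up {g = g} nx li hk nwb q dl bt ns = (λ ri → no-cut-into ri dl' nx li hk nwb) , dl' , bt , ns
    where
    dl' = ≤-trans (≤-reflexive (trans (dep-head nx) (trans q (tdepth-dep g)))) dl

  keeps-pos-forward : ∀ {t g U S C'} → Step₀ G ⟨ g , U , S , pos ⟩ C' → PosKeeps t g S → KeepsBottom t C'
  keeps-pos-forward (r⊸b eq nx) I = let (_ , kc , _ , _ , _ , _ , q) = coherentAt eq in keeps-down (ri⊸ eq) (not-boxEdge kc λ ()) nx q I
  keeps-pos-forward (r⊗a eq nx) I = let (_ , _ , kc , _ , _ , q , _) = coherentAt eq in keeps-down (ri⊗ eq) (not-boxEdge kc λ ()) nx q I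
  keeps-pos-forward (r⊗b eq nx) I = let (_ , _ , kc , _ , _ , _ , q) = coherentAt eq in keeps-down (ri⊗ eq) (not-boxEdge kc λ ()) nx q I
  keeps-pos-forward (r∀ eq nx) I = let (_ , kc , _ , q) = coherentAt eq in keeps-down (ri∀ eq) (not-boxEdge kc λ ()) nx q I
  keeps-pos-forward (l⊸a eq nx _) (ri , dl , _) = ⊥-elim (no-cut-into ri dl nx (li⊸ eq) (proj₁ (coherentAt eq)) λ ())
  keeps-pos-forward (l⊸b eq nx) (ri , dl , _) = ⊥-elim (no-cut-into ri dl nx (li⊸ eq) (proj₁ (coherentAt eq)) λ ())
  keeps-pos-forward (l⊗a eq nx) (ri , dl , _) = ⊥-elim (no-cut-into ri dl nx (li⊗ eq) (proj₁ (coherentAt eq)) λ ())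
  keeps-pos-forward (l⊗b eq nx) (ri , dl , _) = ⊥-elim (no-cut-into ri dl nx (li⊗ eq) (proj₁ (coherentAt eq)) λ ())
  keeps-pos-forward (l∀ eq nx) (ri , dl , _) = ⊥-elim (no-cut-into ri dl nx (li∀ eq) (proj₁ (coherentAt eq)) λ ())
  keeps-pos-forward (xl eq nx) (ri , dl , _) = ⊥-elim (no-cut-into ri dl nx (liX eq) (proj₁ (coherentAt eq)) λ ())
  keeps-pos-forward (xl₀ eq nx) (ri , dl , _) = ⊥-elim (no-cut-into ri dl nx (liX eq) (proj₁ (coherentAt eq)) λ ())
  keeps-pos-forward (xr eq nx) (ri , dl , _) = ⊥-elim (no-cut-into ri dl nx (liX eq) (proj₁ (coherentAt eq)) λ ())
  keeps-pos-forward (xr₀ eq nx) (ri , dl , _) = ⊥-elim (no-cut-into ri dl nx (liX eq) (proj₁ (coherentAt eq)) λ ())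
  keeps-pos-forward (der eq nx) (ri , dl , _) = ⊥-elim (no-cut-into ri dl nx (liD eq) (proj₁ (coherentAt eq)) λ ())
  keeps-pos-forward (dn eq nx) (ri , dl , _) = ⊥-elim (no-cut-into ri dl nx (liN eq) (proj₁ (coherentAt eq)) λ ())
  keeps-pos-forward (dn₀ eq nx) (ri , dl , _) = ⊥-elim (no-cut-into ri dl nx (liN eq) (proj₁ (coherentAt eq)) λ ())
  keeps-pos-forward (dp eq nx) (ri , dl , _) = ⊥-elim (no-cut-into ri dl nx (liN eq) (proj₁ (coherentAt eq)) λ ())
  keeps-pos-forward (bin eq nx) (ri , dl , _ , inj₁ ())
  keeps-pos-forward (bin eq nx) (ri , dl , _ , inj₂ below) = ⊥-elim (no-!-cut ri dl nx eq below)
  keeps-pos-forward {g = g} (bout {c = c} eq nx) (_ , dl , bt , _) = ri! eq , ≤-trans (<⇒≤ lt) dl , bS bt , inj₂ (λ _ → <-≤-trans lt dl)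
    where
    lt : dep c < dep g
    lt = let (_ , _ , _ , q) = coherentAt eq in ≤-reflexive (sym (trans (dep-head nx) (trans q (cong suc (tdepth-dep c)))))
  keeps-pos-forward (bjump eq nx) (_ , dl , b0 , _) =
    let (_ , _ , _ , _ , _ , _ , q , _) = coherentAt eq in
    L!-box-rightIntro eq , ≤-trans (≤-reflexive (dep-across nx (sym q))) dl , b0 , inj₁ refl

  keeps-pos-backward : ∀ {t g U S C'} → Step₀ G (dual C') ⟨ g , U , S , neg ⟩ → PosKeeps t g S → KeepsBottom t C'
  keeps-pos-backward {g = g} {C' = ⟨ _ , _ , _ , neg ⟩} (l⊸a eq nx nx') (_ , dl , bt , _) =
    let (hc , _ , _ , _ , _ , qc , qa , _) = coherentAt eq in
    keeps-up nx (li⊸ eq) hc (λ ()) (trans qc (trans (sym qa) (sym (trans (depth-nxt g) (cong hdepth nx'))))) dl (bS bt) (nsH λ ())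

  keeps-neg-forward : ∀ {t g U S C'} → Step₀ G ⟨ g , U , S , neg ⟩ C' → NegKeeps t g S → KeepsBottom t C'
  keeps-neg-forward {g = g} (r⊸a {c = c} eq) (_ , dl , bt , _) =
    let (_ , kc , _ , _ , _ , q , _) = coherentAt eq in
    ri⊸ eq , ≤-trans (≤-reflexive (trans (sym (tdepth-dep c)) (trans (sym q) (tdepth-dep g)))) dl , bS bt ,
    inj₂ (⊥-elim ∘ not-boxEdge kc λ ())

  keeps-neg-backward : ∀ {t g U S g' U' S'} → Step₀ G ⟨ g' , U' , S' , pos ⟩ ⟨ g , U , S , pos ⟩ → NegKeeps t g S → NegKeeps t g' S'
  keeps-neg-backward (r⊸b eq nx) (nri , _) = ⊥-elim (nri (ri⊸ eq))
  keeps-neg-backward (r⊗a eq nx) (nri , _) = ⊥-elim (nri (ri⊗ eq))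
  keeps-neg-backward (r⊗b eq nx) (nri , _) = ⊥-elim (nri (ri⊗ eq))
  keeps-neg-backward (r∀ eq nx) (nri , _) = ⊥-elim (nri (ri∀ eq))
  keeps-neg-backward (bout eq nx) (nri , _) = ⊥-elim (nri (ri! eq))
  keeps-neg-backward (bjump eq nx) (nri , _) = ⊥-elim (nri (L!-box-rightIntro eq))
  keeps-neg-backward (l⊸b eq nx) (_ , dl , bt , ns) = let (hc , _ , _ , _ , _ , q , _) = coherentAt eq in
    keeps-up nx (li⊸ eq) hc (λ ()) q dl (bS bt) (nsT ns)
  keeps-neg-backward (l⊗a eq nx) (_ , dl , bt , ns) = let (hc , _ , _ , _ , _ , q , _) = coherentAt eq in
    keeps-up nx (li⊗ eq) hc (λ ()) q dl (bS bt) (nsT ns)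
  keeps-neg-backward (l⊗b eq nx) (_ , dl , bt , ns) = let (hc , _ , _ , _ , _ , q , q' , _) = coherentAt eq in
    keeps-up nx (li⊗ eq) hc (λ ()) (trans q (sym q')) dl (bS bt) (nsT ns)
  keeps-neg-backward (l∀ eq nx) (_ , dl , bt , ns) = let (hc , _ , _ , q , _) = coherentAt eq in
    keeps-up nx (li∀ eq) hc (λ ()) q dl (bS bt) (nsT ns)
  keeps-neg-backward (xl eq nx) (_ , dl , bt , ns) = let (hc , _ , _ , _ , _ , q , _) = coherentAt eq in
    keeps-up nx (liX eq) hc (λ ()) q dl (bS (bottom-pop bt)) (nsT (hasNonSig-pop ns))
  keeps-neg-backward (xr eq nx) (_ , dl , bt , ns) = let (hc , _ , _ , _ , _ , q , q' , _) = coherentAt eq in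
    keeps-up nx (liX eq) hc (λ ()) (trans q (sym q')) dl (bS (bottom-pop bt)) (nsT (hasNonSig-pop ns))
  keeps-neg-backward (der eq nx) (_ , dl , bt , ns) = let (hc , _ , _ , q , _) = coherentAt eq in
    keeps-up nx (liD eq) hc (λ ()) q dl (bS bt) (nsT ns)
  keeps-neg-backward (dn eq nx) (_ , dl , bt , ns) = let (hc , _ , _ , q , _) = coherentAt eq in
    keeps-up nx (liN eq) hc (λ ()) q dl (bS (bottom-pop (bottom-pop bt))) (nsT (hasNonSig-pop (hasNonSig-pop ns)))
  keeps-neg-backward (xl₀ eq nx) (_ , _ , _ , ())
  keeps-neg-backward (xr₀ eq nx) (_ , _ , _ , ())
  keeps-neg-backward (dp eq nx) (_ , _ , _ , ())
  keeps-neg-backward (dn₀ eq nx) (_ , _ , _ , nsH ¬sig) = ⊥-elim (¬sig isg)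
  keeps-neg-backward (dn₀ eq nx) (_ , _ , _ , nsT ())
  keeps-neg-backward {g = g} {g' = g'} (bin eq nx) (_ , dl , bt , ns) = nri' , ≤-trans (<⇒≤ lt) dl , bS bt , nsT ns
    where
    lt : dep g' < dep g
    lt = let (_ , _ , _ , _ , _ , q , _) = coherentAt eq in
         ≤-reflexive (sym (trans (sym (tdepth-dep g)) (trans q (cong suc (sym (dep-head nx))))))
    nri' : ¬ RIntro G g'
    nri' ri = no-!-cut ri (≤-trans (<⇒≤ lt) dl) nx eq (λ _ → <-≤-trans lt dl)

  keeps-step : ∀ t {C C'} → KeepsBottom t C → C ⟶ C' → KeepsBottom t C'
  keeps-step t {⟨ _ , _ , _ , pos ⟩} I (inj₁ s) = keeps-pos-forward s I
  keeps-step t {⟨ _ , _ , _ , pos ⟩} I (inj₂ s) = keeps-pos-backward s I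
  keeps-step t {⟨ _ , _ , _ , neg ⟩} I (inj₁ s) = keeps-neg-forward s I
  keeps-step t {⟨ _ , _ , _ , neg ⟩} {⟨ _ , _ , _ , pos ⟩} (nri , _) (inj₂ (r⊸a eq)) = ⊥-elim (nri (ri⊸ eq))
  keeps-step t {⟨ _ , _ , _ , neg ⟩} {⟨ _ , _ , _ , neg ⟩} I (inj₂ s) = keeps-neg-backward s I

  keeps-star : ∀ t {C C'} → KeepsBottom t C → Star _⟶_ C C' → KeepsBottom t C'
  keeps-star t I ε = I
  keeps-star t I (s ◅ ss) = keeps-star t (keeps-step t I s) ss

  keeps-final : ∀ t C → KeepsBottom t C → Final G C → t ≡ sE
  keeps-final t ⟨ _ , _ , _ , pos ⟩ (_ , _ , bt , _) (finW _ _ pf) = sig-injective (bottom-unique bt (posFinal-bottom pf))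
  keeps-final t ⟨ _ , _ , _ , pos ⟩ (_ , _ , bt , _) (finC _ pf) = sig-injective (bottom-unique bt (posFinal-bottom pf))
  keeps-final t ⟨ _ , _ , _ , pos ⟩ (_ , _ , bt , _) (finD _ _) = sig-injective (bottom-unique bt b0)
  keeps-final t ⟨ _ , _ , _ , neg ⟩ (_ , _ , bt , _) (finP nf) = sig-injective (bottom-unique bt (negFinal-bottom nf))

  copy-unique : ∀ e U → BoxEdge G e → dep e ≤ n → ∀ t → Copy G e U t → t ≡ sE
  copy-unique e U (_ , _ , eq) dl t (_ , paths) =
    let (C , path , final) = paths t (⊑-refl t) in
    keeps-final t C (keeps-star t (ri! eq , dl , b0 , inj₁ refl) path) final

  Tracked : Ctx G → Set
  Tracked ⟨ g , U , S , pos ⟩ =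
    RIntro G g × dep g ≤ n × (U ≡ eSeq (dep g)) × PosFinal S × ((S ≡ [ sig sE ]) ⊎ (BoxEdge G g → dep g < n))
  Tracked ⟨ g , U , S , neg ⟩ =
    ¬ RIntro G g × LeftHead (hkind (nxt g)) × dep g ≤ n × (U ≡ eSeq (dep g)) × NegFinal S ×
    Σ Stk (λ S₀ → Σ (List SE) λ Q → (S ≡ S₀ ⊕ Q) × Address (ttype g) Q)

  potential : Ctx G → ℕ
  potential ⟨ g , _ , _ , pos ⟩ = trank g
  potential ⟨ g , _ , _ , neg ⟩ = hrank (nxt g)

  ReachesFinal : Ctx G → Set
  ReachesFinal C = Σ (Ctx G) λ C' → Star _⟶_ C C' × Final G C'

  Progress : Ctx G → Set
  Progress C = Final G C ⊎ Σ (Ctx G) (λ C' → (C ⟶ C') × Tracked C' × (potential C' < potential C))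

  advance : ∀ {C C'} → C ⟶ C' → Tracked C' × (potential C' < potential C) → Progress C
  advance s (I , lt) = inj₂ (_ , s , I , lt)

  descend : ∀ {g U S c y} → Tracked ⟨ g , U , S , pos ⟩ → RIntro G c → ¬ BoxEdge G c → hdepth (nxt g) ≡ tdepth c →
            hrank (nxt g) ≡ trank c → hkind (nxt g) ≢ hC → PosFinal (S ▶ y) →
            Tracked ⟨ c , U , S ▶ y , pos ⟩ × (trank c < trank g)
  descend {g} {c = c} (ri , dl , eU , _ , _) ric nb q r nc pf' =
    (ric , ≤-trans (≤-reflexive d) dl , trans eU (cong eSeq (sym d)) , pf' , inj₂ (⊥-elim ∘ nb)) ,
    subst (_< trank g) r (rank-right g (rightIntro-rightTail ri) nc)
    where
    d : dep c ≡ dep g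
    d = dep-across refl q

  ascend : ∀ {g g₀ c k U S'} → nxt g₀ ≡ c → LIntro G c → hkind c ≡ k → LeftHead k → ¬ WeakOrBox k →
           hdepth c ≡ tdepth g → dep g ≤ n → U ≡ eSeq (dep g) → NegFinal S' →
           Σ Stk (λ S₀ → Σ (List SE) λ Q → (S' ≡ S₀ ⊕ Q) × Address (ttype g₀) Q) → Tracked ⟨ g₀ , U , S' , neg ⟩
  ascend {g} {g₀} nx li hk lh nwb q dl eU nf st =
    (λ ri → no-cut-into ri dl₀ nx li hk nwb) , subst LeftHead (sym (trans (cong hkind nx) hk)) lh ,
    dl₀ , trans eU (cong eSeq (sym d)) , nf , st
    where
    d : dep g₀ ≡ dep g
    d = trans (dep-head nx) (trans q (tdepth-dep g))
    dl₀ = ≤-trans (≤-reflexive d) dl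

  rank-up : ∀ {g g₀ c k} → nxt g₀ ≡ c → hrank c ≡ trank g → tkind g ≡ k → LeftTail k → LeftHead (hkind (nxt g)) →
            hrank (nxt g₀) < hrank (nxt g)
  rank-up {g} refl r kg lt lh = subst (_< _) (sym r) (rank-left g (subst LeftTail (sym kg) lt) lh)

  exit-box : ∀ {v a c g S} → shp v ≡ R! a c → nxt g ≡ a → dep g ≡ suc (dep c) →
             ⟨ g , eSeq (dep g) , S , pos ⟩ ⟶ ⟨ c , eSeq (dep c) , S ▶ sig sE , pos ⟩
  exit-box eq nx d rewrite d = inj₁ (bout eq nx)

  leave-box-upwards : ∀ {v c a bx g₀ S} → shp v ≡ L! c a bx → nxt g₀ ≡ c → dep a ≡ suc (dep g₀) →
                      ⟨ a , eSeq (dep a) , S , neg ⟩ ⟶ ⟨ g₀ , eSeq (dep g₀) , S ▶ sig sE , neg ⟩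
  leave-box-upwards eq nx d rewrite d = inj₂ (bin eq nx)

  progress-to-L⊸a : ∀ {v c a b g U S} → shp v ≡ L⊸ c a b → nxt g ≡ a →
                    Tracked ⟨ g , U , S , pos ⟩ → Progress ⟨ g , U , S , pos ⟩
  progress-to-L⊸a {v} {c} {g = g} {S = S} eq refl (ri , dl , refl , pf , _) with coherentAt eq | head-fed v _ c eq iL⊸c
  ... | (hc , ha , _ , rc , ra , qc , qa , _ , tyc) | (g₁ , nx₁) =
    advance (inj₂ (l⊸a eq nx₁ refl))
      (ascend nx₁ (li⊸ eq) hc hhL⊸c (λ ()) (trans qc (trans (sym qa) (sym (depth-nxt g)))) dl refl (nfA pf)
              (S , ‵a ∷ [] , refl , Address-cast (trans (type-head nx₁) tyc) tt) ,
       subst (_< trank g) (sym (trans (cong hrank nx₁) (trans rc (sym ra)))) (rank-right g (rightIntro-rightTail ri) (≡-≢-trans ha λ ())))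

  progress-to-R!a : ∀ {v a c g U S} → shp v ≡ R! a c → nxt g ≡ a →
                    Tracked ⟨ g , U , S , pos ⟩ → Progress ⟨ g , U , S , pos ⟩
  progress-to-R!a {c = c} {g} eq refl (ri , dl , refl , pf , _) =
    let (ha , _ , r , q) = coherentAt eq
        d : dep g ≡ suc (dep c)
        d = trans (dep-head refl) (trans q (cong suc (tdepth-dep c)))
        lt : dep c < dep g
        lt = ≤-reflexive (sym d)
    in advance (exit-box eq refl d)
         ((ri! eq , ≤-trans (<⇒≤ lt) dl , refl , pfSE pf , inj₂ (λ _ → <-≤-trans lt dl)) ,
          subst (_< trank g) r (rank-right g (rightIntro-rightTail ri) (≡-≢-trans ha λ ())))

  progress-to-L!c : ∀ {v c a bx g U S} → shp v ≡ L! c a bx → nxt g ≡ c →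
                    Tracked ⟨ g , U , S , pos ⟩ → Progress ⟨ g , U , S , pos ⟩
  progress-to-L!c {bx = bx} {g} eq refl (ri , dl , refl , pf , inj₁ refl) =
    let (hc , _ , _ , rc , rbx , _ , qbx , _) = coherentAt eq
        d : dep bx ≡ dep g
        d = dep-across refl (sym qbx)
    in advance (inj₁ (bjump eq refl))
         ((L!-box-rightIntro eq , ≤-trans (≤-reflexive d) dl , cong eSeq (sym d) , pfE , inj₁ refl) ,
          subst (_< trank g) (trans rc (sym rbx)) (rank-right g (rightIntro-rightTail ri) (≡-≢-trans hc λ ())))
  progress-to-L!c eq refl (ri , dl , refl , pf , inj₂ below) = ⊥-elim (no-!-cut ri dl refl eq below)

  progress-pos : ∀ {g U S} → Tracked ⟨ g , U , S , pos ⟩ → Progress ⟨ g , U , S , pos ⟩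
  progress-pos {g} I@(ri , dl , refl , pf , _) with head-attached (nxt g)
  ... | inj₁ atC = inj₁ (finC atC pf)
  ... | inj₂ (v , _ , eq , iWc) = inj₁ (finW eq refl pf)
  ... | inj₂ (v , _ , eq , iR⊸b) = let (_ , kc , hb , _ , r , _ , q) = coherentAt eq in
    advance (inj₁ (r⊸b eq refl)) (descend I (ri⊸ eq) (not-boxEdge kc λ ()) q r (≡-≢-trans hb λ ()) (pfMul m‵o pf))
  ... | inj₂ (v , _ , eq , iR⊗a) = let (ha , _ , kc , r , _ , q , _) = coherentAt eq in
    advance (inj₁ (r⊗a eq refl)) (descend I (ri⊗ eq) (not-boxEdge kc λ ()) q r (≡-≢-trans ha λ ()) (pfMul m‵f pf))
  ... | inj₂ (v , _ , eq , iR⊗b) = let (_ , hb , kc , _ , r , _ , q) = coherentAt eq in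
    advance (inj₁ (r⊗b eq refl)) (descend I (ri⊗ eq) (not-boxEdge kc λ ()) q r (≡-≢-trans hb λ ()) (pfMul m‵x pf))
  ... | inj₂ (v , _ , eq , iR∀a) = let (ha , kc , r , q) = coherentAt eq in
    advance (inj₁ (r∀ eq refl)) (descend I (ri∀ eq) (not-boxEdge kc λ ()) q r (≡-≢-trans ha λ ()) (pfMul m‵s pf))
  ... | inj₂ (v , _ , eq , iL⊸c) = ⊥-elim (no-cut-into ri dl refl (li⊸ eq) (proj₁ (coherentAt eq)) λ ())
  ... | inj₂ (v , _ , eq , iL⊗c) = ⊥-elim (no-cut-into ri dl refl (li⊗ eq) (proj₁ (coherentAt eq)) λ ())
  ... | inj₂ (v , _ , eq , iL∀c) = ⊥-elim (no-cut-into ri dl refl (li∀ eq) (proj₁ (coherentAt eq)) λ ())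
  ... | inj₂ (v , _ , eq , iXc) = ⊥-elim (no-cut-into ri dl refl (liX eq) (proj₁ (coherentAt eq)) λ ())
  ... | inj₂ (v , _ , eq , iDc) = ⊥-elim (no-cut-into ri dl refl (liD eq) (proj₁ (coherentAt eq)) λ ())
  ... | inj₂ (v , _ , eq , iNc) = ⊥-elim (no-cut-into ri dl refl (liN eq) (proj₁ (coherentAt eq)) λ ())
  ... | inj₂ (v , _ , eq , iL⊸a) = progress-to-L⊸a eq refl I
  ... | inj₂ (v , _ , eq , iR!a) = progress-to-R!a eq refl I
  ... | inj₂ (v , _ , eq , iL!c) = progress-to-L!c eq refl I

  progress-from-R⊸a : ∀ {v b c g U S} → shp v ≡ R⊸ g b c → Tracked ⟨ g , U , S , neg ⟩ → Progress ⟨ g , U , S , neg ⟩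
  progress-from-R⊸a {c = c} {g} eq (_ , lh , dl , refl , nf , _) =
    let (ka , kc , _ , r , _ , q , _) = coherentAt eq
        d : dep c ≡ dep g
        d = trans (sym (tdepth-dep c)) (trans (sym q) (tdepth-dep g))
    in advance (inj₁ (r⊸a eq))
         ((ri⊸ eq , ≤-trans (≤-reflexive d) dl , cong eSeq (sym d) , pfA nf , inj₂ (⊥-elim ∘ not-boxEdge kc λ ())) ,
          subst (_< hrank (nxt g)) r (rank-left g (subst LeftTail (sym ka) lR⊸a) lh))

  progress-from-L⊸b : ∀ {v c a g U S} → shp v ≡ L⊸ c a g → Tracked ⟨ g , U , S , neg ⟩ → Progress ⟨ g , U , S , neg ⟩
  progress-from-L⊸b {v} {c} eq (_ , lh , dl , refl , nf , S₀ , Q , refl , vQ) with coherentAt eq | head-fed v _ c eq iL⊸c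
  ... | (hc , _ , kb , rc , _ , qc , _ , _ , tyc) | (g₀ , nx₀) =
    advance (inj₂ (l⊸b eq nx₀))
      (ascend nx₀ (li⊸ eq) hc hhL⊸c (λ ()) qc dl refl (nfMul m‵o nf)
              (S₀ , ‵o ∷ Q , refl , Address-cast (trans (type-head nx₀) tyc) vQ) ,
       rank-up nx₀ rc kb lL⊸b lh)

  progress-from-L⊗a : ∀ {v c b g U S} → shp v ≡ L⊗ c g b → Tracked ⟨ g , U , S , neg ⟩ → Progress ⟨ g , U , S , neg ⟩
  progress-from-L⊗a {v} {c} eq (_ , lh , dl , refl , nf , S₀ , Q , refl , vQ) with coherentAt eq | head-fed v _ c eq iL⊗c
  ... | (hc , ka , _ , rc , _ , qc , _ , tyc) | (g₀ , nx₀) =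
    advance (inj₂ (l⊗a eq nx₀))
      (ascend nx₀ (li⊗ eq) hc hhL⊗c (λ ()) qc dl refl (nfMul m‵f nf)
              (S₀ , ‵f ∷ Q , refl , Address-cast (trans (type-head nx₀) tyc) vQ) ,
       rank-up nx₀ rc ka lL⊗a lh)

  progress-from-L⊗b : ∀ {v c a g U S} → shp v ≡ L⊗ c a g → Tracked ⟨ g , U , S , neg ⟩ → Progress ⟨ g , U , S , neg ⟩
  progress-from-L⊗b {v} {c} eq (_ , lh , dl , refl , nf , S₀ , Q , refl , vQ) with coherentAt eq | head-fed v _ c eq iL⊗c
  ... | (hc , _ , kb , rc , rb , qc , qb , tyc) | (g₀ , nx₀) =
    advance (inj₂ (l⊗b eq nx₀))
      (ascend nx₀ (li⊗ eq) hc hhL⊗c (λ ()) (trans qc (sym qb)) dl refl (nfMul m‵x nf)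
              (S₀ , ‵x ∷ Q , refl , Address-cast (trans (type-head nx₀) tyc) vQ) ,
       rank-up nx₀ (trans rc (sym rb)) kb lL⊗b lh)

  progress-from-L∀a : ∀ {v c g U S} → shp v ≡ L∀ c g → Tracked ⟨ g , U , S , neg ⟩ → Progress ⟨ g , U , S , neg ⟩
  progress-from-L∀a {v} {c} eq (_ , lh , dl , refl , nf , S₀ , Q , refl , vQ) with coherentAt eq | head-fed v _ c eq iL∀c
  ... | (hc , ka , rc , qc , _ , tyc , inst) | (g₀ , nx₀) =
    advance (inj₂ (l∀ eq nx₀))
      (ascend nx₀ (li∀ eq) hc hhL∀c (λ ()) qc dl refl (nfMul m‵s nf)
              (S₀ , ‵s ∷ Q , refl , Address-cast (trans (type-head nx₀) tyc) (Address-≼ Q inst vQ)) ,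
       rank-up nx₀ rc ka lL∀a lh)

  progress-from-Da : ∀ {v c g U S} → shp v ≡ D c g → Tracked ⟨ g , U , S , neg ⟩ → Progress ⟨ g , U , S , neg ⟩
  progress-from-Da {v} {c} eq (_ , lh , dl , refl , nf , S₀ , Q , refl , vQ) with coherentAt eq | head-fed v _ c eq iDc
  ... | (hc , ka , rc , qc , tyc) | (g₀ , nx₀) =
    advance (inj₂ (der eq nx₀))
      (ascend nx₀ (liD eq) hc hhDc (λ ()) qc dl refl (nfSig nf)
              (S₀ , sig sE ∷ Q , refl , Address-cast (trans (type-head nx₀) tyc) vQ) ,
       rank-up nx₀ rc ka lDa lh)

  progress-from-Xa : ∀ {v c b g U S} → shp v ≡ X c g b → Tracked ⟨ g , U , S , neg ⟩ → Progress ⟨ g , U , S , neg ⟩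
  progress-from-Xa {v} {c} eq (_ , lh , dl , refl , nf , S₀ , Q , refl , vQ) with coherentAt eq | head-fed v _ c eq iXc
  ... | (hc , ka , _ , rc , _ , qc , _ , k , tyc , tya , _) | (g₀ , nx₀) with Address-! k Q (subst (λ k → Address k Q) tya vQ)
  ...   | (t , Q' , refl , vQ') =
    advance (inj₂ (xl eq nx₀))
      (ascend nx₀ (liX eq) hc hhXc (λ ()) qc dl refl (nfSig (negFinal-pop nf))
              (S₀ , sig (sL t) ∷ Q' , refl , Address-cast (trans (type-head nx₀) tyc) vQ') ,
       rank-up nx₀ rc ka lXa lh)

  progress-from-Xb : ∀ {v c a g U S} → shp v ≡ X c a g → Tracked ⟨ g , U , S , neg ⟩ → Progress ⟨ g , U , S , neg ⟩
  progress-from-Xb {v} {c} eq (_ , lh , dl , refl , nf , S₀ , Q , refl , vQ) with coherentAt eq | head-fed v _ c eq iXc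
  ... | (hc , _ , kb , rc , rb , qc , qb , k , tyc , _ , tyb) | (g₀ , nx₀) with Address-! k Q (subst (λ k → Address k Q) tyb vQ)
  ...   | (t , Q' , refl , vQ') =
    advance (inj₂ (xr eq nx₀))
      (ascend nx₀ (liX eq) hc hhXc (λ ()) (trans qc (sym qb)) dl refl (nfSig (negFinal-pop nf))
              (S₀ , sig (sR t) ∷ Q' , refl , Address-cast (trans (type-head nx₀) tyc) vQ') ,
       rank-up nx₀ (trans rc (sym rb)) kb lXb lh)

  progress-from-Na : ∀ {v c g U S} → shp v ≡ N c g → Tracked ⟨ g , U , S , neg ⟩ → Progress ⟨ g , U , S , neg ⟩
  progress-from-Na {v} {c} eq (_ , lh , dl , refl , nf , S₀ , Q , refl , vQ) with coherentAt eq | head-fed v _ c eq iNc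
  ... | (hc , ka , rc , qc , k , tyc , tya) | (g₀ , nx₀) with Address-! (s! k) Q (subst (λ k → Address k Q) tya vQ)
  ...   | (u , Q₁ , refl , vQ₁) with Address-! k Q₁ vQ₁
  ...     | (t , Q₂ , refl , vQ₂) =
    advance (inj₂ (dn eq nx₀))
      (ascend nx₀ (liN eq) hc hhNc (λ ()) qc dl refl (nfSig (negFinal-pop (negFinal-pop nf)))
              (S₀ , sig (sN t u) ∷ Q₂ , refl , Address-cast (trans (type-head nx₀) tyc) vQ₂) ,
       rank-up nx₀ rc ka lNa lh)

  progress-from-L!a : ∀ {v c bx g U S} → shp v ≡ L! c g bx → Tracked ⟨ g , U , S , neg ⟩ → Progress ⟨ g , U , S , neg ⟩
  progress-from-L!a {v} {c} {g = g} eq (_ , lh , dl , refl , nf , S₀ , Q , refl , vQ) with coherentAt eq | head-fed v _ c eq iL!c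
  ... | (hc , ka , _ , rc , _ , qa , _ , tyc) | (g₀ , nx₀) =
    let dg : dep g ≡ suc (dep g₀)
        dg = trans (sym (tdepth-dep g)) (trans qa (cong suc (sym (dep-head nx₀))))
        lt : dep g₀ < dep g
        lt = ≤-reflexive (sym dg)
        dl₀ = ≤-trans (<⇒≤ lt) dl
    in advance (leave-box-upwards eq nx₀ dg)
         (((λ ri → no-!-cut ri dl₀ nx₀ eq (λ _ → <-≤-trans lt dl)) , subst LeftHead (sym (trans (cong hkind nx₀) hc)) hhL!c ,
           dl₀ , refl , nfSig nf , (S₀ , sig sE ∷ Q , refl , Address-cast (trans (type-head nx₀) tyc) vQ)) ,
          rank-up nx₀ rc ka lL!a lh)

  progress-neg : ∀ {g U S} → Tracked ⟨ g , U , S , neg ⟩ → Progress ⟨ g , U , S , neg ⟩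
  progress-neg {g} I@(nri , _ , _ , _ , nf , _) with tail-attached g
  ... | inj₁ (i , refl) = inj₁ (finP nf)
  ... | inj₂ (v , _ , eq , jR⊸c) = ⊥-elim (nri (ri⊸ eq))
  ... | inj₂ (v , _ , eq , jR⊗c) = ⊥-elim (nri (ri⊗ eq))
  ... | inj₂ (v , _ , eq , jR∀c) = ⊥-elim (nri (ri∀ eq))
  ... | inj₂ (v , _ , eq , jR!c) = ⊥-elim (nri (ri! eq))
  ... | inj₂ (v , _ , eq , jR⊸a) = progress-from-R⊸a eq I
  ... | inj₂ (v , _ , eq , jL⊸b) = progress-from-L⊸b eq I
  ... | inj₂ (v , _ , eq , jL⊗a) = progress-from-L⊗a eq I
  ... | inj₂ (v , _ , eq , jL⊗b) = progress-from-L⊗b eq I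
  ... | inj₂ (v , _ , eq , jL∀a) = progress-from-L∀a eq I
  ... | inj₂ (v , _ , eq , jDa) = progress-from-Da eq I
  ... | inj₂ (v , _ , eq , jXa) = progress-from-Xa eq I
  ... | inj₂ (v , _ , eq , jXb) = progress-from-Xb eq I
  ... | inj₂ (v , _ , eq , jNa) = progress-from-Na eq I
  ... | inj₂ (v , _ , eq , jL!a) = progress-from-L!a eq I

  progress : ∀ C → Tracked C → Progress C
  progress ⟨ _ , _ , _ , pos ⟩ = progress-pos
  progress ⟨ _ , _ , _ , neg ⟩ = progress-neg

  reaches-final : ∀ m C → Tracked C → potential C < m → ReachesFinal C
  reaches-final (suc m) C I lt with progress C I
  ... | inj₁ final = C , ε , final
  ... | inj₂ (C' , s , I' , lt') =
    let (C'' , path , final) = reaches-final m C' I' (<-≤-trans lt' (≤-pred lt)) in C'' , s ◅ path , final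

  copy-exists : ∀ e → BoxEdge G e → dep e ≤ n → Copy G e (eSeq (dep e)) sE
  copy-exists e (_ , _ , eq) dl = stdE , λ { .sE ⊑E → reaches-final (suc (trank e)) _ (ri! eq , dl , refl , pfE , inj₁ refl) ≤-refl }

  outer-nothing : ∀ {e} → outer e ≡ nothing → dep e ≡ 0
  outer-nothing {e} on with outer-box e
  ... | inj₁ (_ , d) = d
  ... | inj₂ (_ , oj , _) with trans (sym on) oj
  ...   | ()

  outer-just : ∀ {e c} → outer e ≡ just c → dep e ≡ suc (dep c) × BoxEdge G c
  outer-just {e} oj with outer-box e
  ... | inj₁ (on , _) with trans (sym on) oj
  ...   | ()
  outer-just oj | inj₂ (_ , oj' , d , be) with just-injective (trans (sym oj') oj)
  ...   | refl = d , be

  canonical-exists : ∀ k e → dep e ≡ k → k ≤ n → Canonical G e (eSeq k)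
  canonical-exists zero e de _ with outer-box e
  ... | inj₁ (on , _) = can∅ on
  ... | inj₂ (_ , _ , d , _) with trans (sym de) d
  ...   | ()
  canonical-exists (suc k) e de kl with outer-box e
  ... | inj₁ (_ , d) with trans (sym de) d
  ...   | ()
  canonical-exists (suc k) e de kl | inj₂ (c , oj , d , be) =
    can▷ oj (canonical-exists k c dc k≤n) (subst (λ k → Copy G c (eSeq k) sE) dc (copy-exists c be (≤-trans (≤-reflexive dc) k≤n)))
    where
    dc : dep c ≡ k
    dc = suc-injective (trans (sym d) de)
    k≤n : k ≤ n
    k≤n = ≤-trans (n≤1+n k) kl

  canonical-unique : ∀ {e U} → dep e ≤ n → Canonical G e U → U ≡ eSeq (dep e)
  canonical-unique _ (can∅ on) = cong eSeq (sym (outer-nothing on))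
  canonical-unique dl (can▷ {c = c} {t = t} oj cc cp) =
    let (d , be) = outer-just oj
        dc≤n = ≤-trans (n≤1+n _) (subst (_≤ n) d dl)
    in trans (cong₂ _▷_ (canonical-unique dc≤n cc) (copy-unique c _ be dc≤n t cp)) (cong eSeq (sym d))

-- The labelling of the net of a derivation

formulaAt : ∀ {Γ} → Pos Γ → Form
formulaAt {A ∷ Γ} here = A
formulaAt (there p) = formulaAt p

-- Hypothesis tails (inj₂ p) and the conclusion head (inj₂ tt) of an open net
-- are labelled only by their depth 0 and their type.
record OpenWellLabelled {Γ : List Form} (B : Form) (o : ONet (Pos Γ)) : Set where
  open ONet o
  field
    labels : Labelling T H
  open Labelling labels public
  field
    coherent : ∀ v → Coherent labels (shp v)
    tdepth-dep : ∀ t → tdepth t ≡ dep t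
    depth-nxt : ∀ g → [ tdepth , (λ _ → 0) ]′ g ≡ [ hdepth , (λ _ → 0) ]′ (nxt g)
    type-nxt : ∀ g → [ ttype , (λ p → skeleton (formulaAt p)) ]′ g ≡ [ htype , (λ _ → skeleton B) ]′ (nxt g)
    rank-right : ∀ t h → nxt (inj₁ t) ≡ inj₁ h → RightTail (tkind t) → hrank h < trank t
    rank-left : ∀ t h → nxt (inj₁ t) ≡ inj₁ h → LeftTail (tkind t) → LeftHead (hkind h) → trank t < hrank h
    rank-bound : ℕ
    trank<bound : ∀ t → trank t < rank-bound
    hrank<bound : ∀ h → hrank h < rank-bound
    head-attached : ∀ h → HeadAttached shp h
    tail-attached : ∀ t → TailAttached shp t
    head-fed : ∀ v s h → shp v ≡ s → HeadIn h s → Σ (T ⊎ Pos Γ) λ g → nxt g ≡ inj₁ h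
    conclusion : Σ (T ⊎ Pos Γ) λ g → nxt g ≡ inj₂ tt
    conclusion-unique : ∀ g g' → nxt g ≡ inj₂ tt → nxt g' ≡ inj₂ tt → g ≡ g'
    L!-boxEdge : ∀ v c a bx → shp v ≡ L! c a bx → IsBoxEdge shp bx
    outer-box : ∀ t → OuterBox shp outer dep t

HeadIn-map : ∀ {T H T' H' : Set} (f : T → T') (g : H → H') {h s} → HeadIn h s → HeadIn (g h) (mapSh f g s)
HeadIn-map f g iR⊸b = iR⊸b
HeadIn-map f g iL⊸c = iL⊸c
HeadIn-map f g iL⊸a = iL⊸a
HeadIn-map f g iR⊗a = iR⊗a
HeadIn-map f g iR⊗b = iR⊗b
HeadIn-map f g iL⊗c = iL⊗c
HeadIn-map f g iR∀a = iR∀a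
HeadIn-map f g iL∀c = iL∀c
HeadIn-map f g iXc = iXc
HeadIn-map f g iDc = iDc
HeadIn-map f g iNc = iNc
HeadIn-map f g iWc = iWc
HeadIn-map f g iR!a = iR!a
HeadIn-map f g iL!c = iL!c

TailIn-map : ∀ {T H T' H' : Set} (f : T → T') (g : H → H') {t s} → TailIn t s → TailIn (f t) (mapSh f g s)
TailIn-map f g jR⊸a = jR⊸a
TailIn-map f g jR⊸c = jR⊸c
TailIn-map f g jL⊸b = jL⊸b
TailIn-map f g jR⊗c = jR⊗c
TailIn-map f g jL⊗a = jL⊗a
TailIn-map f g jL⊗b = jL⊗b
TailIn-map f g jR∀c = jR∀c
TailIn-map f g jL∀a = jL∀a
TailIn-map f g jXa = jXa
TailIn-map f g jXb = jXb
TailIn-map f g jDa = jDa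
TailIn-map f g jNa = jNa
TailIn-map f g jR!c = jR!c
TailIn-map f g jL!a = jL!a

HeadIn-unmap : ∀ {T H T' H' : Set} (f : T → T') (g : H → H') s {h} → HeadIn h (mapSh f g s) → Σ H λ h₀ → (g h₀ ≡ h) × HeadIn h₀ s
HeadIn-unmap f g (R⊸ a b c) iR⊸b = b , refl , iR⊸b
HeadIn-unmap f g (L⊸ c a b) iL⊸c = c , refl , iL⊸c
HeadIn-unmap f g (L⊸ c a b) iL⊸a = a , refl , iL⊸a
HeadIn-unmap f g (R⊗ a b c) iR⊗a = a , refl , iR⊗a
HeadIn-unmap f g (R⊗ a b c) iR⊗b = b , refl , iR⊗b
HeadIn-unmap f g (L⊗ c a b) iL⊗c = c , refl , iL⊗c
HeadIn-unmap f g (R∀ a c) iR∀a = a , refl , iR∀a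
HeadIn-unmap f g (L∀ c a) iL∀c = c , refl , iL∀c
HeadIn-unmap f g (X c a b) iXc = c , refl , iXc
HeadIn-unmap f g (D c a) iDc = c , refl , iDc
HeadIn-unmap f g (N c a) iNc = c , refl , iNc
HeadIn-unmap f g (W c) iWc = c , refl , iWc
HeadIn-unmap f g (R! a c) iR!a = a , refl , iR!a
HeadIn-unmap f g (L! c a bx) iL!c = c , refl , iL!c

L!-unmap : ∀ {T H T' H' : Set} (f : T → T') (g : H → H') s {c a bx} → mapSh f g s ≡ L! c a bx →
           Σ H λ c₀ → Σ T λ a₀ → Σ T λ bx₀ → (s ≡ L! c₀ a₀ bx₀) × (f bx₀ ≡ bx)
L!-unmap f g (L! c a bx) refl = c , a , bx , refl , refl

module Embedding {T H V T' H' V' : Set} {shp : V → Shape T H} {shp' : V' → Shape T' H'}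
  {outer : T → Maybe T} {dep : T → ℕ} {outer' : T' → Maybe T'} {dep' : T' → ℕ}
  (f : T → T') (g : H → H') (fv : V → V') (shp-fv : ∀ v → shp' (fv v) ≡ mapSh f g (shp v)) where

  head-attached-map : ∀ {h} → HeadAttached shp h → HeadAttached shp' (g h)
  head-attached-map (v , s , refl , hi) = fv v , mapSh f g s , shp-fv v , HeadIn-map f g hi

  tail-attached-map : ∀ {t} → TailAttached shp t → TailAttached shp' (f t)
  tail-attached-map (v , s , refl , ti) = fv v , mapSh f g s , shp-fv v , TailIn-map f g ti

  boxEdge-map : ∀ {c} → IsBoxEdge shp c → IsBoxEdge shp' (f c)
  boxEdge-map (w , a , eq) = fv w , g a , trans (shp-fv w) (cong (mapSh f g) eq)

  head-unmap : ∀ v {s h} → shp' (fv v) ≡ s → HeadIn h s → Σ H λ h₀ → (g h₀ ≡ h) × HeadIn h₀ (shp v)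
  head-unmap v refl hi = HeadIn-unmap f g (shp v) (subst (HeadIn _) (shp-fv v) hi)

  L!-boxEdge-map : (∀ v c a bx → shp v ≡ L! c a bx → IsBoxEdge shp bx) →
                   ∀ v c a bx → shp' (fv v) ≡ L! c a bx → IsBoxEdge shp' bx
  L!-boxEdge-map boxOf v _ _ _ eq with L!-unmap f g (shp v) (trans (sym (shp-fv v)) eq)
  ... | (c₀ , a₀ , bx₀ , eq₀ , refl) = boxEdge-map (boxOf v c₀ a₀ bx₀ eq₀)

  outer-box-map : (∀ t → outer' (f t) ≡ liftO f (outer t)) → (∀ t → dep' (f t) ≡ dep t) →
                  ∀ t → OuterBox shp outer dep t → OuterBox shp' outer' dep' (f t)
  outer-box-map o≡ d≡ t (inj₁ (on , d0)) = inj₁ (trans (o≡ t) (cong (liftO f) on) , trans (d≡ t) d0)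
  outer-box-map o≡ d≡ t (inj₂ (c , oj , d , be)) =
    inj₂ (f c , trans (o≡ t) (cong (liftO f) oj) , trans (d≡ t) (trans d (cong suc (sym (d≡ c)))) , boxEdge-map be)

record LabellingMap {T H T' H' : Set} (L : Labelling T H) (L' : Labelling T' H') (f : T → T') (g : H → H') (kd kr : ℕ) : Set where
  private
    module A = Labelling L
    module B = Labelling L'
  field
    tkind≡ : ∀ t → B.tkind (f t) ≡ A.tkind t
    hkind≡ : ∀ h → B.hkind (g h) ≡ A.hkind h
    trank≡ : ∀ t → B.trank (f t) ≡ kr + A.trank t
    hrank≡ : ∀ h → B.hrank (g h) ≡ kr + A.hrank h
    tdepth≡ : ∀ t → B.tdepth (f t) ≡ kd + A.tdepth t
    hdepth≡ : ∀ h → B.hdepth (g h) ≡ kd + A.hdepth h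
    ttype≡ : ∀ t → B.ttype (f t) ≡ A.ttype t
    htype≡ : ∀ h → B.htype (g h) ≡ A.htype h

module _ {T H T' H' : Set} {L : Labelling T H} {L' : Labelling T' H'} {f : T → T'} {g : H → H'} {kd kr : ℕ}
         (M : LabellingMap L L' f g kd kr) where
  open LabellingMap M

  Coherent-map : ∀ s → Coherent L s → Coherent L' (mapSh f g s)
  Coherent-map (R⊸ a b c) (p1 , p2 , p3 , p4 , p5 , p6 , p7)
    rewrite tkind≡ a | tkind≡ c | hkind≡ b | trank≡ a | trank≡ c | hrank≡ b | tdepth≡ a | tdepth≡ c | hdepth≡ b =
    p1 , p2 , p3 , cong (kr +_) p4 , cong (kr +_) p5 , cong (kd +_) p6 , cong (kd +_) p7
  Coherent-map (L⊸ c a b) (p1 , p2 , p3 , p4 , p5 , p6 , p7 , k , p8)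
    rewrite hkind≡ c | hkind≡ a | tkind≡ b | hrank≡ c | hrank≡ a | trank≡ b | hdepth≡ c | hdepth≡ a | tdepth≡ b | htype≡ c | ttype≡ b =
    p1 , p2 , p3 , cong (kr +_) p4 , cong (kr +_) p5 , cong (kd +_) p6 , cong (kd +_) p7 , k , p8
  Coherent-map (R⊗ a b c) (p1 , p2 , p3 , p4 , p5 , p6 , p7)
    rewrite hkind≡ a | hkind≡ b | tkind≡ c | hrank≡ a | hrank≡ b | trank≡ c | hdepth≡ a | hdepth≡ b | tdepth≡ c =
    p1 , p2 , p3 , cong (kr +_) p4 , cong (kr +_) p5 , cong (kd +_) p6 , cong (kd +_) p7
  Coherent-map (L⊗ c a b) (p1 , p2 , p3 , p4 , p5 , p6 , p7 , p8)
    rewrite hkind≡ c | tkind≡ a | tkind≡ b | hrank≡ c | trank≡ a | trank≡ b | hdepth≡ c | tdepth≡ a | tdepth≡ b | htype≡ c | ttype≡ a | ttype≡ b =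
    p1 , p2 , p3 , cong (kr +_) p4 , cong (kr +_) p5 , cong (kd +_) p6 , cong (kd +_) p7 , p8
  Coherent-map (R∀ a c) (p1 , p2 , p3 , p4)
    rewrite hkind≡ a | tkind≡ c | hrank≡ a | trank≡ c | hdepth≡ a | tdepth≡ c =
    p1 , p2 , cong (kr +_) p3 , cong (kd +_) p4
  Coherent-map (L∀ c a) (p1 , p2 , p3 , p4 , k , p5 , p6)
    rewrite hkind≡ c | tkind≡ a | hrank≡ c | trank≡ a | hdepth≡ c | tdepth≡ a | htype≡ c | ttype≡ a =
    p1 , p2 , cong (kr +_) p3 , cong (kd +_) p4 , k , p5 , p6
  Coherent-map (X c a b) (p1 , p2 , p3 , p4 , p5 , p6 , p7 , k , p8 , p9 , p10)
    rewrite hkind≡ c | tkind≡ a | tkind≡ b | hrank≡ c | trank≡ a | trank≡ b | hdepth≡ c | tdepth≡ a | tdepth≡ b | htype≡ c | ttype≡ a | ttype≡ b =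
    p1 , p2 , p3 , cong (kr +_) p4 , cong (kr +_) p5 , cong (kd +_) p6 , cong (kd +_) p7 , k , p8 , p9 , p10
  Coherent-map (D c a) (p1 , p2 , p3 , p4 , p5)
    rewrite hkind≡ c | tkind≡ a | hrank≡ c | trank≡ a | hdepth≡ c | tdepth≡ a | htype≡ c | ttype≡ a =
    p1 , p2 , cong (kr +_) p3 , cong (kd +_) p4 , p5
  Coherent-map (N c a) (p1 , p2 , p3 , p4 , k , p5 , p6)
    rewrite hkind≡ c | tkind≡ a | hrank≡ c | trank≡ a | hdepth≡ c | tdepth≡ a | htype≡ c | ttype≡ a =
    p1 , p2 , cong (kr +_) p3 , cong (kd +_) p4 , k , p5 , p6
  Coherent-map (W c) p1 rewrite hkind≡ c = p1
  Coherent-map (R! a c) (p1 , p2 , p3 , p4)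
    rewrite hkind≡ a | tkind≡ c | hrank≡ a | trank≡ c | hdepth≡ a | tdepth≡ c =
    p1 , p2 , cong (kr +_) p3 , trans (cong (kd +_) p4) (+-suc kd _)
  Coherent-map (L! c a bx) (p1 , p2 , p3 , p4 , p5 , p6 , p7 , p8)
    rewrite hkind≡ c | tkind≡ a | tkind≡ bx | hrank≡ c | trank≡ a | trank≡ bx | tdepth≡ a | hdepth≡ c | tdepth≡ bx | htype≡ c | ttype≡ a =
    p1 , p2 , p3 , cong (kr +_) p4 , cong (kr +_) p5 , trans (cong (kd +_) p6) (+-suc kd _) , cong (kd +_) p7 , p8

route-≡ : ∀ {H H' X : Set} (f : H → H') (k : H' ⊎ ⊤) {F : H ⊎ ⊤ → X} (F' : H' ⊎ ⊤ → X) →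
          (∀ h → F' (inj₁ (f h)) ≡ F (inj₁ h)) → F' k ≡ F (inj₂ tt) → ∀ x → F' (route f k x) ≡ F x
route-≡ f k F' p q (inj₁ h) = p h
route-≡ f k F' p q (inj₂ tt) = q

route-inj₂ : ∀ {H H' : Set} (f : H → H') (k : H' ⊎ ⊤) x → route f k x ≡ inj₂ tt → (x ≡ inj₂ tt) × (k ≡ inj₂ tt)
route-inj₂ f k (inj₁ h) ()
route-inj₂ f k (inj₂ tt) e = refl , e

route-inj₁ : ∀ {H H' : Set} (f : H → H') (k : H' ⊎ ⊤) x h' → route f k x ≡ inj₁ h' →
             (Σ H λ h → (x ≡ inj₁ h) × (f h ≡ h')) ⊎ ((x ≡ inj₂ tt) × (k ≡ inj₁ h'))
route-inj₁ f k (inj₁ h) h' refl = inj₁ (h , refl , refl)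
route-inj₁ f k (inj₂ tt) h' e = inj₂ (refl , e)

there-injective : ∀ {A Γ} {p q : Pos Γ} → _≡_ {A = Pos (A ∷ Γ)} (there p) (there q) → p ≡ q
there-injective refl = refl

formulaAt-mapPos : ∀ {f : Form → Form} {Γ} (p : Pos Γ) → formulaAt (mapPos {f} p) ≡ f (formulaAt p)
formulaAt-mapPos here = refl
formulaAt-mapPos (there p) = formulaAt-mapPos p

formulaAt-unmapPos : ∀ {f : Form → Form} Γ (p : Pos (map f Γ)) → formulaAt p ≡ f (formulaAt (unmapPos Γ p))
formulaAt-unmapPos (A ∷ Γ) here = refl
formulaAt-unmapPos (A ∷ Γ) (there p) = formulaAt-unmapPos Γ p

mapPos-unmapPos : ∀ {f : Form → Form} Γ (q : Pos (map f Γ)) → mapPos (unmapPos Γ q) ≡ q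
mapPos-unmapPos (A ∷ Γ) here = refl
mapPos-unmapPos (A ∷ Γ) (there q) = cong there (mapPos-unmapPos Γ q)

unmapPos-mapPos : ∀ {f : Form → Form} Γ (p : Pos Γ) → unmapPos {f} Γ (mapPos p) ≡ p
unmapPos-mapPos (A ∷ Γ) here = refl
unmapPos-mapPos (A ∷ Γ) (there p) = cong there (unmapPos-mapPos Γ p)

swapPos-involutive : ∀ Γ {Δ A B} (q : Pos (Γ ++ A ∷ B ∷ Δ)) → swapPos Γ {Δ} {A} {B} (swapPos Γ {Δ} {B} {A} q) ≡ q
swapPos-involutive [] here = refl
swapPos-involutive [] (there here) = refl
swapPos-involutive [] (there (there q)) = refl
swapPos-involutive (C ∷ Γ) here = refl
swapPos-involutive (C ∷ Γ) (there q) = cong there (swapPos-involutive Γ q)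

formulaAt-swapPos : ∀ Γ {Δ A B} (p : Pos (Γ ++ B ∷ A ∷ Δ)) → formulaAt (swapPos Γ {Δ} {A} {B} p) ≡ formulaAt p
formulaAt-swapPos [] here = refl
formulaAt-swapPos [] (there here) = refl
formulaAt-swapPos [] (there (there p)) = refl
formulaAt-swapPos (C ∷ Γ) here = refl
formulaAt-swapPos (C ∷ Γ) (there p) = formulaAt-swapPos Γ p

injˡ : ∀ Γ {Δ} → Pos Γ → Pos (Γ ++ Δ)
injˡ (A ∷ Γ) here = here
injˡ (A ∷ Γ) (there p) = there (injˡ Γ p)

injʳ : ∀ Γ {Δ} → Pos Δ → Pos (Γ ++ Δ)
injʳ [] q = q
injʳ (A ∷ Γ) q = there (injʳ Γ q)

splitPos-injˡ : ∀ Γ {Δ} (q : Pos Γ) → splitPos Γ {Δ} (injˡ Γ q) ≡ inj₁ q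
splitPos-injˡ (A ∷ Γ) here = refl
splitPos-injˡ (A ∷ Γ) {Δ} (there q) rewrite splitPos-injˡ Γ {Δ} q = refl

splitPos-injʳ : ∀ Γ {Δ} (q : Pos Δ) → splitPos Γ {Δ} (injʳ Γ q) ≡ inj₂ q
splitPos-injʳ [] q = refl
splitPos-injʳ (A ∷ Γ) {Δ} q rewrite splitPos-injʳ Γ {Δ} q = refl

splitPos-injective : ∀ Γ {Δ} (p p' : Pos (Γ ++ Δ)) → splitPos Γ p ≡ splitPos Γ p' → p ≡ p'
splitPos-injective [] p p' e = inj₂-injective e
splitPos-injective (A ∷ Γ) here here e = refl
splitPos-injective (A ∷ Γ) here (there p') e with splitPos Γ p'
splitPos-injective (A ∷ Γ) here (there p') () | inj₁ _
splitPos-injective (A ∷ Γ) here (there p') () | inj₂ _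
splitPos-injective (A ∷ Γ) (there p) here e with splitPos Γ p
splitPos-injective (A ∷ Γ) (there p) here () | inj₁ _
splitPos-injective (A ∷ Γ) (there p) here () | inj₂ _
splitPos-injective (A ∷ Γ) (there p) (there p') e with splitPos Γ p in e₁ | splitPos Γ p' in e₂
... | inj₁ q | inj₁ q' = cong there (splitPos-injective Γ p p' (trans e₁ (trans (cong inj₁ (there-injective (inj₁-injective e))) (sym e₂))))
... | inj₂ q | inj₂ q' = cong there (splitPos-injective Γ p p' (trans e₁ (trans (cong inj₂ (inj₂-injective e)) (sym e₂))))
... | inj₁ q | inj₂ q' with e
...   | ()
splitPos-injective (A ∷ Γ) (there p) (there p') e | inj₂ q | inj₁ q' with e
...   | ()

formulaAt-splitPos : ∀ Γ {Δ} (p : Pos (Γ ++ Δ)) → formulaAt p ≡ [ formulaAt , formulaAt ]′ (splitPos Γ p)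
formulaAt-splitPos [] p = refl
formulaAt-splitPos (A ∷ Γ) here = refl
formulaAt-splitPos (A ∷ Γ) (there p) with splitPos Γ p in e
... | inj₁ q = trans (formulaAt-splitPos Γ p) (cong [ formulaAt , formulaAt ]′ e)
... | inj₂ q = trans (formulaAt-splitPos Γ p) (cong [ formulaAt , formulaAt ]′ e)

skeleton-ren : ∀ ρ A → skeleton (ren ρ A) ≡ skeleton A
skeleton-ren ρ (var x) = refl
skeleton-ren ρ (A ⊸ B) = cong₂ _s⊸_ (skeleton-ren ρ A) (skeleton-ren ρ B)
skeleton-ren ρ (A ⊗ B) = cong₂ _s⊗_ (skeleton-ren ρ A) (skeleton-ren ρ B)
skeleton-ren ρ (! A) = cong s! (skeleton-ren ρ A)
skeleton-ren ρ (∀' A) = cong s∀ (skeleton-ren (ext ρ) A)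

skeleton-sub : ∀ σ A → skeleton A ≼ skeleton (sub σ A)
skeleton-sub σ (var x) = ≼v
skeleton-sub σ (A ⊸ B) = ≼⊸ (skeleton-sub σ A) (skeleton-sub σ B)
skeleton-sub σ (A ⊗ B) = ≼⊗ (skeleton-sub σ A) (skeleton-sub σ B)
skeleton-sub σ (! A) = ≼! (skeleton-sub σ A)
skeleton-sub σ (∀' A) = ≼∀ (skeleton-sub (exts σ) A)

module R∀-labelling {Γ : List Form} {A : Form} (d : map (ren suc) Γ ⊢ A) (w : OpenWellLabelled A (onet d)) where
  private
    module N = ONet (onet d)
    module W = OpenWellLabelled w
    o = onet (R∀ {Γ} {A} d)
    module O = ONet o
  open OpenWellLabelled
  open Embedding {shp = N.shp} {O.shp} {N.outer} {N.dep} {O.outer} {O.dep} inj₁ inj₁ inj₁ (λ _ → refl)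

  labels′ : Labelling O.T O.H
  labels′ = record
    { tkind = [ W.tkind , (λ _ → kR∀c) ]′ ; hkind = [ W.hkind , (λ _ → hR∀a) ]′
    ; trank = [ suc ∘ W.trank , (λ _ → 0) ]′ ; hrank = [ suc ∘ W.hrank , (λ _ → 0) ]′
    ; tdepth = [ W.tdepth , (λ _ → 0) ]′ ; hdepth = [ W.hdepth , (λ _ → 0) ]′
    ; ttype = [ W.ttype , (λ _ → s∀ (skeleton A)) ]′ ; htype = [ W.htype , (λ _ → skeleton A) ]′ }

  embedded : LabellingMap W.labels labels′ inj₁ inj₁ 0 1
  embedded = record { tkind≡ = λ _ → refl ; hkind≡ = λ _ → refl ; trank≡ = λ _ → refl ; hrank≡ = λ _ → refl
                    ; tdepth≡ = λ _ → refl ; hdepth≡ = λ _ → refl ; ttype≡ = λ _ → refl ; htype≡ = λ _ → refl }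

  r : N.H ⊎ ⊤ → O.H ⊎ ⊤
  r = route inj₁ (inj₁ (inj₂ tt))

  emb : N.T ⊎ Pos (map (ren suc) Γ) → O.T ⊎ Pos Γ
  emb (inj₁ t) = inj₁ (inj₁ t)
  emb (inj₂ q) = inj₂ (unmapPos Γ q)

  nxt-emb : ∀ g → O.nxt (emb g) ≡ r (N.nxt g)
  nxt-emb (inj₁ t) = refl
  nxt-emb (inj₂ q) = cong (λ z → r (N.nxt (inj₂ z))) (mapPos-unmapPos Γ q)

  hdepth′ : O.H ⊎ ⊤ → ℕ
  hdepth′ = [ Labelling.hdepth labels′ , (λ _ → 0) ]′

  htype′ : O.H ⊎ ⊤ → Skel
  htype′ = [ Labelling.htype labels′ , (λ _ → skeleton (∀' A)) ]′

  hdepth-r : ∀ x → hdepth′ (r x) ≡ [ W.hdepth , (λ _ → 0) ]′ x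
  hdepth-r = route-≡ inj₁ _ hdepth′ (λ _ → refl) refl

  htype-r : ∀ x → htype′ (r x) ≡ [ W.htype , (λ _ → skeleton A) ]′ x
  htype-r = route-≡ inj₁ _ htype′ (λ _ → refl) refl

  not-conclusion : ∀ x → r x ≢ inj₂ tt
  not-conclusion x e with route-inj₂ inj₁ _ x e
  ... | (_ , ())

  labelled : OpenWellLabelled (∀' A) o
  labelled .labels = labels′
  labelled .coherent (inj₁ v) = Coherent-map embedded (N.shp v) (W.coherent v)
  labelled .coherent (inj₂ tt) = refl , refl , refl , refl
  labelled .tdepth-dep (inj₁ t) = W.tdepth-dep t
  labelled .tdepth-dep (inj₂ _) = refl
  labelled .depth-nxt (inj₁ (inj₁ t)) = trans (W.depth-nxt (inj₁ t)) (sym (hdepth-r (N.nxt (inj₁ t))))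
  labelled .depth-nxt (inj₁ (inj₂ _)) = refl
  labelled .depth-nxt (inj₂ p) = trans (W.depth-nxt (inj₂ (mapPos p))) (sym (hdepth-r (N.nxt (inj₂ (mapPos p)))))
  labelled .type-nxt (inj₁ (inj₁ t)) = trans (W.type-nxt (inj₁ t)) (sym (htype-r (N.nxt (inj₁ t))))
  labelled .type-nxt (inj₁ (inj₂ _)) = refl
  labelled .type-nxt (inj₂ p) =
    trans (sym (trans (cong skeleton (formulaAt-mapPos p)) (skeleton-ren suc (formulaAt p))))
          (trans (W.type-nxt (inj₂ (mapPos p))) (sym (htype-r (N.nxt (inj₂ (mapPos p))))))
  labelled .rank-right (inj₁ t) h e rt with route-inj₁ inj₁ _ (N.nxt (inj₁ t)) h e
  ... | inj₁ (h₀ , e₀ , refl) = s≤s (W.rank-right t h₀ e₀ rt)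
  ... | inj₂ (_ , refl) = s≤s z≤n
  labelled .rank-right (inj₂ _) h () _
  labelled .rank-left (inj₁ t) h e lt lh with route-inj₁ inj₁ _ (N.nxt (inj₁ t)) h e
  ... | inj₁ (h₀ , e₀ , refl) = s≤s (W.rank-left t h₀ e₀ lt lh)
  ... | inj₂ (_ , refl) with lh
  ...   | ()
  labelled .rank-left (inj₂ _) h () _ _
  labelled .rank-bound = suc W.rank-bound
  labelled .trank<bound (inj₁ t) = s≤s (W.trank<bound t)
  labelled .trank<bound (inj₂ _) = s≤s z≤n
  labelled .hrank<bound (inj₁ h) = s≤s (W.hrank<bound h)
  labelled .hrank<bound (inj₂ _) = s≤s z≤n
  labelled .head-attached (inj₁ h) = head-attached-map (W.head-attached h)
  labelled .head-attached (inj₂ tt) = inj₂ tt , _ , refl , iR∀a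
  labelled .tail-attached (inj₁ t) = tail-attached-map (W.tail-attached t)
  labelled .tail-attached (inj₂ _) = inj₂ tt , _ , refl , jR∀c
  labelled .head-fed (inj₁ v) s h eq hi with head-unmap v eq hi
  ... | (h₀ , refl , hi₀) with W.head-fed v (N.shp v) h₀ refl hi₀
  ...   | (g , e) = emb g , trans (nxt-emb g) (cong r e)
  labelled .head-fed (inj₂ tt) s h refl iR∀a =
    let (g , e) = W.conclusion in emb g , trans (nxt-emb g) (cong r e)
  labelled .conclusion = inj₁ (inj₂ tt) , refl
  labelled .conclusion-unique (inj₁ (inj₂ tt)) (inj₁ (inj₂ tt)) _ _ = refl
  labelled .conclusion-unique (inj₁ (inj₁ t)) _ e _ = ⊥-elim (not-conclusion _ e)
  labelled .conclusion-unique (inj₂ p) _ e _ = ⊥-elim (not-conclusion _ e)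
  labelled .conclusion-unique (inj₁ (inj₂ tt)) (inj₁ (inj₁ t)) _ e = ⊥-elim (not-conclusion _ e)
  labelled .conclusion-unique (inj₁ (inj₂ tt)) (inj₂ p) _ e = ⊥-elim (not-conclusion _ e)
  labelled .L!-boxEdge (inj₁ v) = L!-boxEdge-map W.L!-boxEdge v
  labelled .L!-boxEdge (inj₂ tt) _ _ _ ()
  labelled .outer-box (inj₁ t) = outer-box-map (λ _ → refl) (λ _ → refl) t (W.outer-box t)
  labelled .outer-box (inj₂ _) = inj₁ (refl , refl)

tkind-by : TailKind → TailKind → Bool → TailKind
tkind-by a b true = a
tkind-by a b false = b

module R⊸-labelling {Γ : List Form} {A B : Form} (d : A ∷ Γ ⊢ B) (w : OpenWellLabelled B (onet d)) where
  private
    module N = ONet (onet d)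
    module W = OpenWellLabelled w
    o = onet (R⊸ {Γ} {A} {B} d)
    module O = ONet o
  open OpenWellLabelled
  open Embedding {shp = N.shp} {O.shp} {N.outer} {N.dep} {O.outer} {O.dep} inj₁ inj₁ inj₁ (λ _ → refl)

  ttype-new : Bool → Skel
  ttype-new true = skeleton A
  ttype-new false = skeleton A s⊸ skeleton B

  labels′ : Labelling O.T O.H
  labels′ = record
    { tkind = [ W.tkind , tkind-by kR⊸a kR⊸c ]′ ; hkind = [ W.hkind , (λ _ → hR⊸b) ]′
    ; trank = [ suc ∘ W.trank , (λ _ → 0) ]′ ; hrank = [ suc ∘ W.hrank , (λ _ → 0) ]′
    ; tdepth = [ W.tdepth , (λ _ → 0) ]′ ; hdepth = [ W.hdepth , (λ _ → 0) ]′
    ; ttype = [ W.ttype , ttype-new ]′ ; htype = [ W.htype , (λ _ → skeleton B) ]′ }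

  embedded : LabellingMap W.labels labels′ inj₁ inj₁ 0 1
  embedded = record { tkind≡ = λ _ → refl ; hkind≡ = λ _ → refl ; trank≡ = λ _ → refl ; hrank≡ = λ _ → refl
                    ; tdepth≡ = λ _ → refl ; hdepth≡ = λ _ → refl ; ttype≡ = λ _ → refl ; htype≡ = λ _ → refl }

  r : N.H ⊎ ⊤ → O.H ⊎ ⊤
  r = route inj₁ (inj₁ (inj₂ tt))

  emb : N.T ⊎ Pos (A ∷ Γ) → O.T ⊎ Pos Γ
  emb (inj₁ t) = inj₁ (inj₁ t)
  emb (inj₂ here) = inj₁ (inj₂ true)
  emb (inj₂ (there p)) = inj₂ p

  nxt-emb : ∀ g → O.nxt (emb g) ≡ r (N.nxt g)
  nxt-emb (inj₁ t) = refl
  nxt-emb (inj₂ here) = refl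
  nxt-emb (inj₂ (there p)) = refl

  hdepth′ : O.H ⊎ ⊤ → ℕ
  hdepth′ = [ Labelling.hdepth labels′ , (λ _ → 0) ]′

  htype′ : O.H ⊎ ⊤ → Skel
  htype′ = [ Labelling.htype labels′ , (λ _ → skeleton (A ⊸ B)) ]′

  hdepth-r : ∀ x → hdepth′ (r x) ≡ [ W.hdepth , (λ _ → 0) ]′ x
  hdepth-r = route-≡ inj₁ _ hdepth′ (λ _ → refl) refl

  htype-r : ∀ x → htype′ (r x) ≡ [ W.htype , (λ _ → skeleton B) ]′ x
  htype-r = route-≡ inj₁ _ htype′ (λ _ → refl) refl

  not-conclusion : ∀ x → r x ≢ inj₂ tt
  not-conclusion x e with route-inj₂ inj₁ _ x e
  ... | (_ , ())

  labelled : OpenWellLabelled (A ⊸ B) o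
  labelled .labels = labels′
  labelled .coherent (inj₁ v) = Coherent-map embedded (N.shp v) (W.coherent v)
  labelled .coherent (inj₂ tt) = refl , refl , refl , refl , refl , refl , refl
  labelled .tdepth-dep (inj₁ t) = W.tdepth-dep t
  labelled .tdepth-dep (inj₂ _) = refl
  labelled .depth-nxt (inj₁ (inj₁ t)) = trans (W.depth-nxt (inj₁ t)) (sym (hdepth-r (N.nxt (inj₁ t))))
  labelled .depth-nxt (inj₁ (inj₂ true)) = trans (W.depth-nxt (inj₂ here)) (sym (hdepth-r (N.nxt (inj₂ here))))
  labelled .depth-nxt (inj₁ (inj₂ false)) = refl
  labelled .depth-nxt (inj₂ p) = trans (W.depth-nxt (inj₂ (there p))) (sym (hdepth-r (N.nxt (inj₂ (there p)))))
  labelled .type-nxt (inj₁ (inj₁ t)) = trans (W.type-nxt (inj₁ t)) (sym (htype-r (N.nxt (inj₁ t))))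
  labelled .type-nxt (inj₁ (inj₂ true)) = trans (W.type-nxt (inj₂ here)) (sym (htype-r (N.nxt (inj₂ here))))
  labelled .type-nxt (inj₁ (inj₂ false)) = refl
  labelled .type-nxt (inj₂ p) = trans (W.type-nxt (inj₂ (there p))) (sym (htype-r (N.nxt (inj₂ (there p)))))
  labelled .rank-right (inj₁ t) h e rt with route-inj₁ inj₁ _ (N.nxt (inj₁ t)) h e
  ... | inj₁ (h₀ , e₀ , refl) = s≤s (W.rank-right t h₀ e₀ rt)
  ... | inj₂ (_ , refl) = s≤s z≤n
  labelled .rank-right (inj₂ true) h e ()
  labelled .rank-right (inj₂ false) h () _
  labelled .rank-left (inj₁ t) h e lt lh with route-inj₁ inj₁ _ (N.nxt (inj₁ t)) h e
  ... | inj₁ (h₀ , e₀ , refl) = s≤s (W.rank-left t h₀ e₀ lt lh)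
  ... | inj₂ (_ , refl) with lh
  ...   | ()
  labelled .rank-left (inj₂ true) h e lt lh with route-inj₁ inj₁ _ (N.nxt (inj₂ here)) h e
  ... | inj₁ (h₀ , e₀ , refl) = s≤s z≤n
  ... | inj₂ (_ , refl) with lh
  ...   | ()
  labelled .rank-left (inj₂ false) h () _ _
  labelled .rank-bound = suc W.rank-bound
  labelled .trank<bound (inj₁ t) = s≤s (W.trank<bound t)
  labelled .trank<bound (inj₂ _) = s≤s z≤n
  labelled .hrank<bound (inj₁ h) = s≤s (W.hrank<bound h)
  labelled .hrank<bound (inj₂ _) = s≤s z≤n
  labelled .head-attached (inj₁ h) = head-attached-map (W.head-attached h)
  labelled .head-attached (inj₂ tt) = inj₂ tt , _ , refl , iR⊸b
  labelled .tail-attached (inj₁ t) = tail-attached-map (W.tail-attached t)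
  labelled .tail-attached (inj₂ true) = inj₂ tt , _ , refl , jR⊸a
  labelled .tail-attached (inj₂ false) = inj₂ tt , _ , refl , jR⊸c
  labelled .head-fed (inj₁ v) s h eq hi with head-unmap v eq hi
  ... | (h₀ , refl , hi₀) with W.head-fed v (N.shp v) h₀ refl hi₀
  ...   | (g , e) = emb g , trans (nxt-emb g) (cong r e)
  labelled .head-fed (inj₂ tt) s h refl iR⊸b =
    let (g , e) = W.conclusion in emb g , trans (nxt-emb g) (cong r e)
  labelled .conclusion = inj₁ (inj₂ false) , refl
  labelled .conclusion-unique (inj₁ (inj₂ false)) (inj₁ (inj₂ false)) _ _ = refl
  labelled .conclusion-unique (inj₁ (inj₁ t)) _ e _ = ⊥-elim (not-conclusion _ e)
  labelled .conclusion-unique (inj₁ (inj₂ true)) _ e _ = ⊥-elim (not-conclusion _ e)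
  labelled .conclusion-unique (inj₂ p) _ e _ = ⊥-elim (not-conclusion _ e)
  labelled .conclusion-unique (inj₁ (inj₂ false)) (inj₁ (inj₁ t)) _ e = ⊥-elim (not-conclusion _ e)
  labelled .conclusion-unique (inj₁ (inj₂ false)) (inj₁ (inj₂ true)) _ e = ⊥-elim (not-conclusion _ e)
  labelled .conclusion-unique (inj₁ (inj₂ false)) (inj₂ p) _ e = ⊥-elim (not-conclusion _ e)
  labelled .L!-boxEdge (inj₁ v) = L!-boxEdge-map W.L!-boxEdge v
  labelled .L!-boxEdge (inj₂ tt) _ _ _ ()
  labelled .outer-box (inj₁ t) = outer-box-map (λ _ → refl) (λ _ → refl) t (W.outer-box t)
  labelled .outer-box (inj₂ _) = inj₁ (refl , refl)

module OneUp-labelling {Γ' Γ : List Form} {A B : Form} (K : Set) (n : ONet (Pos Γ')) (cons : K → Pos Γ')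
  (rest : Pos Γ → Pos Γ') (sh : ∀ {T H : Set} → H → (K → T) → Shape T H) (w : OpenWellLabelled B n)
  (tkind-new : K → TailKind) (hkind-new : HeadKind) where
  private
    module N = ONet n
    module W = OpenWellLabelled w
    o : ONet (Pos (A ∷ Γ))
    o = Construction.oneUp {Γ'} {Γ} {A} K n cons rest sh
    module O = ONet o
  open OpenWellLabelled
  open Embedding {shp = N.shp} {O.shp} {N.outer} {N.dep} {O.outer} {O.dep} inj₁ inj₁ inj₁ (λ _ → refl)

  labels′ : Labelling O.T O.H
  labels′ = record
    { tkind = [ W.tkind , tkind-new ]′ ; hkind = [ W.hkind , (λ _ → hkind-new) ]′
    ; trank = [ suc ∘ W.trank , (λ _ → 0) ]′ ; hrank = [ suc ∘ W.hrank , (λ _ → 0) ]′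
    ; tdepth = [ W.tdepth , (λ _ → 0) ]′ ; hdepth = [ W.hdepth , (λ _ → 0) ]′
    ; ttype = [ W.ttype , (λ k → skeleton (formulaAt (cons k))) ]′ ; htype = [ W.htype , (λ _ → skeleton A) ]′ }

  new-shape : Shape O.T O.H
  new-shape = sh (inj₂ tt) inj₂

  record NewVertex : Set where
    field
      new-coherent : Coherent labels′ new-shape
      new-principal : HeadIn (inj₂ tt) new-shape
      new-heads : ∀ h → HeadIn h new-shape → h ≡ inj₂ tt
      new-tails : ∀ k → TailIn (inj₂ k) new-shape
      new-not-L! : ∀ c a bx → new-shape ≢ L! c a bx
      new-not-right : ∀ k → ¬ RightTail (tkind-new k)
      formulaAt-rest : ∀ p → formulaAt (rest p) ≡ formulaAt p
      cons-or-rest : ∀ q → (Σ K λ k → cons k ≡ q) ⊎ (Σ (Pos Γ) λ p → rest p ≡ q)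
      cons-injective : ∀ k k' → cons k ≡ cons k' → k ≡ k'
      rest-injective : ∀ p p' → rest p ≡ rest p' → p ≡ p'
      cons≢rest : ∀ k p → cons k ≢ rest p

  module Labelled (new : NewVertex) where
    open NewVertex new

    embedded : LabellingMap W.labels labels′ inj₁ inj₁ 0 1
    embedded = record { tkind≡ = λ _ → refl ; hkind≡ = λ _ → refl ; trank≡ = λ _ → refl ; hrank≡ = λ _ → refl
                      ; tdepth≡ = λ _ → refl ; hdepth≡ = λ _ → refl ; ttype≡ = λ _ → refl ; htype≡ = λ _ → refl }

    r : N.H ⊎ ⊤ → O.H ⊎ ⊤
    r = route inj₁ (inj₂ tt)

    emb : N.T ⊎ Pos Γ' → O.T ⊎ Pos (A ∷ Γ)
    emb (inj₁ t) = inj₁ (inj₁ t)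
    emb (inj₂ q) with cons-or-rest q
    ... | inj₁ (k , _) = inj₁ (inj₂ k)
    ... | inj₂ (p , _) = inj₂ (there p)

    nxt-emb : ∀ g → O.nxt (emb g) ≡ r (N.nxt g)
    nxt-emb (inj₁ t) = refl
    nxt-emb (inj₂ q) with cons-or-rest q
    ... | inj₁ (k , refl) = refl
    ... | inj₂ (p , refl) = refl

    unemb : O.T ⊎ Pos (A ∷ Γ) → Maybe (N.T ⊎ Pos Γ')
    unemb (inj₁ (inj₁ t)) = just (inj₁ t)
    unemb (inj₁ (inj₂ k)) = just (inj₂ (cons k))
    unemb (inj₂ here) = nothing
    unemb (inj₂ (there p)) = just (inj₂ (rest p))

    unemb-conclusion : ∀ g → O.nxt g ≡ inj₂ tt → Σ (N.T ⊎ Pos Γ') λ g₀ → (unemb g ≡ just g₀) × (N.nxt g₀ ≡ inj₂ tt)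
    unemb-conclusion (inj₁ (inj₁ t)) e = inj₁ t , refl , proj₁ (route-inj₂ inj₁ _ _ e)
    unemb-conclusion (inj₁ (inj₂ k)) e = inj₂ (cons k) , refl , proj₁ (route-inj₂ inj₁ _ _ e)
    unemb-conclusion (inj₂ (there p)) e = inj₂ (rest p) , refl , proj₁ (route-inj₂ inj₁ _ _ e)

    unemb-injective : ∀ g g' {x} → unemb g ≡ just x → unemb g' ≡ just x → g ≡ g'
    unemb-injective (inj₁ (inj₁ t)) (inj₁ (inj₁ t')) refl refl = refl
    unemb-injective (inj₁ (inj₂ k)) (inj₁ (inj₂ k')) refl e =
      cong (inj₁ ∘ inj₂) (sym (cons-injective k' k (inj₂-injective (just-injective e))))
    unemb-injective (inj₂ (there p)) (inj₂ (there p')) refl e =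
      cong (inj₂ ∘ there) (sym (rest-injective p' p (inj₂-injective (just-injective e))))
    unemb-injective (inj₁ (inj₂ k)) (inj₂ (there p)) refl e = ⊥-elim (cons≢rest k p (sym (inj₂-injective (just-injective e))))
    unemb-injective (inj₂ (there p)) (inj₁ (inj₂ k)) refl e = ⊥-elim (cons≢rest k p (inj₂-injective (just-injective e)))
    unemb-injective (inj₁ (inj₁ _)) (inj₁ (inj₂ _)) refl ()
    unemb-injective (inj₁ (inj₁ _)) (inj₂ (there _)) refl ()
    unemb-injective (inj₁ (inj₂ _)) (inj₁ (inj₁ _)) refl ()
    unemb-injective (inj₂ (there _)) (inj₁ (inj₁ _)) refl ()
    unemb-injective (inj₁ (inj₁ _)) (inj₂ here) refl ()
    unemb-injective (inj₁ (inj₂ _)) (inj₂ here) refl ()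
    unemb-injective (inj₂ (there _)) (inj₂ here) refl ()

    hdepth′ : O.H ⊎ ⊤ → ℕ
    hdepth′ = [ Labelling.hdepth labels′ , (λ _ → 0) ]′

    htype′ : O.H ⊎ ⊤ → Skel
    htype′ = [ Labelling.htype labels′ , (λ _ → skeleton B) ]′

    hdepth-r : ∀ x → hdepth′ (r x) ≡ [ W.hdepth , (λ _ → 0) ]′ x
    hdepth-r = route-≡ inj₁ _ hdepth′ (λ _ → refl) refl

    htype-r : ∀ x → htype′ (r x) ≡ [ W.htype , (λ _ → skeleton B) ]′ x
    htype-r = route-≡ inj₁ _ htype′ (λ _ → refl) refl

    labelled : OpenWellLabelled {A ∷ Γ} B o
    labelled .labels = labels′
    labelled .coherent (inj₁ v) = Coherent-map embedded (N.shp v) (W.coherent v)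
    labelled .coherent (inj₂ tt) = new-coherent
    labelled .tdepth-dep (inj₁ t) = W.tdepth-dep t
    labelled .tdepth-dep (inj₂ _) = refl
    labelled .depth-nxt (inj₁ (inj₁ t)) = trans (W.depth-nxt (inj₁ t)) (sym (hdepth-r (N.nxt (inj₁ t))))
    labelled .depth-nxt (inj₁ (inj₂ k)) = trans (W.depth-nxt (inj₂ (cons k))) (sym (hdepth-r (N.nxt (inj₂ (cons k)))))
    labelled .depth-nxt (inj₂ here) = refl
    labelled .depth-nxt (inj₂ (there p)) = trans (W.depth-nxt (inj₂ (rest p))) (sym (hdepth-r (N.nxt (inj₂ (rest p)))))
    labelled .type-nxt (inj₁ (inj₁ t)) = trans (W.type-nxt (inj₁ t)) (sym (htype-r (N.nxt (inj₁ t))))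
    labelled .type-nxt (inj₁ (inj₂ k)) = trans (W.type-nxt (inj₂ (cons k))) (sym (htype-r (N.nxt (inj₂ (cons k)))))
    labelled .type-nxt (inj₂ here) = refl
    labelled .type-nxt (inj₂ (there p)) =
      trans (cong skeleton (sym (formulaAt-rest p))) (trans (W.type-nxt (inj₂ (rest p))) (sym (htype-r (N.nxt (inj₂ (rest p))))))
    labelled .rank-right (inj₁ t) h e rt with route-inj₁ inj₁ _ (N.nxt (inj₁ t)) h e
    ... | inj₁ (h₀ , e₀ , refl) = s≤s (W.rank-right t h₀ e₀ rt)
    ... | inj₂ (_ , ())
    labelled .rank-right (inj₂ k) h e rt = ⊥-elim (new-not-right k rt)
    labelled .rank-left (inj₁ t) h e lt lh with route-inj₁ inj₁ _ (N.nxt (inj₁ t)) h e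
    ... | inj₁ (h₀ , e₀ , refl) = s≤s (W.rank-left t h₀ e₀ lt lh)
    ... | inj₂ (_ , ())
    labelled .rank-left (inj₂ k) h e lt lh with route-inj₁ inj₁ _ (N.nxt (inj₂ (cons k))) h e
    ... | inj₁ (h₀ , e₀ , refl) = s≤s z≤n
    ... | inj₂ (_ , ())
    labelled .rank-bound = suc W.rank-bound
    labelled .trank<bound (inj₁ t) = s≤s (W.trank<bound t)
    labelled .trank<bound (inj₂ _) = s≤s z≤n
    labelled .hrank<bound (inj₁ h) = s≤s (W.hrank<bound h)
    labelled .hrank<bound (inj₂ _) = s≤s z≤n
    labelled .head-attached (inj₁ h) = head-attached-map (W.head-attached h)
    labelled .head-attached (inj₂ tt) = inj₂ tt , _ , refl , new-principal
    labelled .tail-attached (inj₁ t) = tail-attached-map (W.tail-attached t)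
    labelled .tail-attached (inj₂ k) = inj₂ tt , _ , refl , new-tails k
    labelled .head-fed (inj₁ v) s h eq hi with head-unmap v eq hi
    ... | (h₀ , refl , hi₀) with W.head-fed v (N.shp v) h₀ refl hi₀
    ...   | (g , e) = emb g , trans (nxt-emb g) (cong r e)
    labelled .head-fed (inj₂ tt) s h refl hi = inj₂ here , cong inj₁ (sym (new-heads h hi))
    labelled .conclusion = let (g , e) = W.conclusion in emb g , trans (nxt-emb g) (cong r e)
    labelled .conclusion-unique g g' e e' with unemb-conclusion g e | unemb-conclusion g' e'
    ... | (g₀ , u₀ , c₀) | (g₁ , u₁ , c₁) = unemb-injective g g' u₀ (trans u₁ (cong just (W.conclusion-unique g₁ g₀ c₁ c₀)))
    labelled .L!-boxEdge (inj₁ v) = L!-boxEdge-map W.L!-boxEdge v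
    labelled .L!-boxEdge (inj₂ tt) c a bx eq = ⊥-elim (new-not-L! c a bx eq)
    labelled .outer-box (inj₁ t) = outer-box-map (λ _ → refl) (λ _ → refl) t (W.outer-box t)
    labelled .outer-box (inj₂ _) = inj₁ (refl , refl)

W-labelled : ∀ {Γ A B} (d : Γ ⊢ B) → OpenWellLabelled B (onet d) → OpenWellLabelled B (onet (W {Γ} {A} d))
W-labelled d w = OneUp-labelling.Labelled.labelled ⊥ (onet d) _ _ _ w (λ ()) hWc record
  { new-coherent = refl ; new-principal = iWc ; new-heads = λ { h iWc → refl } ; new-tails = λ ()
  ; new-not-L! = λ _ _ _ () ; new-not-right = λ () ; formulaAt-rest = λ _ → refl
  ; cons-or-rest = λ q → inj₂ (q , refl) ; cons-injective = λ () ; rest-injective = λ _ _ e → e ; cons≢rest = λ () }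

X-labelled : ∀ {Γ A B} (d : ! A ∷ ! A ∷ Γ ⊢ B) → OpenWellLabelled B (onet d) → OpenWellLabelled B (onet (X d))
X-labelled d w = OneUp-labelling.Labelled.labelled Bool (onet d) _ _ _ w (tkind-by kXa kXb) hXc record
  { new-coherent = refl , refl , refl , refl , refl , refl , refl , _ , refl , refl , refl
  ; new-principal = iXc ; new-heads = λ { h iXc → refl } ; new-tails = λ { true → jXa ; false → jXb }
  ; new-not-L! = λ _ _ _ () ; new-not-right = λ { true () ; false () } ; formulaAt-rest = λ _ → refl
  ; cons-or-rest = λ { here → inj₁ (true , refl) ; (there here) → inj₁ (false , refl) ; (there (there p)) → inj₂ (p , refl) }
  ; cons-injective = λ { true true _ → refl ; false false _ → refl ; true false () ; false true () }
  ; rest-injective = λ { p p' refl → refl } ; cons≢rest = λ { true p () ; false p () } }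

L⊗-labelled : ∀ {Γ A B C} (d : A ∷ B ∷ Γ ⊢ C) → OpenWellLabelled C (onet d) → OpenWellLabelled C (onet (L⊗ d))
L⊗-labelled d w = OneUp-labelling.Labelled.labelled Bool (onet d) _ _ _ w (tkind-by kL⊗a kL⊗b) hL⊗c record
  { new-coherent = refl , refl , refl , refl , refl , refl , refl , refl
  ; new-principal = iL⊗c ; new-heads = λ { h iL⊗c → refl } ; new-tails = λ { true → jL⊗a ; false → jL⊗b }
  ; new-not-L! = λ _ _ _ () ; new-not-right = λ { true () ; false () } ; formulaAt-rest = λ _ → refl
  ; cons-or-rest = λ { here → inj₁ (true , refl) ; (there here) → inj₁ (false , refl) ; (there (there p)) → inj₂ (p , refl) }
  ; cons-injective = λ { true true _ → refl ; false false _ → refl ; true false () ; false true () }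
  ; rest-injective = λ { p p' refl → refl } ; cons≢rest = λ { true p () ; false p () } }

D-labelled : ∀ {Γ A B} (d : A ∷ Γ ⊢ B) → OpenWellLabelled B (onet d) → OpenWellLabelled B (onet (D d))
D-labelled d w = OneUp-labelling.Labelled.labelled ⊤ (onet d) _ _ _ w (λ _ → kDa) hDc record
  { new-coherent = refl , refl , refl , refl , refl
  ; new-principal = iDc ; new-heads = λ { h iDc → refl } ; new-tails = λ _ → jDa
  ; new-not-L! = λ _ _ _ () ; new-not-right = λ _ () ; formulaAt-rest = λ _ → refl
  ; cons-or-rest = λ { here → inj₁ (tt , refl) ; (there p) → inj₂ (p , refl) }
  ; cons-injective = λ _ _ _ → refl ; rest-injective = λ _ _ → there-injective ; cons≢rest = λ _ _ () }

N-labelled : ∀ {Γ A B} (d : ! ! A ∷ Γ ⊢ B) → OpenWellLabelled B (onet d) → OpenWellLabelled B (onet (N d))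
N-labelled d w = OneUp-labelling.Labelled.labelled ⊤ (onet d) _ _ _ w (λ _ → kNa) hNc record
  { new-coherent = refl , refl , refl , refl , _ , refl , refl
  ; new-principal = iNc ; new-heads = λ { h iNc → refl } ; new-tails = λ _ → jNa
  ; new-not-L! = λ _ _ _ () ; new-not-right = λ _ () ; formulaAt-rest = λ _ → refl
  ; cons-or-rest = λ { here → inj₁ (tt , refl) ; (there p) → inj₂ (p , refl) }
  ; cons-injective = λ _ _ _ → refl ; rest-injective = λ _ _ → there-injective ; cons≢rest = λ _ _ () }

L∀-labelled : ∀ {Γ A B C} (d : A ⟦ B ⟧ ∷ Γ ⊢ C) → OpenWellLabelled C (onet d) → OpenWellLabelled C (onet (L∀ {Γ} {A} {B} d))
L∀-labelled {A = A} d w = OneUp-labelling.Labelled.labelled ⊤ (onet d) _ _ _ w (λ _ → kL∀a) hL∀c record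
  { new-coherent = refl , refl , refl , refl , _ , refl , skeleton-sub _ A
  ; new-principal = iL∀c ; new-heads = λ { h iL∀c → refl } ; new-tails = λ _ → jL∀a
  ; new-not-L! = λ _ _ _ () ; new-not-right = λ _ () ; formulaAt-rest = λ _ → refl
  ; cons-or-rest = λ { here → inj₁ (tt , refl) ; (there p) → inj₂ (p , refl) }
  ; cons-injective = λ _ _ _ → refl ; rest-injective = λ _ _ → there-injective ; cons≢rest = λ _ _ () }

ax-labelled : ∀ {A} → OpenWellLabelled A (onet (ax {A}))
ax-labelled .OpenWellLabelled.labels =
  record { tkind = λ () ; hkind = λ () ; trank = λ () ; hrank = λ () ; tdepth = λ () ; hdepth = λ () ; ttype = λ () ; htype = λ () }
ax-labelled .OpenWellLabelled.coherent ()
ax-labelled .OpenWellLabelled.tdepth-dep ()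
ax-labelled .OpenWellLabelled.depth-nxt (inj₂ here) = refl
ax-labelled .OpenWellLabelled.type-nxt (inj₂ here) = refl
ax-labelled .OpenWellLabelled.rank-right ()
ax-labelled .OpenWellLabelled.rank-left ()
ax-labelled .OpenWellLabelled.rank-bound = 0
ax-labelled .OpenWellLabelled.trank<bound ()
ax-labelled .OpenWellLabelled.hrank<bound ()
ax-labelled .OpenWellLabelled.head-attached ()
ax-labelled .OpenWellLabelled.tail-attached ()
ax-labelled .OpenWellLabelled.head-fed ()
ax-labelled .OpenWellLabelled.conclusion = inj₂ here , refl
ax-labelled .OpenWellLabelled.conclusion-unique (inj₂ here) (inj₂ here) _ _ = refl
ax-labelled .OpenWellLabelled.L!-boxEdge ()
ax-labelled .OpenWellLabelled.outer-box ()

exch-labelled : ∀ Γ {Δ A B C} (d : Γ ++ A ∷ B ∷ Δ ⊢ C) → OpenWellLabelled C (onet d) →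
                OpenWellLabelled C (onet (exch Γ {Δ} {A} {B} d))
exch-labelled Γ {Δ} {A} {B} {C} d w = record
  { labels = labels ; coherent = coherent ; tdepth-dep = tdepth-dep ; depth-nxt = depth-nxt′ ; type-nxt = type-nxt′
  ; rank-right = rank-right ; rank-left = rank-left ; rank-bound = rank-bound ; trank<bound = trank<bound
  ; hrank<bound = hrank<bound ; head-attached = head-attached ; tail-attached = tail-attached
  ; head-fed = λ v s h eq hi → let (g , e) = head-fed v s h eq hi in emb g , trans (nxt-emb g) e
  ; conclusion = let (g , e) = conclusion in emb g , trans (nxt-emb g) e
  ; conclusion-unique = λ g g' e e' →
      unemb-injective g g' (conclusion-unique (unemb g) (unemb g') (trans (sym (nxt-unemb g)) e) (trans (sym (nxt-unemb g')) e'))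
  ; L!-boxEdge = L!-boxEdge ; outer-box = outer-box }
  where
  open OpenWellLabelled w
  module N = ONet (onet d)
  module O = ONet (onet (exch Γ {Δ} {A} {B} d))

  emb : N.T ⊎ Pos (Γ ++ A ∷ B ∷ Δ) → O.T ⊎ Pos (Γ ++ B ∷ A ∷ Δ)
  emb (inj₁ t) = inj₁ t
  emb (inj₂ q) = inj₂ (swapPos Γ q)

  nxt-emb : ∀ g → O.nxt (emb g) ≡ N.nxt g
  nxt-emb (inj₁ t) = refl
  nxt-emb (inj₂ q) = cong (N.nxt ∘ inj₂) (swapPos-involutive Γ q)

  unemb : O.T ⊎ Pos (Γ ++ B ∷ A ∷ Δ) → N.T ⊎ Pos (Γ ++ A ∷ B ∷ Δ)
  unemb (inj₁ t) = inj₁ t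
  unemb (inj₂ p) = inj₂ (swapPos Γ p)

  nxt-unemb : ∀ g → O.nxt g ≡ N.nxt (unemb g)
  nxt-unemb (inj₁ t) = refl
  nxt-unemb (inj₂ p) = refl

  unemb-injective : ∀ g g' → unemb g ≡ unemb g' → g ≡ g'
  unemb-injective (inj₁ t) (inj₁ t') e = cong inj₁ (inj₁-injective e)
  unemb-injective (inj₂ p) (inj₂ p') e =
    cong inj₂ (trans (sym (swapPos-involutive Γ p)) (trans (cong (swapPos Γ) (inj₂-injective e)) (swapPos-involutive Γ p')))
  unemb-injective (inj₁ t) (inj₂ p) ()
  unemb-injective (inj₂ p) (inj₁ t) ()

  depth-nxt′ : ∀ g → [ tdepth , (λ _ → 0) ]′ g ≡ [ hdepth , (λ _ → 0) ]′ (O.nxt g)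
  depth-nxt′ (inj₁ t) = depth-nxt (inj₁ t)
  depth-nxt′ (inj₂ p) = depth-nxt (inj₂ (swapPos Γ p))

  type-nxt′ : ∀ g → [ ttype , (λ p → skeleton (formulaAt p)) ]′ g ≡ [ htype , (λ _ → skeleton C) ]′ (O.nxt g)
  type-nxt′ (inj₁ t) = type-nxt (inj₁ t)
  type-nxt′ (inj₂ p) = trans (cong skeleton (sym (formulaAt-swapPos Γ p))) (type-nxt (inj₂ (swapPos Γ p)))

inj₂₁ : ∀ {X Y Z : Set} → Y → X ⊎ (Y ⊎ Z)
inj₂₁ y = inj₂ (inj₁ y)

module R⊗-labelling {Γ Δ : List Form} {A B : Form} (d₁ : Γ ⊢ A) (d₂ : Δ ⊢ B)
  (w₁ : OpenWellLabelled A (onet d₁)) (w₂ : OpenWellLabelled B (onet d₂)) where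
  private
    module N = ONet (onet d₁)
    module M = ONet (onet d₂)
    module W₁ = OpenWellLabelled w₁
    module W₂ = OpenWellLabelled w₂
    o = onet (R⊗ {Γ} {Δ} d₁ d₂)
    module O = ONet o
  open OpenWellLabelled
  module E₁ = Embedding {shp = N.shp} {O.shp} {N.outer} {N.dep} {O.outer} {O.dep} inj₁ inj₁ inj₁ (λ _ → refl)
  module E₂ = Embedding {shp = M.shp} {O.shp} {M.outer} {M.dep} {O.outer} {O.dep} inj₂₁ inj₂₁ inj₂₁ (λ _ → refl)

  hkind-new : Bool → HeadKind
  hkind-new true = hR⊗a
  hkind-new false = hR⊗b

  htype-new : Bool → Skel
  htype-new true = skeleton A
  htype-new false = skeleton B

  labels′ : Labelling O.T O.H
  labels′ = record
    { tkind = [ W₁.tkind , [ W₂.tkind , (λ _ → kR⊗c) ]′ ]′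
    ; hkind = [ W₁.hkind , [ W₂.hkind , hkind-new ]′ ]′
    ; trank = [ suc ∘ W₁.trank , [ suc ∘ W₂.trank , (λ _ → 0) ]′ ]′
    ; hrank = [ suc ∘ W₁.hrank , [ suc ∘ W₂.hrank , (λ _ → 0) ]′ ]′
    ; tdepth = [ W₁.tdepth , [ W₂.tdepth , (λ _ → 0) ]′ ]′
    ; hdepth = [ W₁.hdepth , [ W₂.hdepth , (λ _ → 0) ]′ ]′
    ; ttype = [ W₁.ttype , [ W₂.ttype , (λ _ → skeleton A s⊗ skeleton B) ]′ ]′
    ; htype = [ W₁.htype , [ W₂.htype , htype-new ]′ ]′ }

  embedded₁ : LabellingMap W₁.labels labels′ inj₁ inj₁ 0 1
  embedded₁ = record { tkind≡ = λ _ → refl ; hkind≡ = λ _ → refl ; trank≡ = λ _ → refl ; hrank≡ = λ _ → refl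
                     ; tdepth≡ = λ _ → refl ; hdepth≡ = λ _ → refl ; ttype≡ = λ _ → refl ; htype≡ = λ _ → refl }

  embedded₂ : LabellingMap W₂.labels labels′ inj₂₁ inj₂₁ 0 1
  embedded₂ = record { tkind≡ = λ _ → refl ; hkind≡ = λ _ → refl ; trank≡ = λ _ → refl ; hrank≡ = λ _ → refl
                     ; tdepth≡ = λ _ → refl ; hdepth≡ = λ _ → refl ; ttype≡ = λ _ → refl ; htype≡ = λ _ → refl }

  r₁ : N.H ⊎ ⊤ → O.H ⊎ ⊤
  r₁ = route inj₁ (inj₁ (inj₂ (inj₂ true)))

  r₂ : M.H ⊎ ⊤ → O.H ⊎ ⊤
  r₂ = route inj₂₁ (inj₁ (inj₂ (inj₂ false)))

  emb₁ : N.T ⊎ Pos Γ → O.T ⊎ Pos (Γ ++ Δ)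
  emb₁ (inj₁ t) = inj₁ (inj₁ t)
  emb₁ (inj₂ q) = inj₂ (injˡ Γ q)

  nxt-emb₁ : ∀ g → O.nxt (emb₁ g) ≡ r₁ (N.nxt g)
  nxt-emb₁ (inj₁ t) = refl
  nxt-emb₁ (inj₂ q) rewrite splitPos-injˡ Γ {Δ} q = refl

  emb₂ : M.T ⊎ Pos Δ → O.T ⊎ Pos (Γ ++ Δ)
  emb₂ (inj₁ t) = inj₁ (inj₂₁ t)
  emb₂ (inj₂ q) = inj₂ (injʳ Γ q)

  nxt-emb₂ : ∀ g → O.nxt (emb₂ g) ≡ r₂ (M.nxt g)
  nxt-emb₂ (inj₁ t) = refl
  nxt-emb₂ (inj₂ q) rewrite splitPos-injʳ Γ {Δ} q = refl

  hdepth′ : O.H ⊎ ⊤ → ℕ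
  hdepth′ = [ Labelling.hdepth labels′ , (λ _ → 0) ]′

  htype′ : O.H ⊎ ⊤ → Skel
  htype′ = [ Labelling.htype labels′ , (λ _ → skeleton (A ⊗ B)) ]′

  hdepth-r₁ : ∀ x → hdepth′ (r₁ x) ≡ [ W₁.hdepth , (λ _ → 0) ]′ x
  hdepth-r₁ = route-≡ inj₁ _ hdepth′ (λ _ → refl) refl
  hdepth-r₂ : ∀ x → hdepth′ (r₂ x) ≡ [ W₂.hdepth , (λ _ → 0) ]′ x
  hdepth-r₂ = route-≡ inj₂₁ _ hdepth′ (λ _ → refl) refl
  htype-r₁ : ∀ x → htype′ (r₁ x) ≡ [ W₁.htype , (λ _ → skeleton A) ]′ x
  htype-r₁ = route-≡ inj₁ _ htype′ (λ _ → refl) refl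
  htype-r₂ : ∀ x → htype′ (r₂ x) ≡ [ W₂.htype , (λ _ → skeleton B) ]′ x
  htype-r₂ = route-≡ inj₂₁ _ htype′ (λ _ → refl) refl

  not-conclusion₁ : ∀ x → r₁ x ≢ inj₂ tt
  not-conclusion₁ x e with route-inj₂ inj₁ _ x e
  ... | (_ , ())

  not-conclusion₂ : ∀ x → r₂ x ≢ inj₂ tt
  not-conclusion₂ x e with route-inj₂ inj₂₁ _ x e
  ... | (_ , ())

  conclusion-new : ∀ g → O.nxt g ≡ inj₂ tt → g ≡ inj₁ (inj₂ (inj₂ tt))
  conclusion-new (inj₁ (inj₁ t)) e = ⊥-elim (not-conclusion₁ _ e)
  conclusion-new (inj₁ (inj₂ (inj₁ t))) e = ⊥-elim (not-conclusion₂ _ e)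
  conclusion-new (inj₁ (inj₂ (inj₂ tt))) e = refl
  conclusion-new (inj₂ p) e with splitPos Γ p
  ... | inj₁ q = ⊥-elim (not-conclusion₁ _ e)
  ... | inj₂ q = ⊥-elim (not-conclusion₂ _ e)

  labelled : OpenWellLabelled (A ⊗ B) o
  labelled .labels = labels′
  labelled .coherent (inj₁ v) = Coherent-map embedded₁ (N.shp v) (W₁.coherent v)
  labelled .coherent (inj₂ (inj₁ v)) = Coherent-map embedded₂ (M.shp v) (W₂.coherent v)
  labelled .coherent (inj₂ (inj₂ tt)) = refl , refl , refl , refl , refl , refl , refl
  labelled .tdepth-dep (inj₁ t) = W₁.tdepth-dep t
  labelled .tdepth-dep (inj₂ (inj₁ t)) = W₂.tdepth-dep t
  labelled .tdepth-dep (inj₂ (inj₂ _)) = refl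
  labelled .depth-nxt (inj₁ (inj₁ t)) = trans (W₁.depth-nxt (inj₁ t)) (sym (hdepth-r₁ (N.nxt (inj₁ t))))
  labelled .depth-nxt (inj₁ (inj₂ (inj₁ t))) = trans (W₂.depth-nxt (inj₁ t)) (sym (hdepth-r₂ (M.nxt (inj₁ t))))
  labelled .depth-nxt (inj₁ (inj₂ (inj₂ _))) = refl
  labelled .depth-nxt (inj₂ p) with splitPos Γ p
  ... | inj₁ q = trans (W₁.depth-nxt (inj₂ q)) (sym (hdepth-r₁ (N.nxt (inj₂ q))))
  ... | inj₂ q = trans (W₂.depth-nxt (inj₂ q)) (sym (hdepth-r₂ (M.nxt (inj₂ q))))
  labelled .type-nxt (inj₁ (inj₁ t)) = trans (W₁.type-nxt (inj₁ t)) (sym (htype-r₁ (N.nxt (inj₁ t))))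
  labelled .type-nxt (inj₁ (inj₂ (inj₁ t))) = trans (W₂.type-nxt (inj₁ t)) (sym (htype-r₂ (M.nxt (inj₁ t))))
  labelled .type-nxt (inj₁ (inj₂ (inj₂ _))) = refl
  labelled .type-nxt (inj₂ p) with splitPos Γ p in e
  ... | inj₁ q = trans (cong skeleton (trans (formulaAt-splitPos Γ p) (cong [ formulaAt , formulaAt ]′ e)))
                       (trans (W₁.type-nxt (inj₂ q)) (sym (htype-r₁ (N.nxt (inj₂ q)))))
  ... | inj₂ q = trans (cong skeleton (trans (formulaAt-splitPos Γ p) (cong [ formulaAt , formulaAt ]′ e)))
                       (trans (W₂.type-nxt (inj₂ q)) (sym (htype-r₂ (M.nxt (inj₂ q)))))
  labelled .rank-right (inj₁ t) h e rt with route-inj₁ inj₁ _ (N.nxt (inj₁ t)) h e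
  ... | inj₁ (h₀ , e₀ , refl) = s≤s (W₁.rank-right t h₀ e₀ rt)
  ... | inj₂ (_ , refl) = s≤s z≤n
  labelled .rank-right (inj₂ (inj₁ t)) h e rt with route-inj₁ inj₂₁ _ (M.nxt (inj₁ t)) h e
  ... | inj₁ (h₀ , e₀ , refl) = s≤s (W₂.rank-right t h₀ e₀ rt)
  ... | inj₂ (_ , refl) = s≤s z≤n
  labelled .rank-right (inj₂ (inj₂ _)) h () _
  labelled .rank-left (inj₁ t) h e lt lh with route-inj₁ inj₁ _ (N.nxt (inj₁ t)) h e
  ... | inj₁ (h₀ , e₀ , refl) = s≤s (W₁.rank-left t h₀ e₀ lt lh)
  ... | inj₂ (_ , refl) with lh
  ...   | ()
  labelled .rank-left (inj₂ (inj₁ t)) h e lt lh with route-inj₁ inj₂₁ _ (M.nxt (inj₁ t)) h e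
  ... | inj₁ (h₀ , e₀ , refl) = s≤s (W₂.rank-left t h₀ e₀ lt lh)
  ... | inj₂ (_ , refl) with lh
  ...   | ()
  labelled .rank-left (inj₂ (inj₂ _)) h () _ _
  labelled .rank-bound = suc (W₁.rank-bound + W₂.rank-bound)
  labelled .trank<bound (inj₁ t) = s≤s (<-≤-trans (W₁.trank<bound t) (m≤m+n W₁.rank-bound W₂.rank-bound))
  labelled .trank<bound (inj₂ (inj₁ t)) = s≤s (<-≤-trans (W₂.trank<bound t) (m≤n+m W₂.rank-bound W₁.rank-bound))
  labelled .trank<bound (inj₂ (inj₂ _)) = s≤s z≤n
  labelled .hrank<bound (inj₁ h) = s≤s (<-≤-trans (W₁.hrank<bound h) (m≤m+n W₁.rank-bound W₂.rank-bound))
  labelled .hrank<bound (inj₂ (inj₁ h)) = s≤s (<-≤-trans (W₂.hrank<bound h) (m≤n+m W₂.rank-bound W₁.rank-bound))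
  labelled .hrank<bound (inj₂ (inj₂ _)) = s≤s z≤n
  labelled .head-attached (inj₁ h) = E₁.head-attached-map (W₁.head-attached h)
  labelled .head-attached (inj₂ (inj₁ h)) = E₂.head-attached-map (W₂.head-attached h)
  labelled .head-attached (inj₂ (inj₂ true)) = inj₂ (inj₂ tt) , _ , refl , iR⊗a
  labelled .head-attached (inj₂ (inj₂ false)) = inj₂ (inj₂ tt) , _ , refl , iR⊗b
  labelled .tail-attached (inj₁ t) = E₁.tail-attached-map (W₁.tail-attached t)
  labelled .tail-attached (inj₂ (inj₁ t)) = E₂.tail-attached-map (W₂.tail-attached t)
  labelled .tail-attached (inj₂ (inj₂ _)) = inj₂ (inj₂ tt) , _ , refl , jR⊗c
  labelled .head-fed (inj₁ v) s h eq hi with E₁.head-unmap v eq hi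
  ... | (h₀ , refl , hi₀) with W₁.head-fed v (N.shp v) h₀ refl hi₀
  ...   | (g , e) = emb₁ g , trans (nxt-emb₁ g) (cong r₁ e)
  labelled .head-fed (inj₂ (inj₁ v)) s h eq hi with E₂.head-unmap v eq hi
  ... | (h₀ , refl , hi₀) with W₂.head-fed v (M.shp v) h₀ refl hi₀
  ...   | (g , e) = emb₂ g , trans (nxt-emb₂ g) (cong r₂ e)
  labelled .head-fed (inj₂ (inj₂ tt)) s h refl iR⊗a = let (g , e) = W₁.conclusion in emb₁ g , trans (nxt-emb₁ g) (cong r₁ e)
  labelled .head-fed (inj₂ (inj₂ tt)) s h refl iR⊗b = let (g , e) = W₂.conclusion in emb₂ g , trans (nxt-emb₂ g) (cong r₂ e)
  labelled .conclusion = inj₁ (inj₂ (inj₂ tt)) , refl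
  labelled .conclusion-unique g g' e e' = trans (conclusion-new g e) (sym (conclusion-new g' e'))
  labelled .L!-boxEdge (inj₁ v) = E₁.L!-boxEdge-map W₁.L!-boxEdge v
  labelled .L!-boxEdge (inj₂ (inj₁ v)) = E₂.L!-boxEdge-map W₂.L!-boxEdge v
  labelled .L!-boxEdge (inj₂ (inj₂ tt)) _ _ _ ()
  labelled .outer-box (inj₁ t) = E₁.outer-box-map (λ _ → refl) (λ _ → refl) t (W₁.outer-box t)
  labelled .outer-box (inj₂ (inj₁ t)) = E₂.outer-box-map (λ _ → refl) (λ _ → refl) t (W₂.outer-box t)
  labelled .outer-box (inj₂ (inj₂ _)) = inj₁ (refl , refl)

module L⊸-labelling {Γ Δ : List Form} {A B C : Form} (d₁ : Γ ⊢ A) (d₂ : B ∷ Δ ⊢ C)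
  (w₁ : OpenWellLabelled A (onet d₁)) (w₂ : OpenWellLabelled C (onet d₂)) where
  private
    module N = ONet (onet d₁)
    module M = ONet (onet d₂)
    module W₁ = OpenWellLabelled w₁
    module W₂ = OpenWellLabelled w₂
    o = onet (L⊸ {Γ} {Δ} {A} {B} {C} d₁ d₂)
    module O = ONet o
  open OpenWellLabelled
  module E₁ = Embedding {shp = N.shp} {O.shp} {N.outer} {N.dep} {O.outer} {O.dep} inj₁ inj₁ inj₁ (λ _ → refl)
  module E₂ = Embedding {shp = M.shp} {O.shp} {M.outer} {M.dep} {O.outer} {O.dep} inj₂₁ inj₂₁ inj₂₁ (λ _ → refl)

  hkind-new : Bool → HeadKind
  hkind-new true = hL⊸c
  hkind-new false = hL⊸a

  htype-new : Bool → Skel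
  htype-new true = skeleton A s⊸ skeleton B
  htype-new false = skeleton A

  labels′ : Labelling O.T O.H
  labels′ = record
    { tkind = [ W₁.tkind , [ W₂.tkind , (λ _ → kL⊸b) ]′ ]′
    ; hkind = [ W₁.hkind , [ W₂.hkind , hkind-new ]′ ]′
    ; trank = [ suc ∘ W₁.trank , [ suc ∘ W₂.trank , (λ _ → 0) ]′ ]′
    ; hrank = [ suc ∘ W₁.hrank , [ suc ∘ W₂.hrank , (λ _ → 0) ]′ ]′
    ; tdepth = [ W₁.tdepth , [ W₂.tdepth , (λ _ → 0) ]′ ]′
    ; hdepth = [ W₁.hdepth , [ W₂.hdepth , (λ _ → 0) ]′ ]′
    ; ttype = [ W₁.ttype , [ W₂.ttype , (λ _ → skeleton B) ]′ ]′
    ; htype = [ W₁.htype , [ W₂.htype , htype-new ]′ ]′ }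

  embedded₁ : LabellingMap W₁.labels labels′ inj₁ inj₁ 0 1
  embedded₁ = record { tkind≡ = λ _ → refl ; hkind≡ = λ _ → refl ; trank≡ = λ _ → refl ; hrank≡ = λ _ → refl
                     ; tdepth≡ = λ _ → refl ; hdepth≡ = λ _ → refl ; ttype≡ = λ _ → refl ; htype≡ = λ _ → refl }

  embedded₂ : LabellingMap W₂.labels labels′ inj₂₁ inj₂₁ 0 1
  embedded₂ = record { tkind≡ = λ _ → refl ; hkind≡ = λ _ → refl ; trank≡ = λ _ → refl ; hrank≡ = λ _ → refl
                     ; tdepth≡ = λ _ → refl ; hdepth≡ = λ _ → refl ; ttype≡ = λ _ → refl ; htype≡ = λ _ → refl }

  r₁ : N.H ⊎ ⊤ → O.H ⊎ ⊤
  r₁ = route inj₁ (inj₁ (inj₂ (inj₂ false)))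

  r₂ : M.H ⊎ ⊤ → O.H ⊎ ⊤
  r₂ = route inj₂₁ (inj₂ tt)

  emb₁ : N.T ⊎ Pos Γ → O.T ⊎ Pos (A ⊸ B ∷ Γ ++ Δ)
  emb₁ (inj₁ t) = inj₁ (inj₁ t)
  emb₁ (inj₂ q) = inj₂ (there (injˡ Γ q))

  nxt-emb₁ : ∀ g → O.nxt (emb₁ g) ≡ r₁ (N.nxt g)
  nxt-emb₁ (inj₁ t) = refl
  nxt-emb₁ (inj₂ q) rewrite splitPos-injˡ Γ {Δ} q = refl

  emb₂ : M.T ⊎ Pos (B ∷ Δ) → O.T ⊎ Pos (A ⊸ B ∷ Γ ++ Δ)
  emb₂ (inj₁ t) = inj₁ (inj₂₁ t)
  emb₂ (inj₂ here) = inj₁ (inj₂ (inj₂ tt))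
  emb₂ (inj₂ (there q)) = inj₂ (there (injʳ Γ q))

  nxt-emb₂ : ∀ g → O.nxt (emb₂ g) ≡ r₂ (M.nxt g)
  nxt-emb₂ (inj₁ t) = refl
  nxt-emb₂ (inj₂ here) = refl
  nxt-emb₂ (inj₂ (there q)) rewrite splitPos-injʳ Γ {Δ} q = refl

  hdepth′ : O.H ⊎ ⊤ → ℕ
  hdepth′ = [ Labelling.hdepth labels′ , (λ _ → 0) ]′

  htype′ : O.H ⊎ ⊤ → Skel
  htype′ = [ Labelling.htype labels′ , (λ _ → skeleton C) ]′

  hdepth-r₁ : ∀ x → hdepth′ (r₁ x) ≡ [ W₁.hdepth , (λ _ → 0) ]′ x
  hdepth-r₁ = route-≡ inj₁ _ hdepth′ (λ _ → refl) refl
  hdepth-r₂ : ∀ x → hdepth′ (r₂ x) ≡ [ W₂.hdepth , (λ _ → 0) ]′ x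
  hdepth-r₂ = route-≡ inj₂₁ _ hdepth′ (λ _ → refl) refl
  htype-r₁ : ∀ x → htype′ (r₁ x) ≡ [ W₁.htype , (λ _ → skeleton A) ]′ x
  htype-r₁ = route-≡ inj₁ _ htype′ (λ _ → refl) refl
  htype-r₂ : ∀ x → htype′ (r₂ x) ≡ [ W₂.htype , (λ _ → skeleton C) ]′ x
  htype-r₂ = route-≡ inj₂₁ _ htype′ (λ _ → refl) refl

  not-conclusion₁ : ∀ x → r₁ x ≢ inj₂ tt
  not-conclusion₁ x e with route-inj₂ inj₁ _ x e
  ... | (_ , ())

  conclusion-from₂ : ∀ g → O.nxt g ≡ inj₂ tt → Σ (M.T ⊎ Pos (B ∷ Δ)) λ g₀ → (g ≡ emb₂ g₀) × (M.nxt g₀ ≡ inj₂ tt)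
  conclusion-from₂ (inj₁ (inj₁ t)) e = ⊥-elim (not-conclusion₁ _ e)
  conclusion-from₂ (inj₁ (inj₂ (inj₁ t))) e = inj₁ t , refl , proj₁ (route-inj₂ inj₂₁ _ _ e)
  conclusion-from₂ (inj₁ (inj₂ (inj₂ tt))) e = inj₂ here , refl , proj₁ (route-inj₂ inj₂₁ _ _ e)
  conclusion-from₂ (inj₂ (there p)) e with splitPos Γ p in es
  ... | inj₁ q = ⊥-elim (not-conclusion₁ _ e)
  ... | inj₂ q = inj₂ (there q) , cong (inj₂ ∘ there) (splitPos-injective Γ p (injʳ Γ q) (trans es (sym (splitPos-injʳ Γ q)))) ,
                 proj₁ (route-inj₂ inj₂₁ _ _ e)

  labelled : OpenWellLabelled C o
  labelled .labels = labels′
  labelled .coherent (inj₁ v) = Coherent-map embedded₁ (N.shp v) (W₁.coherent v)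
  labelled .coherent (inj₂ (inj₁ v)) = Coherent-map embedded₂ (M.shp v) (W₂.coherent v)
  labelled .coherent (inj₂ (inj₂ tt)) = refl , refl , refl , refl , refl , refl , refl , skeleton A , refl
  labelled .tdepth-dep (inj₁ t) = W₁.tdepth-dep t
  labelled .tdepth-dep (inj₂ (inj₁ t)) = W₂.tdepth-dep t
  labelled .tdepth-dep (inj₂ (inj₂ _)) = refl
  labelled .depth-nxt (inj₁ (inj₁ t)) = trans (W₁.depth-nxt (inj₁ t)) (sym (hdepth-r₁ (N.nxt (inj₁ t))))
  labelled .depth-nxt (inj₁ (inj₂ (inj₁ t))) = trans (W₂.depth-nxt (inj₁ t)) (sym (hdepth-r₂ (M.nxt (inj₁ t))))
  labelled .depth-nxt (inj₁ (inj₂ (inj₂ _))) = trans (W₂.depth-nxt (inj₂ here)) (sym (hdepth-r₂ (M.nxt (inj₂ here))))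
  labelled .depth-nxt (inj₂ here) = refl
  labelled .depth-nxt (inj₂ (there p)) with splitPos Γ p
  ... | inj₁ q = trans (W₁.depth-nxt (inj₂ q)) (sym (hdepth-r₁ (N.nxt (inj₂ q))))
  ... | inj₂ q = trans (W₂.depth-nxt (inj₂ (there q))) (sym (hdepth-r₂ (M.nxt (inj₂ (there q)))))
  labelled .type-nxt (inj₁ (inj₁ t)) = trans (W₁.type-nxt (inj₁ t)) (sym (htype-r₁ (N.nxt (inj₁ t))))
  labelled .type-nxt (inj₁ (inj₂ (inj₁ t))) = trans (W₂.type-nxt (inj₁ t)) (sym (htype-r₂ (M.nxt (inj₁ t))))
  labelled .type-nxt (inj₁ (inj₂ (inj₂ _))) = trans (W₂.type-nxt (inj₂ here)) (sym (htype-r₂ (M.nxt (inj₂ here))))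
  labelled .type-nxt (inj₂ here) = refl
  labelled .type-nxt (inj₂ (there p)) with splitPos Γ p in e
  ... | inj₁ q = trans (cong skeleton (trans (formulaAt-splitPos Γ p) (cong [ formulaAt , formulaAt ]′ e)))
                       (trans (W₁.type-nxt (inj₂ q)) (sym (htype-r₁ (N.nxt (inj₂ q)))))
  ... | inj₂ q = trans (cong skeleton (trans (formulaAt-splitPos Γ p) (cong [ formulaAt , formulaAt ]′ e)))
                       (trans (W₂.type-nxt (inj₂ (there q))) (sym (htype-r₂ (M.nxt (inj₂ (there q))))))
  labelled .rank-right (inj₁ t) h e rt with route-inj₁ inj₁ _ (N.nxt (inj₁ t)) h e
  ... | inj₁ (h₀ , e₀ , refl) = s≤s (W₁.rank-right t h₀ e₀ rt)
  ... | inj₂ (_ , refl) = s≤s z≤n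
  labelled .rank-right (inj₂ (inj₁ t)) h e rt with route-inj₁ inj₂₁ _ (M.nxt (inj₁ t)) h e
  ... | inj₁ (h₀ , e₀ , refl) = s≤s (W₂.rank-right t h₀ e₀ rt)
  ... | inj₂ (_ , ())
  labelled .rank-right (inj₂ (inj₂ _)) h e ()
  labelled .rank-left (inj₁ t) h e lt lh with route-inj₁ inj₁ _ (N.nxt (inj₁ t)) h e
  ... | inj₁ (h₀ , e₀ , refl) = s≤s (W₁.rank-left t h₀ e₀ lt lh)
  ... | inj₂ (_ , refl) with lh
  ...   | ()
  labelled .rank-left (inj₂ (inj₁ t)) h e lt lh with route-inj₁ inj₂₁ _ (M.nxt (inj₁ t)) h e
  ... | inj₁ (h₀ , e₀ , refl) = s≤s (W₂.rank-left t h₀ e₀ lt lh)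
  ... | inj₂ (_ , ())
  labelled .rank-left (inj₂ (inj₂ _)) h e lt lh with route-inj₁ inj₂₁ _ (M.nxt (inj₂ here)) h e
  ... | inj₁ (h₀ , e₀ , refl) = s≤s z≤n
  ... | inj₂ (_ , ())
  labelled .rank-bound = suc (W₁.rank-bound + W₂.rank-bound)
  labelled .trank<bound (inj₁ t) = s≤s (<-≤-trans (W₁.trank<bound t) (m≤m+n W₁.rank-bound W₂.rank-bound))
  labelled .trank<bound (inj₂ (inj₁ t)) = s≤s (<-≤-trans (W₂.trank<bound t) (m≤n+m W₂.rank-bound W₁.rank-bound))
  labelled .trank<bound (inj₂ (inj₂ _)) = s≤s z≤n
  labelled .hrank<bound (inj₁ h) = s≤s (<-≤-trans (W₁.hrank<bound h) (m≤m+n W₁.rank-bound W₂.rank-bound))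
  labelled .hrank<bound (inj₂ (inj₁ h)) = s≤s (<-≤-trans (W₂.hrank<bound h) (m≤n+m W₂.rank-bound W₁.rank-bound))
  labelled .hrank<bound (inj₂ (inj₂ _)) = s≤s z≤n
  labelled .head-attached (inj₁ h) = E₁.head-attached-map (W₁.head-attached h)
  labelled .head-attached (inj₂ (inj₁ h)) = E₂.head-attached-map (W₂.head-attached h)
  labelled .head-attached (inj₂ (inj₂ true)) = inj₂ (inj₂ tt) , _ , refl , iL⊸c
  labelled .head-attached (inj₂ (inj₂ false)) = inj₂ (inj₂ tt) , _ , refl , iL⊸a
  labelled .tail-attached (inj₁ t) = E₁.tail-attached-map (W₁.tail-attached t)
  labelled .tail-attached (inj₂ (inj₁ t)) = E₂.tail-attached-map (W₂.tail-attached t)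
  labelled .tail-attached (inj₂ (inj₂ _)) = inj₂ (inj₂ tt) , _ , refl , jL⊸b
  labelled .head-fed (inj₁ v) s h eq hi with E₁.head-unmap v eq hi
  ... | (h₀ , refl , hi₀) with W₁.head-fed v (N.shp v) h₀ refl hi₀
  ...   | (g , e) = emb₁ g , trans (nxt-emb₁ g) (cong r₁ e)
  labelled .head-fed (inj₂ (inj₁ v)) s h eq hi with E₂.head-unmap v eq hi
  ... | (h₀ , refl , hi₀) with W₂.head-fed v (M.shp v) h₀ refl hi₀
  ...   | (g , e) = emb₂ g , trans (nxt-emb₂ g) (cong r₂ e)
  labelled .head-fed (inj₂ (inj₂ tt)) s h refl iL⊸c = inj₂ here , refl
  labelled .head-fed (inj₂ (inj₂ tt)) s h refl iL⊸a = let (g , e) = W₁.conclusion in emb₁ g , trans (nxt-emb₁ g) (cong r₁ e)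
  labelled .conclusion = let (g , e) = W₂.conclusion in emb₂ g , trans (nxt-emb₂ g) (cong r₂ e)
  labelled .conclusion-unique g g' e e' with conclusion-from₂ g e | conclusion-from₂ g' e'
  ... | (g₀ , refl , c₀) | (g₁ , refl , c₁) = cong emb₂ (W₂.conclusion-unique g₀ g₁ c₀ c₁)
  labelled .L!-boxEdge (inj₁ v) = E₁.L!-boxEdge-map W₁.L!-boxEdge v
  labelled .L!-boxEdge (inj₂ (inj₁ v)) = E₂.L!-boxEdge-map W₂.L!-boxEdge v
  labelled .L!-boxEdge (inj₂ (inj₂ tt)) _ _ _ ()
  labelled .outer-box (inj₁ t) = E₁.outer-box-map (λ _ → refl) (λ _ → refl) t (W₁.outer-box t)
  labelled .outer-box (inj₂ (inj₁ t)) = E₂.outer-box-map (λ _ → refl) (λ _ → refl) t (W₂.outer-box t)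
  labelled .outer-box (inj₂ (inj₂ _)) = inj₁ (refl , refl)

isRight : TailKind → Bool
isRight kR⊸c = true
isRight kR⊗c = true
isRight kR∀c = true
isRight kR!c = true
isRight _ = false

RightTail⇒isRight : ∀ {k} → RightTail k → isRight k ≡ true
RightTail⇒isRight rR⊸ = refl
RightTail⇒isRight rR⊗ = refl
RightTail⇒isRight rR∀ = refl
RightTail⇒isRight rR! = refl

LeftTail⇒¬isRight : ∀ {k} → LeftTail k → isRight k ≡ false
LeftTail⇒¬isRight lR⊸a = refl
LeftTail⇒¬isRight lL⊸b = refl
LeftTail⇒¬isRight lL⊗a = refl
LeftTail⇒¬isRight lL⊗b = refl
LeftTail⇒¬isRight lL∀a = refl
LeftTail⇒¬isRight lXa = refl
LeftTail⇒¬isRight lXb = refl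
LeftTail⇒¬isRight lDa = refl
LeftTail⇒¬isRight lNa = refl
LeftTail⇒¬isRight lL!a = refl

module cut-labelling {Γ Δ : List Form} {A B : Form} (d₁ : Γ ⊢ A) (d₂ : A ∷ Δ ⊢ B)
  (w₁ : OpenWellLabelled A (onet d₁)) (w₂ : OpenWellLabelled B (onet d₂)) where
  private
    module N = ONet (onet d₁)
    module M = ONet (onet d₂)
    module W₁ = OpenWellLabelled w₁
    module W₂ = OpenWellLabelled w₂
    o = onet (cut {Γ} {Δ} {A} {B} d₁ d₂)
    module O = ONet o
  open OpenWellLabelled
  module E₁ = Embedding {shp = N.shp} {O.shp} {N.outer} {N.dep} {O.outer} {O.dep} inj₁ inj₁ inj₁ (λ _ → refl)
  module E₂ = Embedding {shp = M.shp} {O.shp} {M.outer} {M.dep} {O.outer} {O.dep} inj₂ inj₂ inj₂ (λ _ → refl)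

  c₀ : N.T ⊎ Pos Γ
  c₀ = proj₁ W₁.conclusion

  right-cut : Bool
  right-cut = [ isRight ∘ W₁.tkind , (λ _ → false) ]′ c₀

  -- If the cut formula is introduced on the right by the first premise, the
  -- cut edge runs from the first premise into the second, so the first is
  -- ranked above the second; otherwise the other way round.
  shift₁ shift₂ : Bool → ℕ
  shift₁ true = suc W₂.rank-bound
  shift₁ false = 1
  shift₂ true = 1
  shift₂ false = suc W₁.rank-bound

  labels′ : Labelling O.T O.H
  labels′ = record
    { tkind = [ W₁.tkind , W₂.tkind ]′
    ; hkind = [ W₁.hkind , W₂.hkind ]′
    ; trank = [ (shift₁ right-cut +_) ∘ W₁.trank , (shift₂ right-cut +_) ∘ W₂.trank ]′
    ; hrank = [ (shift₁ right-cut +_) ∘ W₁.hrank , (shift₂ right-cut +_) ∘ W₂.hrank ]′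
    ; tdepth = [ W₁.tdepth , W₂.tdepth ]′
    ; hdepth = [ W₁.hdepth , W₂.hdepth ]′
    ; ttype = [ W₁.ttype , W₂.ttype ]′
    ; htype = [ W₁.htype , W₂.htype ]′ }

  embedded₁ : LabellingMap W₁.labels labels′ inj₁ inj₁ 0 (shift₁ right-cut)
  embedded₁ = record { tkind≡ = λ _ → refl ; hkind≡ = λ _ → refl ; trank≡ = λ _ → refl ; hrank≡ = λ _ → refl
                     ; tdepth≡ = λ _ → refl ; hdepth≡ = λ _ → refl ; ttype≡ = λ _ → refl ; htype≡ = λ _ → refl }

  embedded₂ : LabellingMap W₂.labels labels′ inj₂ inj₂ 0 (shift₂ right-cut)
  embedded₂ = record { tkind≡ = λ _ → refl ; hkind≡ = λ _ → refl ; trank≡ = λ _ → refl ; hrank≡ = λ _ → refl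
                     ; tdepth≡ = λ _ → refl ; hdepth≡ = λ _ → refl ; ttype≡ = λ _ → refl ; htype≡ = λ _ → refl }

  r₂ : M.H ⊎ ⊤ → O.H ⊎ ⊤
  r₂ = route inj₂ (inj₂ tt)

  cut-head : O.H ⊎ ⊤
  cut-head = r₂ (M.nxt (inj₂ here))

  r₁ : N.H ⊎ ⊤ → O.H ⊎ ⊤
  r₁ = route inj₁ cut-head

  emb₁ : N.T ⊎ Pos Γ → O.T ⊎ Pos (Γ ++ Δ)
  emb₁ (inj₁ t) = inj₁ (inj₁ t)
  emb₁ (inj₂ q) = inj₂ (injˡ Γ q)

  nxt-emb₁ : ∀ g → O.nxt (emb₁ g) ≡ r₁ (N.nxt g)
  nxt-emb₁ (inj₁ t) = refl
  nxt-emb₁ (inj₂ q) rewrite splitPos-injˡ Γ {Δ} q = refl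

  emb₂ : M.T ⊎ Pos (A ∷ Δ) → O.T ⊎ Pos (Γ ++ Δ)
  emb₂ (inj₁ t) = inj₁ (inj₂ t)
  emb₂ (inj₂ here) = emb₁ c₀
  emb₂ (inj₂ (there q)) = inj₂ (injʳ Γ q)

  nxt-emb₂ : ∀ g → O.nxt (emb₂ g) ≡ r₂ (M.nxt g)
  nxt-emb₂ (inj₁ t) = refl
  nxt-emb₂ (inj₂ here) = trans (nxt-emb₁ c₀) (cong r₁ (proj₂ W₁.conclusion))
  nxt-emb₂ (inj₂ (there q)) rewrite splitPos-injʳ Γ {Δ} q = refl

  hdepth′ : O.H ⊎ ⊤ → ℕ
  hdepth′ = [ Labelling.hdepth labels′ , (λ _ → 0) ]′

  htype′ : O.H ⊎ ⊤ → Skel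
  htype′ = [ Labelling.htype labels′ , (λ _ → skeleton B) ]′

  hdepth-r₂ : ∀ x → hdepth′ (r₂ x) ≡ [ W₂.hdepth , (λ _ → 0) ]′ x
  hdepth-r₂ = route-≡ inj₂ _ hdepth′ (λ _ → refl) refl
  htype-r₂ : ∀ x → htype′ (r₂ x) ≡ [ W₂.htype , (λ _ → skeleton B) ]′ x
  htype-r₂ = route-≡ inj₂ _ htype′ (λ _ → refl) refl
  hdepth-r₁ : ∀ x → hdepth′ (r₁ x) ≡ [ W₁.hdepth , (λ _ → 0) ]′ x
  hdepth-r₁ = route-≡ inj₁ _ hdepth′ (λ _ → refl) (trans (hdepth-r₂ (M.nxt (inj₂ here))) (sym (W₂.depth-nxt (inj₂ here))))
  htype-r₁ : ∀ x → htype′ (r₁ x) ≡ [ W₁.htype , (λ _ → skeleton A) ]′ x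
  htype-r₁ = route-≡ inj₁ _ htype′ (λ _ → refl) (trans (htype-r₂ (M.nxt (inj₂ here))) (sym (W₂.type-nxt (inj₂ here))))

  right-cut-kind : ∀ t → N.nxt (inj₁ t) ≡ inj₂ tt → right-cut ≡ isRight (W₁.tkind t)
  right-cut-kind t e = cong [ isRight ∘ W₁.tkind , (λ _ → false) ]′ (sym (W₁.conclusion-unique (inj₁ t) c₀ e (proj₂ W₁.conclusion)))

  across-right : ∀ b → b ≡ true → ∀ x y → x < W₂.rank-bound → shift₂ b + x < shift₁ b + y
  across-right .true refl x y lt = s≤s (≤-trans lt (m≤m+n W₂.rank-bound y))

  across-left : ∀ b → b ≡ false → ∀ x y → x < W₁.rank-bound → shift₁ b + x < shift₂ b + y
  across-left .false refl x y lt = s≤s (≤-trans lt (m≤m+n W₁.rank-bound y))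

  shift₁≤ : ∀ b → shift₁ b ≤ suc W₂.rank-bound
  shift₁≤ true = ≤-refl
  shift₁≤ false = s≤s z≤n

  shift₂≤ : ∀ b → shift₂ b ≤ suc W₁.rank-bound
  shift₂≤ true = s≤s z≤n
  shift₂≤ false = ≤-refl

  bound : ℕ
  bound = (suc W₂.rank-bound + W₁.rank-bound) + (suc W₁.rank-bound + W₂.rank-bound)

  below-bound₁ : ∀ {x} → x < W₁.rank-bound → shift₁ right-cut + x < bound
  below-bound₁ lt = <-≤-trans (+-mono-≤-< (shift₁≤ right-cut) lt) (m≤m+n _ _)

  below-bound₂ : ∀ {x} → x < W₂.rank-bound → shift₂ right-cut + x < bound
  below-bound₂ lt = <-≤-trans (+-mono-≤-< (shift₂≤ right-cut) lt) (m≤n+m _ (suc W₂.rank-bound + W₁.rank-bound))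

  conclusion-from₂ : ∀ g → O.nxt g ≡ inj₂ tt → Σ (M.T ⊎ Pos (A ∷ Δ)) λ g₀ → (g ≡ emb₂ g₀) × (M.nxt g₀ ≡ inj₂ tt)
  conclusion-from₂ (inj₁ (inj₂ t)) e = inj₁ t , refl , proj₁ (route-inj₂ inj₂ _ _ e)
  conclusion-from₂ (inj₁ (inj₁ t)) e =
    let (e₀ , eh) = route-inj₂ inj₁ cut-head _ e in
    inj₂ here , cong emb₁ (W₁.conclusion-unique (inj₁ t) c₀ e₀ (proj₂ W₁.conclusion)) , proj₁ (route-inj₂ inj₂ _ _ eh)
  conclusion-from₂ (inj₂ p) e with splitPos Γ p in es
  ... | inj₁ q =
    let (e₀ , eh) = route-inj₂ inj₁ cut-head _ e in
    inj₂ here ,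
    trans (cong inj₂ (splitPos-injective Γ p (injˡ Γ q) (trans es (sym (splitPos-injˡ Γ q)))))
          (cong emb₁ (W₁.conclusion-unique (inj₂ q) c₀ e₀ (proj₂ W₁.conclusion))) ,
    proj₁ (route-inj₂ inj₂ _ _ eh)
  ... | inj₂ q = inj₂ (there q) , cong inj₂ (splitPos-injective Γ p (injʳ Γ q) (trans es (sym (splitPos-injʳ Γ q)))) ,
                 proj₁ (route-inj₂ inj₂ _ _ e)

  labelled : OpenWellLabelled B o
  labelled .labels = labels′
  labelled .coherent (inj₁ v) = Coherent-map embedded₁ (N.shp v) (W₁.coherent v)
  labelled .coherent (inj₂ v) = Coherent-map embedded₂ (M.shp v) (W₂.coherent v)
  labelled .tdepth-dep (inj₁ t) = W₁.tdepth-dep t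
  labelled .tdepth-dep (inj₂ t) = W₂.tdepth-dep t
  labelled .depth-nxt (inj₁ (inj₁ t)) = trans (W₁.depth-nxt (inj₁ t)) (sym (hdepth-r₁ (N.nxt (inj₁ t))))
  labelled .depth-nxt (inj₁ (inj₂ t)) = trans (W₂.depth-nxt (inj₁ t)) (sym (hdepth-r₂ (M.nxt (inj₁ t))))
  labelled .depth-nxt (inj₂ p) with splitPos Γ p
  ... | inj₁ q = trans (W₁.depth-nxt (inj₂ q)) (sym (hdepth-r₁ (N.nxt (inj₂ q))))
  ... | inj₂ q = trans (W₂.depth-nxt (inj₂ (there q))) (sym (hdepth-r₂ (M.nxt (inj₂ (there q)))))
  labelled .type-nxt (inj₁ (inj₁ t)) = trans (W₁.type-nxt (inj₁ t)) (sym (htype-r₁ (N.nxt (inj₁ t))))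
  labelled .type-nxt (inj₁ (inj₂ t)) = trans (W₂.type-nxt (inj₁ t)) (sym (htype-r₂ (M.nxt (inj₁ t))))
  labelled .type-nxt (inj₂ p) with splitPos Γ p in e
  ... | inj₁ q = trans (cong skeleton (trans (formulaAt-splitPos Γ p) (cong [ formulaAt , formulaAt ]′ e)))
                       (trans (W₁.type-nxt (inj₂ q)) (sym (htype-r₁ (N.nxt (inj₂ q)))))
  ... | inj₂ q = trans (cong skeleton (trans (formulaAt-splitPos Γ p) (cong [ formulaAt , formulaAt ]′ e)))
                       (trans (W₂.type-nxt (inj₂ (there q))) (sym (htype-r₂ (M.nxt (inj₂ (there q))))))
  labelled .rank-right (inj₁ t) h e rt with route-inj₁ inj₁ cut-head (N.nxt (inj₁ t)) h e
  ... | inj₁ (h₀ , e₀ , refl) = +-monoʳ-< (shift₁ right-cut) (W₁.rank-right t h₀ e₀ rt)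
  ... | inj₂ (e₀ , eh) with route-inj₁ inj₂ (inj₂ tt) (M.nxt (inj₂ here)) h eh
  ...   | inj₁ (h₁ , _ , refl) =
          across-right right-cut (trans (right-cut-kind t e₀) (RightTail⇒isRight rt)) (W₂.hrank h₁) (W₁.trank t) (W₂.hrank<bound h₁)
  ...   | inj₂ (_ , ())
  labelled .rank-right (inj₂ t) h e rt with route-inj₁ inj₂ (inj₂ tt) (M.nxt (inj₁ t)) h e
  ... | inj₁ (h₀ , e₀ , refl) = +-monoʳ-< (shift₂ right-cut) (W₂.rank-right t h₀ e₀ rt)
  ... | inj₂ (_ , ())
  labelled .rank-left (inj₁ t) h e lt lh with route-inj₁ inj₁ cut-head (N.nxt (inj₁ t)) h e
  ... | inj₁ (h₀ , e₀ , refl) = +-monoʳ-< (shift₁ right-cut) (W₁.rank-left t h₀ e₀ lt lh)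
  ... | inj₂ (e₀ , eh) with route-inj₁ inj₂ (inj₂ tt) (M.nxt (inj₂ here)) h eh
  ...   | inj₁ (h₁ , _ , refl) =
          across-left right-cut (trans (right-cut-kind t e₀) (LeftTail⇒¬isRight lt)) (W₁.trank t) (W₂.hrank h₁) (W₁.trank<bound t)
  ...   | inj₂ (_ , ())
  labelled .rank-left (inj₂ t) h e lt lh with route-inj₁ inj₂ (inj₂ tt) (M.nxt (inj₁ t)) h e
  ... | inj₁ (h₀ , e₀ , refl) = +-monoʳ-< (shift₂ right-cut) (W₂.rank-left t h₀ e₀ lt lh)
  ... | inj₂ (_ , ())
  labelled .rank-bound = bound
  labelled .trank<bound (inj₁ t) = below-bound₁ (W₁.trank<bound t)
  labelled .trank<bound (inj₂ t) = below-bound₂ (W₂.trank<bound t)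
  labelled .hrank<bound (inj₁ h) = below-bound₁ (W₁.hrank<bound h)
  labelled .hrank<bound (inj₂ h) = below-bound₂ (W₂.hrank<bound h)
  labelled .head-attached (inj₁ h) = E₁.head-attached-map (W₁.head-attached h)
  labelled .head-attached (inj₂ h) = E₂.head-attached-map (W₂.head-attached h)
  labelled .tail-attached (inj₁ t) = E₁.tail-attached-map (W₁.tail-attached t)
  labelled .tail-attached (inj₂ t) = E₂.tail-attached-map (W₂.tail-attached t)
  labelled .head-fed (inj₁ v) s h eq hi with E₁.head-unmap v eq hi
  ... | (h₀ , refl , hi₀) with W₁.head-fed v (N.shp v) h₀ refl hi₀
  ...   | (g , e) = emb₁ g , trans (nxt-emb₁ g) (cong r₁ e)
  labelled .head-fed (inj₂ v) s h eq hi with E₂.head-unmap v eq hi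
  ... | (h₀ , refl , hi₀) with W₂.head-fed v (M.shp v) h₀ refl hi₀
  ...   | (g , e) = emb₂ g , trans (nxt-emb₂ g) (cong r₂ e)
  labelled .conclusion = let (g , e) = W₂.conclusion in emb₂ g , trans (nxt-emb₂ g) (cong r₂ e)
  labelled .conclusion-unique g g' e e' with conclusion-from₂ g e | conclusion-from₂ g' e'
  ... | (g₀ , refl , c₀′) | (g₁ , refl , c₁′) = cong emb₂ (W₂.conclusion-unique g₀ g₁ c₀′ c₁′)
  labelled .L!-boxEdge (inj₁ v) = E₁.L!-boxEdge-map W₁.L!-boxEdge v
  labelled .L!-boxEdge (inj₂ v) = E₂.L!-boxEdge-map W₂.L!-boxEdge v
  labelled .outer-box (inj₁ t) = E₁.outer-box-map (λ _ → refl) (λ _ → refl) t (W₁.outer-box t)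
  labelled .outer-box (inj₂ t) = E₂.outer-box-map (λ _ → refl) (λ _ → refl) t (W₂.outer-box t)

module P-labelling {Γ : List Form} {B : Form} (d : Γ ⊢ B) (w : OpenWellLabelled B (onet d)) where
  private
    module N = ONet (onet d)
    module W = OpenWellLabelled w
    o = onet (P {Γ} {B} d)
    module O = ONet o
  open OpenWellLabelled
  open Embedding {shp = N.shp} {O.shp} {N.outer} {N.dep} {O.outer} {O.dep} inj₁ inj₁ inj₁ (λ _ → refl)

  box-edge : O.T
  box-edge = inj₂ (inj₁ tt)

  labels′ : Labelling O.T O.H
  labels′ = record
    { tkind = [ W.tkind , [ (λ _ → kR!c) , (λ _ → kL!a) ]′ ]′
    ; hkind = [ W.hkind , [ (λ _ → hR!a) , (λ _ → hL!c) ]′ ]′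
    ; trank = [ suc ∘ W.trank , (λ _ → 0) ]′
    ; hrank = [ suc ∘ W.hrank , (λ _ → 0) ]′
    ; tdepth = [ suc ∘ W.tdepth , [ (λ _ → 0) , (λ _ → 1) ]′ ]′
    ; hdepth = [ suc ∘ W.hdepth , [ (λ _ → 1) , (λ _ → 0) ]′ ]′
    ; ttype = [ W.ttype , [ (λ _ → s! (skeleton B)) , (λ i → skeleton (formulaAt i)) ]′ ]′
    ; htype = [ W.htype , [ (λ _ → skeleton B) , (λ i → s! (skeleton (formulaAt i))) ]′ ]′ }

  embedded : LabellingMap W.labels labels′ inj₁ inj₁ 1 1
  embedded = record { tkind≡ = λ _ → refl ; hkind≡ = λ _ → refl ; trank≡ = λ _ → refl ; hrank≡ = λ _ → refl
                    ; tdepth≡ = λ _ → refl ; hdepth≡ = λ _ → refl ; ttype≡ = λ _ → refl ; htype≡ = λ _ → refl }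

  r : N.H ⊎ ⊤ → O.H ⊎ ⊤
  r = route inj₁ (inj₁ (inj₂ (inj₁ tt)))

  emb : N.T ⊎ Pos Γ → O.T ⊎ Pos (map !_ Γ)
  emb (inj₁ t) = inj₁ (inj₁ t)
  emb (inj₂ i) = inj₁ (inj₂ (inj₂ i))

  nxt-emb : ∀ g → O.nxt (emb g) ≡ r (N.nxt g)
  nxt-emb (inj₁ t) = refl
  nxt-emb (inj₂ i) = refl

  hdepth′ : O.H ⊎ ⊤ → ℕ
  hdepth′ = [ Labelling.hdepth labels′ , (λ _ → 0) ]′

  htype′ : O.H ⊎ ⊤ → Skel
  htype′ = [ Labelling.htype labels′ , (λ _ → skeleton (! B)) ]′

  hdepth-r : ∀ x → hdepth′ (r x) ≡ suc ([ W.hdepth , (λ _ → 0) ]′ x)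
  hdepth-r = route-≡ inj₁ _ hdepth′ (λ _ → refl) refl

  htype-r : ∀ x → htype′ (r x) ≡ [ W.htype , (λ _ → skeleton B) ]′ x
  htype-r = route-≡ inj₁ _ htype′ (λ _ → refl) refl

  not-conclusion : ∀ x → r x ≢ inj₂ tt
  not-conclusion x e with route-inj₂ inj₁ _ x e
  ... | (_ , ())

  conclusion-new : ∀ g → O.nxt g ≡ inj₂ tt → g ≡ inj₁ box-edge
  conclusion-new (inj₁ (inj₁ t)) e = ⊥-elim (not-conclusion _ e)
  conclusion-new (inj₁ (inj₂ (inj₁ tt))) e = refl
  conclusion-new (inj₁ (inj₂ (inj₂ i))) e = ⊥-elim (not-conclusion _ e)

  labelled : OpenWellLabelled (! B) o
  labelled .labels = labels′
  labelled .coherent (inj₁ v) = Coherent-map embedded (N.shp v) (W.coherent v)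
  labelled .coherent (inj₂ (inj₁ _)) = refl , refl , refl , refl
  labelled .coherent (inj₂ (inj₂ i)) = refl , refl , refl , refl , refl , refl , refl , refl
  labelled .tdepth-dep (inj₁ t) = cong suc (W.tdepth-dep t)
  labelled .tdepth-dep (inj₂ (inj₁ _)) = refl
  labelled .tdepth-dep (inj₂ (inj₂ _)) = refl
  labelled .depth-nxt (inj₁ (inj₁ t)) = trans (cong suc (W.depth-nxt (inj₁ t))) (sym (hdepth-r (N.nxt (inj₁ t))))
  labelled .depth-nxt (inj₁ (inj₂ (inj₁ _))) = refl
  labelled .depth-nxt (inj₁ (inj₂ (inj₂ i))) = trans (cong suc (W.depth-nxt (inj₂ i))) (sym (hdepth-r (N.nxt (inj₂ i))))
  labelled .depth-nxt (inj₂ p) = refl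
  labelled .type-nxt (inj₁ (inj₁ t)) = trans (W.type-nxt (inj₁ t)) (sym (htype-r (N.nxt (inj₁ t))))
  labelled .type-nxt (inj₁ (inj₂ (inj₁ _))) = refl
  labelled .type-nxt (inj₁ (inj₂ (inj₂ i))) = trans (W.type-nxt (inj₂ i)) (sym (htype-r (N.nxt (inj₂ i))))
  labelled .type-nxt (inj₂ p) = cong skeleton (formulaAt-unmapPos Γ p)
  labelled .rank-right (inj₁ t) h e rt with route-inj₁ inj₁ _ (N.nxt (inj₁ t)) h e
  ... | inj₁ (h₀ , e₀ , refl) = s≤s (W.rank-right t h₀ e₀ rt)
  ... | inj₂ (_ , refl) = s≤s z≤n
  labelled .rank-right (inj₂ (inj₁ _)) h () _
  labelled .rank-right (inj₂ (inj₂ i)) h e ()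
  labelled .rank-left (inj₁ t) h e lt lh with route-inj₁ inj₁ _ (N.nxt (inj₁ t)) h e
  ... | inj₁ (h₀ , e₀ , refl) = s≤s (W.rank-left t h₀ e₀ lt lh)
  ... | inj₂ (_ , refl) with lh
  ...   | ()
  labelled .rank-left (inj₂ (inj₁ _)) h () _ _
  labelled .rank-left (inj₂ (inj₂ i)) h e lt lh with route-inj₁ inj₁ _ (N.nxt (inj₂ i)) h e
  ... | inj₁ (h₀ , e₀ , refl) = s≤s z≤n
  ... | inj₂ (_ , refl) with lh
  ...   | ()
  labelled .rank-bound = suc W.rank-bound
  labelled .trank<bound (inj₁ t) = s≤s (W.trank<bound t)
  labelled .trank<bound (inj₂ _) = s≤s z≤n
  labelled .hrank<bound (inj₁ h) = s≤s (W.hrank<bound h)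
  labelled .hrank<bound (inj₂ _) = s≤s z≤n
  labelled .head-attached (inj₁ h) = head-attached-map (W.head-attached h)
  labelled .head-attached (inj₂ (inj₁ tt)) = inj₂ (inj₁ tt) , _ , refl , iR!a
  labelled .head-attached (inj₂ (inj₂ i)) = inj₂ (inj₂ i) , _ , refl , iL!c
  labelled .tail-attached (inj₁ t) = tail-attached-map (W.tail-attached t)
  labelled .tail-attached (inj₂ (inj₁ tt)) = inj₂ (inj₁ tt) , _ , refl , jR!c
  labelled .tail-attached (inj₂ (inj₂ i)) = inj₂ (inj₂ i) , _ , refl , jL!a
  labelled .head-fed (inj₁ v) s h eq hi with head-unmap v eq hi
  ... | (h₀ , refl , hi₀) with W.head-fed v (N.shp v) h₀ refl hi₀
  ...   | (g , e) = emb g , trans (nxt-emb g) (cong r e)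
  labelled .head-fed (inj₂ (inj₁ tt)) s h refl iR!a = let (g , e) = W.conclusion in emb g , trans (nxt-emb g) (cong r e)
  labelled .head-fed (inj₂ (inj₂ i)) s h refl iL!c = inj₂ (mapPos i) , cong (inj₁ ∘ inj₂ ∘ inj₂) (unmapPos-mapPos Γ i)
  labelled .conclusion = inj₁ box-edge , refl
  labelled .conclusion-unique g g' e e' = trans (conclusion-new g e) (sym (conclusion-new g' e'))
  labelled .L!-boxEdge (inj₁ v) = L!-boxEdge-map W.L!-boxEdge v
  labelled .L!-boxEdge (inj₂ (inj₁ _)) _ _ _ ()
  labelled .L!-boxEdge (inj₂ (inj₂ i)) _ _ _ refl = inj₂ (inj₁ tt) , inj₂ (inj₁ tt) , refl
  labelled .outer-box (inj₁ t) with W.outer-box t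
  ... | inj₁ (on , d0) = inj₂ (box-edge , cong (just ∘ Maybe.maybe inj₁ box-edge) on , cong suc d0 , inj₂ (inj₁ tt) , inj₂ (inj₁ tt) , refl)
  ... | inj₂ (c , oj , d , be) = inj₂ (inj₁ c , cong (just ∘ Maybe.maybe inj₁ box-edge) oj , cong suc d , boxEdge-map be)
  labelled .outer-box (inj₂ (inj₁ _)) = inj₁ (refl , refl)
  labelled .outer-box (inj₂ (inj₂ i)) = inj₂ (box-edge , refl , refl , inj₂ (inj₁ tt) , inj₂ (inj₁ tt) , refl)

openWellLabelled : ∀ {Γ B} (d : Γ ⊢ B) → OpenWellLabelled B (onet d)
openWellLabelled ax = ax-labelled
openWellLabelled (cut d₁ d₂) = cut-labelling.labelled d₁ d₂ (openWellLabelled d₁) (openWellLabelled d₂)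
openWellLabelled (exch Γ d) = exch-labelled Γ d (openWellLabelled d)
openWellLabelled (W d) = W-labelled d (openWellLabelled d)
openWellLabelled (X d) = X-labelled d (openWellLabelled d)
openWellLabelled (R⊸ d) = R⊸-labelling.labelled d (openWellLabelled d)
openWellLabelled (L⊸ d₁ d₂) = L⊸-labelling.labelled d₁ d₂ (openWellLabelled d₁) (openWellLabelled d₂)
openWellLabelled (R⊗ d₁ d₂) = R⊗-labelling.labelled d₁ d₂ (openWellLabelled d₁) (openWellLabelled d₂)
openWellLabelled (L⊗ d) = L⊗-labelled d (openWellLabelled d)
openWellLabelled (P d) = P-labelling.labelled d (openWellLabelled d)
openWellLabelled (D d) = D-labelled d (openWellLabelled d)
openWellLabelled (N d) = N-labelled d (openWellLabelled d)
openWellLabelled (R∀ d) = R∀-labelling.labelled d (openWellLabelled d)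
openWellLabelled (L∀ d) = L∀-labelled d (openWellLabelled d)

module PN-labelling {Γ : List Form} {B : Form} (d : Γ ⊢ B) where
  private
    module N = ONet (onet d)
    module W = OpenWellLabelled (openWellLabelled d)
    G = PN d
    module G = Net G
  open WellLabelled
  open Embedding {shp = N.shp} {G.shp} {N.outer} {N.dep} {G.outer} {G.dep} inj₁ inj₁ id (λ _ → refl)

  labels′ : Labelling G.E G.H
  labels′ = record
    { tkind = [ W.tkind , (λ _ → kP) ]′
    ; hkind = [ W.hkind , (λ _ → hC) ]′
    ; trank = [ W.trank , (λ _ → 0) ]′
    ; hrank = [ W.hrank , (λ _ → 0) ]′
    ; tdepth = [ W.tdepth , (λ _ → 0) ]′
    ; hdepth = [ W.hdepth , (λ _ → 0) ]′
    ; ttype = [ W.ttype , (λ p → skeleton (formulaAt p)) ]′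
    ; htype = [ W.htype , (λ _ → skeleton B) ]′ }

  embedded : LabellingMap W.labels labels′ inj₁ inj₁ 0 0
  embedded = record { tkind≡ = λ _ → refl ; hkind≡ = λ _ → refl ; trank≡ = λ _ → refl ; hrank≡ = λ _ → refl
                    ; tdepth≡ = λ _ → refl ; hdepth≡ = λ _ → refl ; ttype≡ = λ _ → refl ; htype≡ = λ _ → refl }

  labelled : WellLabelled G
  labelled .labels = labels′
  labelled .coherent v = Coherent-map embedded (N.shp v) (W.coherent v)
  labelled .tdepth-dep (inj₁ t) = W.tdepth-dep t
  labelled .tdepth-dep (inj₂ _) = refl
  labelled .depth-nxt = W.depth-nxt
  labelled .type-nxt = W.type-nxt
  labelled .rank-right (inj₁ t) rt nc with N.nxt (inj₁ t) in eq
  ... | inj₁ h = W.rank-right t h eq rt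
  ... | inj₂ _ = ⊥-elim (nc refl)
  labelled .rank-right (inj₂ p) ()
  labelled .rank-left (inj₁ t) lt lh with N.nxt (inj₁ t) in eq
  ... | inj₁ h = W.rank-left t h eq lt lh
  ... | inj₂ _ with lh
  ...   | ()
  labelled .rank-left (inj₂ p) ()
  labelled .head-attached (inj₁ h) = inj₂ (head-attached-map (W.head-attached h))
  labelled .head-attached (inj₂ tt) = inj₁ refl
  labelled .tail-attached (inj₁ t) = inj₂ (tail-attached-map (W.tail-attached t))
  labelled .tail-attached (inj₂ p) = inj₁ (p , refl)
  labelled .head-fed v s h eq hi with head-unmap v eq hi
  ... | (h₀ , refl , hi₀) = W.head-fed v (N.shp v) h₀ refl hi₀
  labelled .L!-boxEdge = L!-boxEdge-map W.L!-boxEdge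
  labelled .outer-box (inj₁ t) = outer-box-map (λ _ → refl) (λ _ → refl) t (W.outer-box t)
  labelled .outer-box (inj₂ _) = inj₁ (refl , refl)

wellLabelled : ∀ {Γ B} (d : Γ ⊢ B) → WellLabelled (PN d)
wellLabelled = PN-labelling.labelled

lemma4 : ∀ {Γ : List Form} {B : Form} (d : Γ ⊢ B) (n : ℕ) (e : Net.E (PN d))
    → BoxEdge (PN d) e
    → Net.dep (PN d) e ≤ n
    → (∀ c → IsCut (PN d) c → Net.dep (PN d) c < n → WCut (PN d) c)
    → (∀ c → IsCut (PN d) c → Net.dep (PN d) c ≡ n → WCut (PN d) c ⊎ BangCut (PN d) c)
    → (Canonical (PN d) e (eSeq (Net.dep (PN d) e))
         × (∀ U → Canonical (PN d) e U → U ≡ eSeq (Net.dep (PN d) e)))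
      × (Copy (PN d) e (eSeq (Net.dep (PN d) e)) sE
         × (∀ t → Copy (PN d) e (eSeq (Net.dep (PN d) e)) t → t ≡ sE))
lemma4 d n e be dl cuts-below cuts-at =
  (canonical-exists (dep e) e refl dl , λ U → canonical-unique dl) ,
  (copy-exists e be dl , copy-unique e _ be dl)
  where
  open Paths (PN d) (wellLabelled d) n cuts-below cuts-at
  open Net (PN d) using (dep)
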